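{- Let $p$ be the mesh pattern $(12,R)$ with $R=\{(0,0),(0,1),(1,0),(1,2),(2,1),(2,2)\}$, let $E(t,u)=\sum_{n\ge0}t^n\sum_{\sigma\in K_n}u^{p(\sigma)}$, and let $P(t)=\sum_{n\ge0}|K_n(p)|t^n$. Then $$P(t)=\frac{(1+t)^2A(t)}{(1+t)^2+t^2\big(A(t)-t-1\big)A(t)},\qquad E(t,u)=\frac{(1+t)^2A(t)}{1+t\Big(2+t\big(1+(1-u)(A(t)-t-1)A(t)\big)\Big)}.$$ The initial terms of $E(t,u)$ are $1+t+2t^4+14t^5+(88+2u)t^6+(632+14u)t^7+(5152+90u)t^8+\cdots$.
   Context: A permutation $\sigma=\sigma_1\cdots\sigma_n$ of $\{1,\dots,n\}$ is a king permutation if $|\sigma_{i+1}-\sigma_i|>1$ for all $1\le i\le n-1$. $K_n$ is the set of king permutations of length $n$ ($K_0$ = the empty permutation, $K_1=\{1\}$) and $A(t)=\sum_{n\ge0}|K_n|t^n$ (known to equal $\sum_{n\ge0}n!\,t^n(1-t)^n/(1+t)^n$). For a mesh pattern $p=(12,R)$ with $R\subseteq\{0,1,2\}^2$, an occurrence of $p$ in $\sigma\in S_n$ is a pair of positions $i_1<i_2$ with $\sigma_{i_1}<\sigma_{i_2}$ such that for every $(x,y)\in R$ there is no position $m$ with $i_x<m<i_{x+1}$ and $v_y<\sigma_m<v_{y+1}$, where $i_0=0$, $i_3=n+1$, $v_0=0$, $v_1=\sigma_{i_1}$, $v_2=\sigma_{i_2}$, $v_3=n+1$ (first coordinate of a box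 indexes positions, second values). $p(\sigma)$ is the number of occurrences of $p$ in $\sigma$; $K_n(p)$ is the set of king $n$-permutations with $p(\sigma)=0$. -}

module Defs where

open import Data.Nat as ℕ using (ℕ; zero; suc; _∸_; _≡ᵇ_; _<ᵇ_; ∣_-_∣)
open import Data.Bool using (Bool; true; false; not; _∧_; if_then_else_)
open import Data.List using (List; []; _∷_; [_]; map; concatMap; filterᵇ; upTo; length; foldr)
open import Data.Product using (_×_; _,_)
open import Data.Fin using (Fin; toℕ; zero; suc)
open import Data.Integer as ℤ using (ℤ; +_)

-- Permutations of {1,…,n}, written in one-line notation σ₁σ₂…σₙ as lists.

range : ℕ → List ℕ
range n = map suc (upTo n)

elemᵇ : ℕ → List ℕ → Bool
elemᵇ x []       = false
elemᵇ x (y ∷ ys) = if x ≡ᵇ y then true else elemᵇ x ys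

arrangements : ℕ → List ℕ → ℕ → List (List ℕ)
arrangements n used zero    = [ [] ]
arrangements n used (suc k) =
  concatMap (λ x → map (x ∷_) (arrangements n (x ∷ used) k))
            (filterᵇ (λ x → not (elemᵇ x used)) (range n))

perms : ℕ → List (List ℕ)
perms n = arrangements n [] n

allᵇ : {A : Set} → (A → Bool) → List A → Bool
allᵇ p []       = true
allᵇ p (x ∷ xs) = p x ∧ allᵇ p xs

isKing : List ℕ → Bool
isKing []           = true
isKing (a ∷ [])     = true
isKing (a ∷ b ∷ xs) = (1 <ᵇ ∣ a - b ∣) ∧ isKing (b ∷ xs)

K : ℕ → List (List ℕ)
K n = filterᵇ isKing (perms n)

-- σ_i, positions 1-indexed (value 0 outside 1..n, never used)
at : List ℕ → ℕ → ℕ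
at []       _             = 0
at (x ∷ xs) zero          = 0
at (x ∷ xs) (suc zero)    = x
at (x ∷ xs) (suc (suc i)) = at xs (suc i)

-- i_0 = 0, i_1, i_2, i_3 = n+1   (index given as ℕ in 0..3)
bnd : ℕ → ℕ → ℕ → ℕ → ℕ
bnd n a b zero                = 0
bnd n a b (suc zero)          = a
bnd n a b (suc (suc zero))    = b
bnd n a b (suc (suc (suc _))) = suc n

boxEmpty : List ℕ → ℕ → ℕ → Fin 3 × Fin 3 → Bool
boxEmpty σ i₁ i₂ (x , y) =
  allᵇ (λ m → not ( (bnd n i₁ i₂ (toℕ x) <ᵇ m) ∧ (m <ᵇ bnd n i₁ i₂ (suc (toℕ x)))
                 ∧ (bnd n v₁ v₂ (toℕ y) <ᵇ at σ m) ∧ (at σ m <ᵇ bnd n v₁ v₂ (suc (toℕ y)))))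
      (range n)
  where
  n = length σ
  v₁ = at σ i₁
  v₂ = at σ i₂

isOcc : List (Fin 3 × Fin 3) → List ℕ → ℕ → ℕ → Bool
isOcc R σ i₁ i₂ = (i₁ <ᵇ i₂) ∧ (at σ i₁ <ᵇ at σ i₂) ∧ allᵇ (boxEmpty σ i₁ i₂) R

occ : List (Fin 3 × Fin 3) → List ℕ → ℕ
occ R σ = length (filterᵇ (λ b → b)
            (concatMap (λ i → map (λ j → isOcc R σ i j) (range (length σ)))
                       (range (length σ))))

Rp : List (Fin 3 × Fin 3)
Rp = (f0 , f0) ∷ (f0 , f1) ∷ (f1 , f0) ∷ (f1 , f2) ∷ (f2 , f1) ∷ (f2 , f2) ∷ []
  where
  f0 f1 f2 : Fin 3
  f0 = zero
  f1 = suc zero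
  f2 = suc (suc zero)

Series : Set
Series = ℕ → ℤ

sumℤ : List ℤ → ℤ
sumℤ = foldr ℤ._+_ (+ 0)

_⊕_ _⊖_ _⊛_ : Series → Series → Series
(f ⊕ g) n = f n ℤ.+ g n
(f ⊖ g) n = f n ℤ.- g n
(f ⊛ g) n = sumℤ (map (λ k → f k ℤ.* g (n ∸ k)) (upTo (suc n)))

one tt : Series
one zero    = + 1
one (suc _) = + 0
tt (suc zero) = + 1
tt _          = + 0

-- Bivariate series in t and u: coefficient of t^n u^k is F n k.
Series₂ : Set
Series₂ = ℕ → ℕ → ℤ

_⊕₂_ _⊖₂_ _⊛₂_ : Series₂ → Series₂ → Series₂
(F ⊕₂ G) n k = F n k ℤ.+ G n k
(F ⊖₂ G) n k = F n k ℤ.- G n k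
(F ⊛₂ G) n k = sumℤ (map (λ i → sumℤ (map (λ j → F i j ℤ.* G (n ∸ i) (k ∸ j))
                                          (upTo (suc k))))
                         (upTo (suc n)))

lift : Series → Series₂
lift f n zero    = f n
lift f n (suc _) = + 0

one₂ t₂ u₂ two₂ : Series₂
one₂ = lift one
t₂   = lift tt
two₂ = one₂ ⊕₂ one₂
u₂ zero (suc zero) = + 1
u₂ _    _          = + 0

A : Series
A n = + length (K n)

P : Series
P n = + length (filterᵇ (λ σ → occ Rp σ ≡ᵇ 0) (K n))

E : Series₂
E n k = + length (filterᵇ (λ σ → occ Rp σ ≡ᵇ k) (K n))

onePt² : Series
onePt² = (one ⊕ tt) ⊛ (one ⊕ tt)

numP denP : Series
numP = onePt² ⊛ A
denP = onePt² ⊕ ((tt ⊛ tt) ⊛ (((A ⊖ tt) ⊖ one) ⊛ A))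

numE denE : Series₂
numE = lift numP
denE = one₂ ⊕₂ (t₂ ⊛₂ (two₂ ⊕₂ (t₂ ⊛₂ (one₂ ⊕₂
         ((one₂ ⊖₂ u₂) ⊛₂ lift (((A ⊖ tt) ⊖ one) ⊛ A))))))

Einit : Series₂
Einit 0 0 = + 1
Einit 1 0 = + 1
Einit 4 0 = + 2
Einit 5 0 = + 14
Einit 6 0 = + 88
Einit 6 1 = + 2
Einit 7 0 = + 632
Einit 7 1 = + 14
Einit 8 0 = + 5152
Einit 8 1 = + 90
Einit _ _ = + 0

-- An occurrence (i, j) of p in a permutation σ splits σ as a skew sum α ⊟ μ ⊟ γ in which the block μ,
-- running from position i to position j, starts with its minimum and ends with its maximum (framed); it
-- contributes exactly one occurrence, and occurrences never straddle blocks. Splitting again inside γ until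
-- γ avoids p gives a unique such decomposition, and for king permutations the junctions of the skew sum are
-- automatically far apart. So king permutations with k + 1 occurrences correspond bijectively to triples
-- (one with k occurrences, a framed one, an avoiding one): E_{k+1} = E_k M P and A = P + A M P, where M
-- counts framed king permutations. Stripping a leading 1 and/or a trailing maximum from king permutations of
-- length b ≥ 2 gives A_b = M_b + 2 M_{b+1} + M_{b+2}, i.e. M (1+t)² = t² (A − t − 1), and eliminating M
-- yields both formulas.

module Submission where

open import Defs
open import Algebra.Bundles using (CommutativeRing)
open import Algebra.Structures using (IsCommutativeRing)
open import Data.Bool using (Bool; true; false; not; _∧_; T)
open import Data.Bool.Properties using (T-∧; ∧-assoc)
open import Data.Empty using (⊥; ⊥-elim)
import Data.Integer as ℤ
import Data.Integer.Properties as ℤ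
open import Data.List using (List; []; _∷_; [_]; map; concatMap; filterᵇ; upTo; length; _++_; _∷ʳ_; cartesianProduct; initLast; _∷ʳ′_)
open import Data.List.Properties
  using (length-++; length-++-sucʳ; length-map; length-upTo; map-applyUpTo; map-upTo; map-∘; map-++; map-cong; map-cong-local; map-id; map-id-local;
         map-injective; ++-assoc; ++-identityʳ; ∷-injective; ∷-injectiveˡ; ∷-injectiveʳ; ∷ʳ-injectiveˡ; upTo-∷ʳ; filter-≐; filter-all)
open import Data.List.Membership.Propositional using (_∈_; _∉_; find; lose)
open import Data.List.Membership.Propositional.Properties
  using (∈-map⁺; ∈-map⁻; ∈-upTo⁺; ∈-upTo⁻; ∈-filter⁺; ∈-filter⁻; ∈-concatMap⁺; ∈-concatMap⁻; ∈-cartesianProduct⁺; ∈-cartesianProduct⁻;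
         ∈-++⁺ˡ; ∈-++⁺ʳ; ∈-++⁻; ∈-∃++)
open import Data.List.Membership.Propositional.Properties.WithK using (unique∧set⇒bag)
open import Data.List.Relation.Binary.BagAndSetEquality using (∼bag⇒↭)
open import Data.List.Relation.Binary.Permutation.Propositional.Properties using (↭-length)
open import Data.List.Relation.Unary.All as All using (All; []; _∷_)
import Data.List.Relation.Unary.All.Properties as All
open import Data.List.Relation.Unary.Any using (here; there)
open import Data.List.Relation.Unary.Unique.Propositional using (Unique; []; _∷_)
import Data.List.Relation.Unary.Unique.Propositional.Properties as Unique
open import Data.Maybe using (Maybe; just; nothing)
open import Data.Nat using (ℕ; zero; suc; pred; _+_; _*_; _∸_; _≡ᵇ_; _<ᵇ_; _≤_; _<_; z≤n; s≤s; _≤?_; _≟_; ∣_-_∣)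
import Data.Nat as ℕ
open import Data.Nat.Properties
open import Algebra.Properties.CommutativeSemigroup +-commutativeSemigroup using () renaming (interchange to +-interchange)
open import Data.List.Membership.DecPropositional _≟_ using (_∈?_)
open import Data.Product using (_×_; _,_; proj₁; proj₂; ∃; Σ)
open import Data.Sum using (_⊎_; inj₁; inj₂)
open import Function using (_∘_; _⇔_; mk⇔; Equivalence)
open import Level using (0ℓ)
open import Relation.Nullary using (¬_; yes; no)
open import Relation.Nullary.Decidable using (T?)
open import Relation.Binary.PropositionalEquality using (_≡_; _≢_; refl; sym; trans; cong; cong₂; subst; subst₂; module ≡-Reasoning)
import Relation.Binary.Reasoning.Setoid as SetoidReasoning

module PowerSeries where

  open import Data.Integer using (ℤ; +_; -_; _-_) renaming (_+_ to _+ᶻ_; _*_ to _*ᶻ_)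
  open import Data.Integer.Tactic.RingSolver using (solve-∀)

  ∑< : ℕ → (ℕ → ℤ) → ℤ
  ∑< n h = sumℤ (map h (upTo n))

  sumℤ-++ : ∀ xs ys → sumℤ (xs ++ ys) ≡ sumℤ xs +ᶻ sumℤ ys
  sumℤ-++ []       ys = sym (ℤ.+-identityˡ (sumℤ ys))
  sumℤ-++ (x ∷ xs) ys = trans (cong (x +ᶻ_) (sumℤ-++ xs ys)) (sym (ℤ.+-assoc x (sumℤ xs) (sumℤ ys)))

  sumℤ-+ : ∀ {A : Set} (a b : A → ℤ) xs → sumℤ (map (λ x → a x +ᶻ b x) xs) ≡ sumℤ (map a xs) +ᶻ sumℤ (map b xs)
  sumℤ-+ a b []       = refl
  sumℤ-+ a b (x ∷ xs) = trans (cong (a x +ᶻ b x +ᶻ_) (sumℤ-+ a b xs)) (interchange (a x) (b x) _ _)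
    where
    interchange : ∀ p q r s → p +ᶻ q +ᶻ (r +ᶻ s) ≡ p +ᶻ r +ᶻ (q +ᶻ s)
    interchange = solve-∀

  sumℤ-swap : ∀ {A B : Set} (w : A → B → ℤ) xs ys →
    sumℤ (map (λ x → sumℤ (map (w x) ys)) xs) ≡ sumℤ (map (λ y → sumℤ (map (λ x → w x y) xs)) ys)
  sumℤ-swap w []       ys = sym (sumℤ-zero ys)
    where
    sumℤ-zero : ∀ ys → sumℤ (map (λ _ → + 0) ys) ≡ + 0
    sumℤ-zero []       = refl
    sumℤ-zero (_ ∷ ys) = trans (ℤ.+-identityˡ _) (sumℤ-zero ys)
  sumℤ-swap w (x ∷ xs) ys = trans (cong (sumℤ (map (w x) ys) +ᶻ_) (sumℤ-swap w xs ys))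
    (sym (sumℤ-+ (w x) (λ y → sumℤ (map (λ x → w x y) xs)) ys))

  ∑<-suc : ∀ n h → ∑< (suc n) h ≡ h 0 +ᶻ ∑< n (h ∘ suc)
  ∑<-suc n h = cong (λ xs → h 0 +ᶻ sumℤ xs) (trans (map-applyUpTo suc h n) (sym (map-upTo (h ∘ suc) n)))

  ∑<-sucʳ : ∀ n h → ∑< (suc n) h ≡ ∑< n h +ᶻ h n
  ∑<-sucʳ n h = begin
    sumℤ (map h (upTo (suc n)))               ≡⟨ cong (sumℤ ∘ map h) (sym (upTo-∷ʳ n)) ⟩
    sumℤ (map h (upTo n ++ [ n ]))            ≡⟨ cong sumℤ (map-++ h (upTo n) [ n ]) ⟩
    sumℤ (map h (upTo n) ++ [ h n ])          ≡⟨ sumℤ-++ (map h (upTo n)) [ h n ] ⟩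
    ∑< n h +ᶻ (h n +ᶻ + 0)                    ≡⟨ cong (∑< n h +ᶻ_) (ℤ.+-identityʳ (h n)) ⟩
    ∑< n h +ᶻ h n                             ∎
    where open ≡-Reasoning

  ∑<-cong : ∀ n {h h′} → (∀ k → k < n → h k ≡ h′ k) → ∑< n h ≡ ∑< n h′
  ∑<-cong zero    eq = refl
  ∑<-cong (suc n) {h} {h′} eq = begin
    ∑< (suc n) h      ≡⟨ ∑<-sucʳ n h ⟩
    ∑< n h +ᶻ h n     ≡⟨ cong₂ _+ᶻ_ (∑<-cong n (λ k k<n → eq k (m≤n⇒m≤1+n k<n))) (eq n ≤-refl) ⟩
    ∑< n h′ +ᶻ h′ n   ≡⟨ sym (∑<-sucʳ n h′) ⟩
    ∑< (suc n) h′     ∎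
    where open ≡-Reasoning

  ∑<-zero : ∀ n {h} → (∀ j → j < n → h j ≡ + 0) → ∑< n h ≡ + 0
  ∑<-zero zero    h≡0 = refl
  ∑<-zero (suc n) {h} h≡0 = begin
    ∑< (suc n) h        ≡⟨ ∑<-sucʳ n h ⟩
    ∑< n h +ᶻ h n       ≡⟨ cong₂ _+ᶻ_ (∑<-zero n (λ j j<n → h≡0 j (m≤n⇒m≤1+n j<n))) (h≡0 n ≤-refl) ⟩
    + 0                 ∎
    where open ≡-Reasoning

  -- A record rather than a Π-type, so that Agda does not unfold ⊛ when inferring the arguments of ring laws.
  infix 4 _≋_
  record _≋_ (f g : Series) : Set where
    constructor coeffwise
    field coeff : ∀ n → f n ≡ g n
  open _≋_ public

  ≋-refl : ∀ {f} → f ≋ f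
  ≋-refl = coeffwise λ _ → refl

  ≋-sym : ∀ {f g} → f ≋ g → g ≋ f
  ≋-sym f≋g = coeffwise λ n → sym (coeff f≋g n)

  ≋-trans : ∀ {f g h} → f ≋ g → g ≋ h → f ≋ h
  ≋-trans f≋g g≋h = coeffwise λ n → trans (coeff f≋g n) (coeff g≋h n)

  zeroˢ : Series
  zeroˢ _ = + 0

  -ˢ_ : Series → Series
  (-ˢ f) n = - f n

  scale : ℤ → Series → Series
  scale c f n = c *ᶻ f n

  shift : Series → Series
  shift f n = f (suc n)

  ⊛-zeroth : ∀ f g → (f ⊛ g) 0 ≡ f 0 *ᶻ g 0
  ⊛-zeroth f g = ℤ.+-identityʳ (f 0 *ᶻ g 0)

  ⊛-sucˡ : ∀ f g n → (f ⊛ g) (suc n) ≡ f 0 *ᶻ g (suc n) +ᶻ (shift f ⊛ g) n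
  ⊛-sucˡ f g n = ∑<-suc (suc n) (λ k → f k *ᶻ g (suc n ∸ k))

  ⊛-sucʳ : ∀ f g n → (f ⊛ g) (suc n) ≡ (f ⊛ shift g) n +ᶻ f (suc n) *ᶻ g 0
  ⊛-sucʳ f g n = trans (∑<-sucʳ (suc n) (λ k → f k *ᶻ g (suc n ∸ k)))
    (cong₂ _+ᶻ_ (∑<-cong (suc n) (λ k k≤n → cong (λ m → f k *ᶻ g m) (+-∸-assoc 1 (≤-pred k≤n))))
                (cong (λ m → f (suc n) *ᶻ g m) (n∸n≡0 n)))

  ⊛-cong : ∀ {f f′ g g′} → f ≋ f′ → g ≋ g′ → f ⊛ g ≋ f′ ⊛ g′
  ⊛-cong f≋f′ g≋g′ = coeffwise λ n → cong sumℤ (map-cong (λ k → cong₂ _*ᶻ_ (coeff f≋f′ k) (coeff g≋g′ (n ∸ k))) (upTo (suc n)))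

  ⊛-comm : ∀ f g → f ⊛ g ≋ g ⊛ f
  ⊛-comm f g = coeffwise (go f g)
    where
    go : ∀ f g n → (f ⊛ g) n ≡ (g ⊛ f) n
    go f g zero    = trans (⊛-zeroth f g) (trans (ℤ.*-comm (f 0) (g 0)) (sym (⊛-zeroth g f)))
    go f g (suc n) = begin
      (f ⊛ g) (suc n)                        ≡⟨ ⊛-sucˡ f g n ⟩
      f 0 *ᶻ g (suc n) +ᶻ (shift f ⊛ g) n    ≡⟨ cong₂ _+ᶻ_ (ℤ.*-comm (f 0) (g (suc n))) (go (shift f) g n) ⟩
      g (suc n) *ᶻ f 0 +ᶻ (g ⊛ shift f) n    ≡⟨ ℤ.+-comm (g (suc n) *ᶻ f 0) _ ⟩
      (g ⊛ shift f) n +ᶻ g (suc n) *ᶻ f 0    ≡⟨ sym (⊛-sucʳ g f n) ⟩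
      (g ⊛ f) (suc n)                        ∎
      where open ≡-Reasoning

  ⊛-zeroˡ : ∀ f → zeroˢ ⊛ f ≋ zeroˢ
  ⊛-zeroˡ f = coeffwise go
    where
    go : ∀ n → (zeroˢ ⊛ f) n ≡ + 0
    go zero    = trans (⊛-zeroth zeroˢ f) (ℤ.*-zeroˡ (f 0))
    go (suc n) = begin
      (zeroˢ ⊛ f) (suc n)                    ≡⟨ ⊛-sucˡ zeroˢ f n ⟩
      + 0 *ᶻ f (suc n) +ᶻ (zeroˢ ⊛ f) n      ≡⟨ cong₂ _+ᶻ_ (ℤ.*-zeroˡ (f (suc n))) (go n) ⟩
      + 0                                    ∎
      where open ≡-Reasoning

  ⊛-identityˡ : ∀ f → one ⊛ f ≋ f
  ⊛-identityˡ f = coeffwise go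
    where
    go : ∀ n → (one ⊛ f) n ≡ f n
    go zero    = trans (⊛-zeroth one f) (ℤ.*-identityˡ (f 0))
    go (suc n) = begin
      (one ⊛ f) (suc n)                     ≡⟨ ⊛-sucˡ one f n ⟩
      + 1 *ᶻ f (suc n) +ᶻ (zeroˢ ⊛ f) n     ≡⟨ cong₂ _+ᶻ_ (ℤ.*-identityˡ (f (suc n))) (coeff (⊛-zeroˡ f) n) ⟩
      f (suc n) +ᶻ + 0                      ≡⟨ ℤ.+-identityʳ (f (suc n)) ⟩
      f (suc n)                             ∎
      where open ≡-Reasoning

  ⊛-distribʳ : ∀ f g h → (g ⊕ h) ⊛ f ≋ (g ⊛ f) ⊕ (h ⊛ f)
  ⊛-distribʳ f = λ g h → coeffwise (go g h)
    where
    go : ∀ g h n → ((g ⊕ h) ⊛ f) n ≡ (g ⊛ f) n +ᶻ (h ⊛ f) n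
    go g h zero    = trans (⊛-zeroth (g ⊕ h) f)
      (trans (ℤ.*-distribʳ-+ (f 0) (g 0) (h 0)) (sym (cong₂ _+ᶻ_ (⊛-zeroth g f) (⊛-zeroth h f))))
    go g h (suc n) = begin
      ((g ⊕ h) ⊛ f) (suc n)                                      ≡⟨ ⊛-sucˡ (g ⊕ h) f n ⟩
      (g 0 +ᶻ h 0) *ᶻ f (suc n) +ᶻ ((shift g ⊕ shift h) ⊛ f) n  ≡⟨ cong₂ _+ᶻ_ (ℤ.*-distribʳ-+ (f (suc n)) (g 0) (h 0)) (go (shift g) (shift h) n) ⟩
      (g 0 *ᶻ f (suc n) +ᶻ h 0 *ᶻ f (suc n)) +ᶻ ((shift g ⊛ f) n +ᶻ (shift h ⊛ f) n)
        ≡⟨ interchange (g 0 *ᶻ f (suc n)) _ _ _ ⟩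
      (g 0 *ᶻ f (suc n) +ᶻ (shift g ⊛ f) n) +ᶻ (h 0 *ᶻ f (suc n) +ᶻ (shift h ⊛ f) n)
        ≡⟨ sym (cong₂ _+ᶻ_ (⊛-sucˡ g f n) (⊛-sucˡ h f n)) ⟩
      (g ⊛ f) (suc n) +ᶻ (h ⊛ f) (suc n)                         ∎
      where
      open ≡-Reasoning
      interchange : ∀ a b c d → (a +ᶻ b) +ᶻ (c +ᶻ d) ≡ (a +ᶻ c) +ᶻ (b +ᶻ d)
      interchange = solve-∀

  ⊛-scaleˡ : ∀ c f g → scale c f ⊛ g ≋ scale c (f ⊛ g)
  ⊛-scaleˡ c f g = coeffwise (go f)
    where
    go : ∀ f n → (scale c f ⊛ g) n ≡ c *ᶻ (f ⊛ g) n
    go f zero    = trans (⊛-zeroth (scale c f) g) (trans (ℤ.*-assoc c (f 0) (g 0)) (cong (c *ᶻ_) (sym (⊛-zeroth f g))))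
    go f (suc n) = begin
      (scale c f ⊛ g) (suc n)                           ≡⟨ ⊛-sucˡ (scale c f) g n ⟩
      c *ᶻ f 0 *ᶻ g (suc n) +ᶻ (scale c (shift f) ⊛ g) n ≡⟨ cong₂ _+ᶻ_ (ℤ.*-assoc c (f 0) (g (suc n))) (go (shift f) n) ⟩
      c *ᶻ (f 0 *ᶻ g (suc n)) +ᶻ c *ᶻ (shift f ⊛ g) n   ≡⟨ sym (ℤ.*-distribˡ-+ c _ _) ⟩
      c *ᶻ (f 0 *ᶻ g (suc n) +ᶻ (shift f ⊛ g) n)         ≡⟨ cong (c *ᶻ_) (sym (⊛-sucˡ f g n)) ⟩
      c *ᶻ (f ⊛ g) (suc n)                              ∎
      where open ≡-Reasoning

  shift-⊛ : ∀ f g → shift (f ⊛ g) ≋ scale (f 0) (shift g) ⊕ (shift f ⊛ g)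
  shift-⊛ f g = coeffwise (⊛-sucˡ f g)

  ⊛-assoc : ∀ f g h → (f ⊛ g) ⊛ h ≋ f ⊛ (g ⊛ h)
  ⊛-assoc f g h = coeffwise (go f g)
    where
    go : ∀ f g n → ((f ⊛ g) ⊛ h) n ≡ (f ⊛ (g ⊛ h)) n
    go f g zero = begin
      ((f ⊛ g) ⊛ h) 0           ≡⟨ trans (⊛-zeroth (f ⊛ g) h) (cong (_*ᶻ h 0) (⊛-zeroth f g)) ⟩
      f 0 *ᶻ g 0 *ᶻ h 0          ≡⟨ ℤ.*-assoc (f 0) (g 0) (h 0) ⟩
      f 0 *ᶻ (g 0 *ᶻ h 0)        ≡⟨ sym (trans (⊛-zeroth f (g ⊛ h)) (cong (f 0 *ᶻ_) (⊛-zeroth g h))) ⟩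
      (f ⊛ (g ⊛ h)) 0           ∎
      where open ≡-Reasoning
    go f g (suc n) = begin
      ((f ⊛ g) ⊛ h) (suc n)
        ≡⟨ ⊛-sucˡ (f ⊛ g) h n ⟩
      (f ⊛ g) 0 *ᶻ h (suc n) +ᶻ (shift (f ⊛ g) ⊛ h) n
        ≡⟨ cong₂ _+ᶻ_ (cong (_*ᶻ h (suc n)) (⊛-zeroth f g)) (coeff (⊛-cong (shift-⊛ f g) (≋-refl {h})) n) ⟩
      f 0 *ᶻ g 0 *ᶻ h (suc n) +ᶻ ((scale (f 0) (shift g) ⊕ (shift f ⊛ g)) ⊛ h) n
        ≡⟨ cong (f 0 *ᶻ g 0 *ᶻ h (suc n) +ᶻ_) (trans (coeff (⊛-distribʳ h (scale (f 0) (shift g)) (shift f ⊛ g)) n)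
             (cong₂ _+ᶻ_ (coeff (⊛-scaleˡ (f 0) (shift g) h) n) (go (shift f) g n))) ⟩
      f 0 *ᶻ g 0 *ᶻ h (suc n) +ᶻ (f 0 *ᶻ (shift g ⊛ h) n +ᶻ (shift f ⊛ (g ⊛ h)) n)
        ≡⟨ factor (f 0) (g 0) (h (suc n)) _ _ ⟩
      f 0 *ᶻ (g 0 *ᶻ h (suc n) +ᶻ (shift g ⊛ h) n) +ᶻ (shift f ⊛ (g ⊛ h)) n
        ≡⟨ cong (λ z → f 0 *ᶻ z +ᶻ (shift f ⊛ (g ⊛ h)) n) (sym (⊛-sucˡ g h n)) ⟩
      f 0 *ᶻ (g ⊛ h) (suc n) +ᶻ (shift f ⊛ (g ⊛ h)) n
        ≡⟨ sym (⊛-sucˡ f (g ⊛ h) n) ⟩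
      (f ⊛ (g ⊛ h)) (suc n) ∎
      where
      open ≡-Reasoning
      factor : ∀ a b c x y → a *ᶻ b *ᶻ c +ᶻ (a *ᶻ x +ᶻ y) ≡ a *ᶻ (b *ᶻ c +ᶻ x) +ᶻ y
      factor = solve-∀

  ⊕-⊛-isCommutativeRing : IsCommutativeRing _≋_ _⊕_ _⊛_ -ˢ_ zeroˢ one
  ⊕-⊛-isCommutativeRing = record
    { isRing = record
      { +-isAbelianGroup = record
        { isGroup = record
          { isMonoid = record
            { isSemigroup = record
              { isMagma = record
                { isEquivalence = record { refl = ≋-refl ; sym = ≋-sym ; trans = ≋-trans }
                ; ∙-cong = λ f≋f′ g≋g′ → coeffwise λ n → cong₂ _+ᶻ_ (coeff f≋f′ n) (coeff g≋g′ n)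
                }
              ; assoc = λ f g h → coeffwise λ n → ℤ.+-assoc (f n) (g n) (h n)
              }
            ; identity = (λ f → coeffwise λ n → ℤ.+-identityˡ (f n)) , (λ f → coeffwise λ n → ℤ.+-identityʳ (f n))
            }
          ; inverse = (λ f → coeffwise λ n → ℤ.+-inverseˡ (f n)) , (λ f → coeffwise λ n → ℤ.+-inverseʳ (f n))
          ; ⁻¹-cong = λ f≋g → coeffwise λ n → cong -_ (coeff f≋g n)
          }
        ; comm = λ f g → coeffwise λ n → ℤ.+-comm (f n) (g n)
        }
      ; *-cong = ⊛-cong
      ; *-assoc = ⊛-assoc
      ; *-identity = ⊛-identityˡ , λ f → ≋-trans (⊛-comm f one) (⊛-identityˡ f)
      ; distrib = (λ f g h → ≋-trans (⊛-comm f (g ⊕ h)) (≋-trans (⊛-distribʳ f g h) (coeffwise λ n → cong₂ _+ᶻ_ (coeff (⊛-comm g f) n) (coeff (⊛-comm h f) n))))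
                , ⊛-distribʳ
      }
    ; *-comm = ⊛-comm
    }

  seriesRing : CommutativeRing 0ℓ 0ℓ
  seriesRing = record { isCommutativeRing = ⊕-⊛-isCommutativeRing }

  open CommutativeRing seriesRing public
    using (ring; commutativeSemiring; setoid; zeroʳ; +-cong; +-congˡ; *-congˡ; *-congʳ; -‿inverseˡ)
  open import Algebra.Properties.Ring ring public using (-1*x≈-x; -‿distribʳ-*)
  open import Algebra.Properties.Semiring.Mult (CommutativeRing.semiring seriesRing) using () renaming (_×_ to _×ˢ_)

  -- The semiring solver with ℕ coefficients: con 0, con 1 and con 2 evaluate to zeroˢ, one and one ⊕ one,
  -- the constants occurring in denP and denE.
  decideConstants : ∀ m n → Maybe (m ×ˢ one ≋ n ×ˢ one)
  decideConstants m n with m ℕ.≟ n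
  ... | yes refl = just ≋-refl
  ... | no _     = nothing

  open import Algebra.Solver.Ring.NaturalCoefficients commutativeSemiring decideConstants public
    using (solve; _:=_; _:+_; _:*_; con)

  ⊛[1+t]-zero : ∀ h → (h ⊛ (one ⊕ tt)) 0 ≡ h 0
  ⊛[1+t]-zero h = trans (⊛-zeroth h (one ⊕ tt)) (ℤ.*-identityʳ (h 0))

  shift-1+t : shift (one ⊕ tt) ≋ one
  shift-1+t = coeffwise λ { zero → refl ; (suc _) → refl }

  shift-t : shift tt ≋ one
  shift-t = coeffwise λ { zero → refl ; (suc _) → refl }

  ⊛[1+t]-suc : ∀ h n → (h ⊛ (one ⊕ tt)) (suc n) ≡ h (suc n) +ᶻ h n
  ⊛[1+t]-suc h n = begin
    (h ⊛ (one ⊕ tt)) (suc n)                        ≡⟨ coeff (⊛-comm h (one ⊕ tt)) (suc n) ⟩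
    ((one ⊕ tt) ⊛ h) (suc n)                        ≡⟨ ⊛-sucˡ (one ⊕ tt) h n ⟩
    + 1 *ᶻ h (suc n) +ᶻ (shift (one ⊕ tt) ⊛ h) n    ≡⟨ cong₂ _+ᶻ_ (ℤ.*-identityˡ (h (suc n))) (coeff (≋-trans (⊛-cong shift-1+t (≋-refl {h})) (⊛-identityˡ h)) n) ⟩
    h (suc n) +ᶻ h n                                ∎
    where open ≡-Reasoning

  t⊛-zero : ∀ g → (tt ⊛ g) 0 ≡ + 0
  t⊛-zero g = trans (⊛-zeroth tt g) (ℤ.*-zeroˡ (g 0))

  t⊛-suc : ∀ g n → (tt ⊛ g) (suc n) ≡ g n
  t⊛-suc g n = begin
    (tt ⊛ g) (suc n)                      ≡⟨ ⊛-sucˡ tt g n ⟩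
    + 0 *ᶻ g (suc n) +ᶻ (shift tt ⊛ g) n  ≡⟨ cong₂ _+ᶻ_ (ℤ.*-zeroˡ (g (suc n))) (coeff (≋-trans (⊛-cong shift-t (≋-refl {g})) (⊛-identityˡ g)) n) ⟩
    + 0 +ᶻ g n                            ≡⟨ ℤ.+-identityˡ (g n) ⟩
    g n                                   ∎
    where open ≡-Reasoning

  column : ℕ → Series₂ → Series
  column k F n = F n k

  ⊛₂-by-columns : ∀ F G n k → (F ⊛₂ G) n k ≡ ∑< (suc k) (λ j → (column j F ⊛ column (k ∸ j) G) n)
  ⊛₂-by-columns F G n k = sumℤ-swap (λ i j → F i j *ᶻ G (n ∸ i) (k ∸ j)) (upTo (suc n)) (upTo (suc k))

  column-liftˡ : ∀ f G k → column k (lift f ⊛₂ G) ≋ f ⊛ column k G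
  column-liftˡ f G k = coeffwise λ n → begin
    (lift f ⊛₂ G) n k                                                          ≡⟨ ⊛₂-by-columns (lift f) G n k ⟩
    ∑< (suc k) (λ j → (column j (lift f) ⊛ column (k ∸ j) G) n)                ≡⟨ ∑<-suc k (λ j → (column j (lift f) ⊛ column (k ∸ j) G) n) ⟩
    (f ⊛ column k G) n +ᶻ ∑< k (λ j → (zeroˢ ⊛ column (k ∸ suc j) G) n)        ≡⟨ cong ((f ⊛ column k G) n +ᶻ_) (∑<-zero k (λ j _ → coeff (⊛-zeroˡ (column (k ∸ suc j) G)) n)) ⟩
    (f ⊛ column k G) n +ᶻ + 0                                                  ≡⟨ ℤ.+-identityʳ _ ⟩
    (f ⊛ column k G) n                                                         ∎
    where open ≡-Reasoning

  ∸-suc : ∀ {j k} → j < k → k ∸ j ≡ suc (k ∸ suc j)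
  ∸-suc {zero}  {suc k} _         = refl
  ∸-suc {suc j} {suc k} (s≤s j<k) = ∸-suc j<k

  column-liftʳ : ∀ F g k → column k (F ⊛₂ lift g) ≋ column k F ⊛ g
  column-liftʳ F g k = coeffwise λ n → begin
    (F ⊛₂ lift g) n k                                          ≡⟨ ⊛₂-by-columns F (lift g) n k ⟩
    ∑< (suc k) (h n)                                           ≡⟨ ∑<-sucʳ k (h n) ⟩
    ∑< k (h n) +ᶻ (column k F ⊛ column (k ∸ k) (lift g)) n     ≡⟨ cong₂ _+ᶻ_ (∑<-zero k (vanishes n)) (cong (λ i → (column k F ⊛ column i (lift g)) n) (n∸n≡0 k)) ⟩
    + 0 +ᶻ (column k F ⊛ g) n                                  ≡⟨ ℤ.+-identityˡ _ ⟩
    (column k F ⊛ g) n                                         ∎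
    where
    open ≡-Reasoning
    h : ℕ → ℕ → ℤ
    h n j = (column j F ⊛ column (k ∸ j) (lift g)) n
    vanishes : ∀ n j → j < k → h n j ≡ + 0
    vanishes n j j<k = trans (cong (λ i → (column j F ⊛ column i (lift g)) n) (∸-suc j<k)) (coeff (zeroʳ (column j F)) n)

  [1+t]²-recurrence : ∀ m a → m 0 ≡ + 0 → m 1 ≡ + 0 →
    (∀ b → a b ≡ (m b +ᶻ m (suc b)) +ᶻ (m (suc b) +ᶻ m (suc (suc b))) +ᶻ tt b +ᶻ one b) →
    m ⊛ onePt² ≋ (tt ⊛ tt) ⊛ ((a ⊖ tt) ⊖ one)
  [1+t]²-recurrence m a m₀≡0 m₁≡0 rec = coeffwise λ n → begin
    (m ⊛ onePt²) n                         ≡⟨ coeff (≋-sym (⊛-assoc m (one ⊕ tt) (one ⊕ tt))) n ⟩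
    ((m ⊛ (one ⊕ tt)) ⊛ (one ⊕ tt)) n      ≡⟨ coefficients n ⟩
    (tt ⊛ (tt ⊛ b)) n                      ≡⟨ coeff (≋-sym (⊛-assoc tt tt b)) n ⟩
    ((tt ⊛ tt) ⊛ b) n                      ∎
    where
    open ≡-Reasoning
    b : Series
    b = (a ⊖ tt) ⊖ one
    m[1+t] : Series
    m[1+t] = m ⊛ (one ⊕ tt)
    coefficients : ∀ n → (m[1+t] ⊛ (one ⊕ tt)) n ≡ (tt ⊛ (tt ⊛ b)) n
    coefficients zero = begin
      (m[1+t] ⊛ (one ⊕ tt)) 0     ≡⟨ trans (⊛[1+t]-zero m[1+t]) (⊛[1+t]-zero m) ⟩
      m 0                         ≡⟨ trans m₀≡0 (sym (t⊛-zero (tt ⊛ b))) ⟩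
      (tt ⊛ (tt ⊛ b)) 0           ∎
    coefficients (suc zero) = begin
      (m[1+t] ⊛ (one ⊕ tt)) 1     ≡⟨ ⊛[1+t]-suc m[1+t] 0 ⟩
      m[1+t] 1 +ᶻ m[1+t] 0        ≡⟨ cong₂ _+ᶻ_ (⊛[1+t]-suc m 0) (⊛[1+t]-zero m) ⟩
      m 1 +ᶻ m 0 +ᶻ m 0           ≡⟨ cong₂ _+ᶻ_ (cong₂ _+ᶻ_ m₁≡0 m₀≡0) m₀≡0 ⟩
      + 0                         ≡⟨ sym (trans (t⊛-suc (tt ⊛ b) 0) (t⊛-zero b)) ⟩
      (tt ⊛ (tt ⊛ b)) 1           ∎
    coefficients (suc (suc n)) = begin
      (m[1+t] ⊛ (one ⊕ tt)) (suc (suc n))             ≡⟨ ⊛[1+t]-suc m[1+t] (suc n) ⟩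
      m[1+t] (suc (suc n)) +ᶻ m[1+t] (suc n)          ≡⟨ cong₂ _+ᶻ_ (⊛[1+t]-suc m (suc n)) (⊛[1+t]-suc m n) ⟩
      m (suc (suc n)) +ᶻ m (suc n) +ᶻ (m (suc n) +ᶻ m n) ≡⟨ cancel (m (suc (suc n))) (m (suc n)) (m n) (tt n) (one n) ⟩
      (m n +ᶻ m (suc n)) +ᶻ (m (suc n) +ᶻ m (suc (suc n))) +ᶻ tt n +ᶻ one n - tt n - one n ≡⟨ cong (λ x → x - tt n - one n) (sym (rec n)) ⟩
      b n                                             ≡⟨ sym (trans (t⊛-suc (tt ⊛ b) (suc n)) (t⊛-suc b n)) ⟩
      (tt ⊛ (tt ⊛ b)) (suc (suc n))                   ∎
      where
      cancel : ∀ p q r x y → p +ᶻ q +ᶻ (q +ᶻ r) ≡ (r +ᶻ q) +ᶻ (q +ᶻ p) +ᶻ x +ᶻ y - x - y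
      cancel = solve-∀

  module ≋-Reasoning = SetoidReasoning setoid

open PowerSeries

T-∧⁻ : ∀ {a b} → T (a ∧ b) → T a × T b
T-∧⁻ = Equivalence.to T-∧

T-∧⁺ : ∀ {a b} → T a → T b → T (a ∧ b)
T-∧⁺ p q = Equivalence.from T-∧ (p , q)

T-not⁺ : ∀ {b} → ¬ T b → T (not b)
T-not⁺ {false} _   = _
T-not⁺ {true}  ¬tb = ¬tb _

T-not⁻ : ∀ {b} → T (not b) → ¬ T b
T-not⁻ {false} _ ()

¬T⇒≡false : ∀ {b} → ¬ T b → b ≡ false
¬T⇒≡false {false} _  = refl
¬T⇒≡false {true}  ¬t = ⊥-elim (¬t _)

T-extensional : ∀ {a b} → (T a → T b) → (T b → T a) → a ≡ b
T-extensional {false} {false} _ _ = refl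
T-extensional {false} {true}  _ g = ⊥-elim (g _)
T-extensional {true}  {false} f _ = ⊥-elim (f _)
T-extensional {true}  {true}  _ _ = refl

T-elemᵇ⁻ : ∀ {x xs} → T (elemᵇ x xs) → x ∈ xs
T-elemᵇ⁻ {x} {y ∷ ys} t with x ≡ᵇ y in eq
... | true  = here (≡ᵇ⇒≡ x y (subst T (sym eq) _))
... | false = there (T-elemᵇ⁻ t)

T-elemᵇ⁺ : ∀ {x xs} → x ∈ xs → T (elemᵇ x xs)
T-elemᵇ⁺ {x} {y ∷ ys} x∈ with x ≡ᵇ y in eq | x∈
... | true  | _          = _
... | false | here refl  = ⊥-elim (subst T eq (≡⇒≡ᵇ x x refl))
... | false | there x∈ys = T-elemᵇ⁺ x∈ys

∈-filterᵇ⁻ : ∀ {A : Set} {p : A → Bool} {xs x} → x ∈ filterᵇ p xs → x ∈ xs × T (p x)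
∈-filterᵇ⁻ {p = p} = ∈-filter⁻ (T? ∘ p)

∈-filterᵇ⁺ : ∀ {A : Set} {p : A → Bool} {xs x} → x ∈ xs → T (p x) → x ∈ filterᵇ p xs
∈-filterᵇ⁺ {p = p} = ∈-filter⁺ (T? ∘ p)

filterᵇ-unique : ∀ {A : Set} (p : A → Bool) {xs} → Unique xs → Unique (filterᵇ p xs)
filterᵇ-unique p = Unique.filter⁺ (T? ∘ p)

map-unique-local : ∀ {A B : Set} (f : A → B) {xs : List A} →
  (∀ {x y} → x ∈ xs → y ∈ xs → f x ≡ f y → x ≡ y) → Unique xs → Unique (map f xs)
map-unique-local f {[]}     inj []          = []
map-unique-local f {x ∷ xs} inj (x∉ ∷ uxs) =
  All.tabulate (λ fy∈ fx≡fy → let (y , y∈ , fy≡) = ∈-map⁻ f fy∈ in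
                                All.lookup x∉ y∈ (inj (here refl) (there y∈) (trans fx≡fy fy≡)))
  ∷ map-unique-local f (λ x∈ y∈ → inj (there x∈) (there y∈)) uxs

length-unique-⇔ : ∀ {A : Set} {xs ys : List A} → Unique xs → Unique ys →
  (∀ {z} → z ∈ xs ⇔ z ∈ ys) → length xs ≡ length ys
length-unique-⇔ uxs uys xs⇔ys = ↭-length (∼bag⇒↭ (unique∧set⇒bag uxs uys xs⇔ys))

length-bijection : ∀ {X Y : Set} (f : X → Y) {xs : List X} {ys : List Y} → Unique xs → Unique ys →
  (∀ {x} → x ∈ xs → f x ∈ ys) →
  (∀ {x y} → x ∈ xs → y ∈ xs → f x ≡ f y → x ≡ y) →
  (∀ {y} → y ∈ ys → ∃ λ x → x ∈ xs × f x ≡ y) →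
  length xs ≡ length ys
length-bijection f {xs} {ys} uxs uys into inj onto = trans (sym (length-map f xs))
  (length-unique-⇔ (map-unique-local f inj uxs) uys (mk⇔ to from))
  where
  to : ∀ {y} → y ∈ map f xs → y ∈ ys
  to fx∈ = let (x , x∈ , y≡) = ∈-map⁻ f fx∈ in subst (_∈ ys) (sym y≡) (into x∈)
  from : ∀ {y} → y ∈ ys → y ∈ map f xs
  from y∈ = let (x , x∈ , fx≡y) = onto y∈ in subst (_∈ map f xs) fx≡y (∈-map⁺ f x∈)

-- Permutations of {1, …, n} and king permutations

InRange : ℕ → ℕ → Set
InRange n x = 1 ≤ x × x ≤ n

IsPerm : List ℕ → Set
IsPerm σ = Unique σ × All (InRange (length σ)) σ

range-suc : ∀ n → range (suc n) ≡ 1 ∷ map suc (range n)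
range-suc n = cong (1 ∷_) (trans (map-applyUpTo suc suc n) (trans (sym (map-upTo (suc ∘ suc) n)) (map-∘ (upTo n))))

range-+ : ∀ a b → range (a + b) ≡ range a ++ map (a +_) (range b)
range-+ zero    b = sym (map-id (range b))
range-+ (suc a) b = begin
  range (suc a + b)                                         ≡⟨ range-suc (a + b) ⟩
  1 ∷ map suc (range (a + b))                               ≡⟨ cong (λ r → 1 ∷ map suc r) (range-+ a b) ⟩
  1 ∷ map suc (range a ++ map (a +_) (range b))             ≡⟨ cong (1 ∷_) (map-++ suc (range a) _) ⟩
  1 ∷ (map suc (range a) ++ map suc (map (a +_) (range b))) ≡⟨ cong (λ r → 1 ∷ (map suc (range a) ++ r)) (sym (map-∘ (range b))) ⟩
  1 ∷ map suc (range a) ++ map (suc a +_) (range b)         ≡⟨ cong (_++ map (suc a +_) (range b)) (sym (range-suc a)) ⟩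
  range (suc a) ++ map (suc a +_) (range b)                 ∎
  where open ≡-Reasoning

∈-range⁻ : ∀ {n x} → x ∈ range n → InRange n x
∈-range⁻ x∈ with ∈-map⁻ suc x∈
... | _ , y∈ , refl = s≤s z≤n , ∈-upTo⁻ y∈

∈-range⁺ : ∀ {n x} → InRange n x → x ∈ range n
∈-range⁺ {x = suc x} (_ , x<n) = ∈-map⁺ suc (∈-upTo⁺ x<n)

range-unique : ∀ n → Unique (range n)
range-unique n = Unique.map⁺ suc-injective (Unique.upTo⁺ n)

length-range : ∀ n → length (range n) ≡ n
length-range n = trans (length-map suc (upTo n)) (length-upTo n)

Fresh : ℕ → List ℕ → ℕ → Set
Fresh n used x = InRange n x × x ∉ used

private
  candidates : ℕ → List ℕ → List ℕ
  candidates n used = filterᵇ (λ x → not (elemᵇ x used)) (range n)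

  extensions : ℕ → List ℕ → ℕ → ℕ → List (List ℕ)
  extensions n used k x = map (x ∷_) (arrangements n (x ∷ used) k)

∈-arrangements⁻ : ∀ n used k {σ} → σ ∈ arrangements n used k → length σ ≡ k × Unique σ × All (Fresh n used) σ
∈-arrangements⁻ n used zero    (here refl) = refl , [] , []
∈-arrangements⁻ n used (suc k) σ∈ with find (∈-concatMap⁻ (extensions n used k) {xs = candidates n used} σ∈)
... | x , x∈ , σ∈′ with ∈-map⁻ (x ∷_) σ∈′
... | τ , τ∈ , refl with ∈-arrangements⁻ n (x ∷ used) k τ∈
... | length≡ , uτ , freshτ =
  let (x∈range , x∉used) = ∈-filterᵇ⁻ {p = λ x → not (elemᵇ x used)} x∈ in
  cong suc length≡ ,
  All.map (λ (_ , y∉) x≡y → y∉ (here (sym x≡y))) freshτ ∷ uτ ,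
  (∈-range⁻ x∈range , T-not⁻ x∉used ∘ T-elemᵇ⁺) ∷ All.map (λ (r , y∉) → r , y∉ ∘ there) freshτ

∈-arrangements⁺ : ∀ n used k {σ} → length σ ≡ k → Unique σ → All (Fresh n used) σ → σ ∈ arrangements n used k
∈-arrangements⁺ n used zero    {[]}    refl _ _ = here refl
∈-arrangements⁺ n used (suc k) {x ∷ τ} length≡ (x∉τ ∷ uτ) ((x∈range , x∉used) ∷ freshτ) =
  ∈-concatMap⁺ (extensions n used k)
    (lose (∈-filterᵇ⁺ {p = λ x → not (elemᵇ x used)} (∈-range⁺ x∈range) (T-not⁺ (x∉used ∘ T-elemᵇ⁻)))
          (∈-map⁺ (x ∷_) (∈-arrangements⁺ n (x ∷ used) k (suc-injective length≡) uτ (All.zipWith fresh′ (x∉τ , freshτ)))))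
  where
  fresh′ : ∀ {y} → x ≢ y × Fresh n used y → Fresh n (x ∷ used) y
  fresh′ (x≢y , r , y∉) = r , λ { (here y≡x) → x≢y (sym y≡x) ; (there y∈) → y∉ y∈ }

arrangements-unique : ∀ n used k → Unique (arrangements n used k)
arrangements-unique n used zero    = [] ∷ []
arrangements-unique n used (suc k) = go (candidates n used) (filterᵇ-unique _ (range-unique n))
  where
  go : ∀ xs → Unique xs → Unique (concatMap (extensions n used k) xs)
  go []       _           = []
  go (x ∷ xs) (x∉ ∷ uxs) = Unique.++⁺ (Unique.map⁺ ∷-injectiveʳ (arrangements-unique n (x ∷ used) k)) (go xs uxs)
    λ (σ∈ , σ∈′) → let (τ , _ , σ≡) = ∈-map⁻ (x ∷_) σ∈
                       (y , y∈ , σ∈″) = find (∈-concatMap⁻ (extensions n used k) {xs = xs} σ∈′)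
                       (τ′ , _ , σ≡′) = ∈-map⁻ (y ∷_) σ∈″
                   in All.lookup x∉ y∈ (∷-injectiveˡ (trans (sym σ≡) σ≡′))

∈-perms⁻ : ∀ {n σ} → σ ∈ perms n → length σ ≡ n × IsPerm σ
∈-perms⁻ {n} σ∈ with ∈-arrangements⁻ n [] n σ∈
... | refl , uσ , freshσ = refl , uσ , All.map proj₁ freshσ

∈-perms⁺ : ∀ {n σ} → length σ ≡ n → IsPerm σ → σ ∈ perms n
∈-perms⁺ {n} refl (uσ , rangeσ) = ∈-arrangements⁺ n [] n refl uσ (All.map (_, λ ()) rangeσ)

record KingPerm (n : ℕ) (σ : List ℕ) : Set where
  constructor kingPerm
  field
    length≡ : length σ ≡ n
    perm    : IsPerm σ
    king    : T (isKing σ)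

∈K⁻ : ∀ n {σ} → σ ∈ K n → KingPerm n σ
∈K⁻ n σ∈ with ∈-filterᵇ⁻ {p = isKing} σ∈
... | σ∈perms , kσ = let (length≡ , pσ) = ∈-perms⁻ σ∈perms in kingPerm length≡ pσ kσ

∈K⁺ : ∀ {n σ} → KingPerm n σ → σ ∈ K n
∈K⁺ (kingPerm length≡ pσ kσ) = ∈-filterᵇ⁺ {p = isKing} (∈-perms⁺ length≡ pσ) kσ

K-unique : ∀ n → Unique (K n)
K-unique n = filterᵇ-unique isKing (arrangements-unique n [] n)

-- Occurrences of the mesh pattern

at-++ˡ : ∀ xs ys m → 1 ≤ m → m ≤ length xs → at (xs ++ ys) m ≡ at xs m
at-++ˡ (x ∷ xs) ys 1             _ _         = refl
at-++ˡ (x ∷ xs) ys (suc (suc m)) _ (s≤s m≤) = at-++ˡ xs ys (suc m) (s≤s z≤n) m≤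

at-++ʳ : ∀ xs ys m → at (xs ++ ys) (length xs + suc m) ≡ at ys (suc m)
at-++ʳ []       ys m = refl
at-++ʳ (x ∷ xs) ys m = begin
  at (x ∷ xs ++ ys) (suc (length xs + suc m))   ≡⟨ cong (at (x ∷ xs ++ ys) ∘ suc) (+-suc (length xs) m) ⟩
  at (xs ++ ys) (suc (length xs + m))           ≡⟨ cong (at (xs ++ ys)) (sym (+-suc (length xs) m)) ⟩
  at (xs ++ ys) (length xs + suc m)             ≡⟨ at-++ʳ xs ys m ⟩
  at ys (suc m)                                 ∎
  where open ≡-Reasoning

at-map : ∀ f xs m → 1 ≤ m → m ≤ length xs → at (map f xs) m ≡ f (at xs m)
at-map f (x ∷ xs) 1             _ _         = refl
at-map f (x ∷ xs) (suc (suc m)) _ (s≤s m≤) = at-map f xs (suc m) (s≤s z≤n) m≤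

at-∈ : ∀ xs m → 1 ≤ m → m ≤ length xs → at xs m ∈ xs
at-∈ (x ∷ xs) 1             _ _         = here refl
at-∈ (x ∷ xs) (suc (suc m)) _ (s≤s m≤) = there (at-∈ xs (suc m) (s≤s z≤n) m≤)

∈⇒at : ∀ {xs z} → z ∈ xs → ∃ λ m → (1 ≤ m × m ≤ length xs) × at xs m ≡ z
∈⇒at {x ∷ xs} (here refl) = 1 , (s≤s z≤n , s≤s z≤n) , refl
∈⇒at {x ∷ xs} (there z∈) with ∈⇒at z∈
... | suc m , (_ , m≤) , at≡z = suc (suc m) , (s≤s z≤n , s≤s m≤) , at≡z

at-injective : ∀ {xs} → Unique xs → ∀ {m m′} → 1 ≤ m → m ≤ length xs → 1 ≤ m′ → m′ ≤ length xs →
  at xs m ≡ at xs m′ → m ≡ m′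
at-injective {x ∷ xs} (x∉ ∷ u) {1}             {1}              _ _        _ _         _  = refl
at-injective {x ∷ xs} (x∉ ∷ u) {1}             {suc (suc m′)}   _ _        _ (s≤s m′≤) eq = ⊥-elim (All.lookup x∉ (at-∈ xs (suc m′) (s≤s z≤n) m′≤) eq)
at-injective {x ∷ xs} (x∉ ∷ u) {suc (suc m)}   {1}              _ (s≤s m≤) _ _         eq = ⊥-elim (All.lookup x∉ (at-∈ xs (suc m) (s≤s z≤n) m≤) (sym eq))
at-injective {x ∷ xs} (x∉ ∷ u) {suc (suc m)}   {suc (suc m′)}   _ (s≤s m≤) _ (s≤s m′≤) eq = cong suc (at-injective u (s≤s z≤n) m≤ (s≤s z≤n) m′≤ eq)

at-in-range : ∀ {σ} → IsPerm σ → ∀ m → 1 ≤ m → m ≤ length σ → InRange (length σ) (at σ m)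
at-in-range {σ} pσ m 1≤m m≤n = All.lookup (proj₂ pσ) (at-∈ σ m 1≤m m≤n)

at-distinct : ∀ {σ} → IsPerm σ → ∀ {m k} → 1 ≤ m → m ≤ length σ → 1 ≤ k → k ≤ length σ → m ≢ k → at σ m ≢ at σ k
at-distinct pσ 1≤m m≤n 1≤k k≤n m≢k = m≢k ∘ at-injective (proj₁ pσ) 1≤m m≤n 1≤k k≤n

allᵇ⁻ : ∀ {A : Set} {p : A → Bool} {xs x} → T (allᵇ p xs) → x ∈ xs → T (p x)
allᵇ⁻ {p = p} {y ∷ ys} t (here refl) = proj₁ (T-∧⁻ {p y} t)
allᵇ⁻ {p = p} {y ∷ ys} t (there x∈)  = allᵇ⁻ {p = p} (proj₂ (T-∧⁻ {p y} t)) x∈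

allᵇ⁺ : ∀ {A : Set} {p : A → Bool} {xs} → (∀ {x} → x ∈ xs → T (p x)) → T (allᵇ p xs)
allᵇ⁺ {xs = []}     h = _
allᵇ⁺ {p = p} {y ∷ ys} h = T-∧⁺ {p y} (h (here refl)) (allᵇ⁺ {p = p} (h ∘ there))

-- What the six empty boxes of Rp amount to in a permutation.
record Occurrence (σ : List ℕ) (i j : ℕ) : Set where
  constructor occurrence
  field
    increasing : at σ i < at σ j
    before     : ∀ m → 1 ≤ m → m < i → at σ j < at σ m
    between    : ∀ m → i < m → m < j → at σ i < at σ m × at σ m < at σ j
    after      : ∀ m → j < m → m ≤ length σ → at σ m < at σ i
open Occurrence public

module OccurrenceCharacterisation {σ : List ℕ} (pσ : IsPerm σ) where

  private
    n : ℕ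
    n = length σ

    box : ℕ → ℕ → ℕ → ℕ → Bool
    box a b c d = allᵇ (λ m → not ((a <ᵇ m) ∧ (m <ᵇ b) ∧ (c <ᵇ at σ m) ∧ (at σ m <ᵇ d))) (range n)

    EmptyBox : ℕ → ℕ → ℕ → ℕ → Set
    EmptyBox a b c d = ∀ m → 1 ≤ m → m ≤ n → a < m → m < b → c < at σ m → at σ m < d → ⊥

    box⁻ : ∀ {a b c d} → T (box a b c d) → EmptyBox a b c d
    box⁻ {a} {b} {c} {d} t m 1≤m m≤n a<m m<b c<v v<d =
      T-not⁻ (allᵇ⁻ {p = λ m → not ((a <ᵇ m) ∧ (m <ᵇ b) ∧ (c <ᵇ at σ m) ∧ (at σ m <ᵇ d))} t (∈-range⁺ (1≤m , m≤n)))
        (T-∧⁺ {a <ᵇ m} (<⇒<ᵇ a<m) (T-∧⁺ {m <ᵇ b} (<⇒<ᵇ m<b) (T-∧⁺ {c <ᵇ at σ m} (<⇒<ᵇ c<v) (<⇒<ᵇ v<d))))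

    box⁺ : ∀ {a b c d} → EmptyBox a b c d → T (box a b c d)
    box⁺ {a} {b} {c} {d} empty = allᵇ⁺ {p = λ m → not ((a <ᵇ m) ∧ (m <ᵇ b) ∧ (c <ᵇ at σ m) ∧ (at σ m <ᵇ d))} λ {m} m∈ →
      let (1≤m , m≤n) = ∈-range⁻ m∈ in T-not⁺ λ t →
      let (a<m , b₁) = T-∧⁻ {a <ᵇ m} t ; (m<b , b₂) = T-∧⁻ {m <ᵇ b} b₁ ; (c<v , v<d) = T-∧⁻ {c <ᵇ at σ m} b₂ in
      empty m 1≤m m≤n (<ᵇ⇒< a m a<m) (<ᵇ⇒< m b m<b) (<ᵇ⇒< c _ c<v) (<ᵇ⇒< _ d v<d)

    value-in-range : ∀ m → 1 ≤ m → m ≤ n → InRange n (at σ m)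
    value-in-range = at-in-range pσ

    values-distinct : ∀ {m k} → 1 ≤ m → m ≤ n → 1 ≤ k → k ≤ n → m ≢ k → at σ m ≢ at σ k
    values-distinct = at-distinct pσ

    leaves-box-up : ∀ {a b c d m} → EmptyBox a b c d → 1 ≤ m → m ≤ n → a < m → m < b → c < at σ m → d ≤ at σ m
    leaves-box-up empty 1≤m m≤n a<m m<b c<v = ≮⇒≥ (empty _ 1≤m m≤n a<m m<b c<v)

    leaves-box-down : ∀ {a b c d m} → EmptyBox a b c d → 1 ≤ m → m ≤ n → a < m → m < b → at σ m < d → at σ m ≤ c
    leaves-box-down empty 1≤m m≤n a<m m<b v<d = ≮⇒≥ λ c<v → empty _ 1≤m m≤n a<m m<b c<v v<d

    boxes⇒Occurrence : ∀ {i j} → 1 ≤ i → i < j → j ≤ n → at σ i < at σ j →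
      EmptyBox 0 i 0 (at σ i) → EmptyBox 0 i (at σ i) (at σ j) → EmptyBox i j 0 (at σ i) →
      EmptyBox i j (at σ j) (suc n) → EmptyBox j (suc n) (at σ i) (at σ j) → EmptyBox j (suc n) (at σ j) (suc n) →
      Occurrence σ i j
    boxes⇒Occurrence {i} {j} 1≤i i<j j≤n v₁<v₂ e₀₀ e₀₁ e₁₀ e₁₂ e₂₁ e₂₂ = occurrence v₁<v₂ before′ between′ after′
      where
      1≤j : 1 ≤ j
      1≤j = ≤-trans 1≤i (<⇒≤ i<j)
      i≤n : i ≤ n
      i≤n = ≤-trans (<⇒≤ i<j) j≤n
      ≢v₁ : ∀ {m} → 1 ≤ m → m ≤ n → m ≢ i → at σ i ≢ at σ m
      ≢v₁ 1≤m m≤n m≢i = values-distinct 1≤m m≤n 1≤i i≤n m≢i ∘ sym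
      ≢v₂ : ∀ {m} → 1 ≤ m → m ≤ n → m ≢ j → at σ j ≢ at σ m
      ≢v₂ 1≤m m≤n m≢j = values-distinct 1≤m m≤n 1≤j j≤n m≢j ∘ sym
      before′ : ∀ m → 1 ≤ m → m < i → at σ j < at σ m
      before′ m 1≤m m<i = ≤∧≢⇒< (leaves-box-up e₀₁ 1≤m m≤n 1≤m m<i v₁<v) (≢v₂ 1≤m m≤n (<⇒≢ (<-trans m<i i<j)))
        where
        m≤n : m ≤ n
        m≤n = ≤-trans (<⇒≤ m<i) i≤n
        v₁<v : at σ i < at σ m
        v₁<v = ≤∧≢⇒< (leaves-box-up e₀₀ 1≤m m≤n 1≤m m<i (proj₁ (value-in-range m 1≤m m≤n))) (≢v₁ 1≤m m≤n (<⇒≢ m<i))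
      between′ : ∀ m → i < m → m < j → at σ i < at σ m × at σ m < at σ j
      between′ m i<m m<j =
        ≤∧≢⇒< (leaves-box-up e₁₀ 1≤m m≤n i<m m<j (proj₁ (value-in-range m 1≤m m≤n))) (≢v₁ 1≤m m≤n (<⇒≢ i<m ∘ sym)) ,
        ≤∧≢⇒< (leaves-box-down e₁₂ 1≤m m≤n i<m m<j (s≤s (proj₂ (value-in-range m 1≤m m≤n)))) (≢v₂ 1≤m m≤n (<⇒≢ m<j) ∘ sym)
        where
        1≤m : 1 ≤ m
        1≤m = ≤-trans 1≤i (<⇒≤ i<m)
        m≤n : m ≤ n
        m≤n = ≤-trans (<⇒≤ m<j) j≤n
      after′ : ∀ m → j < m → m ≤ n → at σ m < at σ i
      after′ m j<m m≤n = ≤∧≢⇒< (leaves-box-down e₂₁ 1≤m m≤n j<m (s≤s m≤n) v<v₂) (≢v₁ 1≤m m≤n (<⇒≢ (<-trans i<j j<m) ∘ sym) ∘ sym)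
        where
        1≤m : 1 ≤ m
        1≤m = ≤-trans 1≤j (<⇒≤ j<m)
        v<v₂ : at σ m < at σ j
        v<v₂ = ≤∧≢⇒< (leaves-box-down e₂₂ 1≤m m≤n j<m (s≤s m≤n) (s≤s (proj₂ (value-in-range m 1≤m m≤n)))) (≢v₂ 1≤m m≤n (<⇒≢ j<m ∘ sym) ∘ sym)

  isOcc⇒Occurrence : ∀ {i j} → 1 ≤ i → j ≤ n → T (isOcc Rp σ i j) → i < j × Occurrence σ i j
  isOcc⇒Occurrence {i} {j} 1≤i j≤n t =
    let (i<j , r₁) = T-∧⁻ {i <ᵇ j} t
        (v₁<v₂ , r₂) = T-∧⁻ {v₁ <ᵇ v₂} r₁
        (b₀₀ , r₃) = T-∧⁻ {box 0 i 0 v₁} r₂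
        (b₀₁ , r₄) = T-∧⁻ {box 0 i v₁ v₂} r₃
        (b₁₀ , r₅) = T-∧⁻ {box i j 0 v₁} r₄
        (b₁₂ , r₆) = T-∧⁻ {box i j v₂ (suc n)} r₅
        (b₂₁ , r₇) = T-∧⁻ {box j (suc n) v₁ v₂} r₆
        (b₂₂ , _)  = T-∧⁻ {box j (suc n) v₂ (suc n)} r₇
    in <ᵇ⇒< i j i<j ,
       boxes⇒Occurrence 1≤i (<ᵇ⇒< i j i<j) j≤n (<ᵇ⇒< v₁ v₂ v₁<v₂)
         (box⁻ {0} {i} {0} {v₁} b₀₀) (box⁻ {0} {i} {v₁} {v₂} b₀₁) (box⁻ {i} {j} {0} {v₁} b₁₀)
         (box⁻ {i} {j} {v₂} {suc n} b₁₂) (box⁻ {j} {suc n} {v₁} {v₂} b₂₁) (box⁻ {j} {suc n} {v₂} {suc n} b₂₂)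
    where
    v₁ v₂ : ℕ
    v₁ = at σ i
    v₂ = at σ j

  Occurrence⇒isOcc : ∀ {i j} → i < j → Occurrence σ i j → T (isOcc Rp σ i j)
  Occurrence⇒isOcc {i} {j} i<j o =
    T-∧⁺ {i <ᵇ j} (<⇒<ᵇ i<j) (T-∧⁺ {v₁ <ᵇ v₂} (<⇒<ᵇ (increasing o))
      (T-∧⁺ (box⁺ {0} {i} {0} {v₁} λ m 1≤m _ _ m<i _ v<v₁ → <-asym v<v₁ (<-trans (increasing o) (before o m 1≤m m<i)))
      (T-∧⁺ (box⁺ {0} {i} {v₁} {v₂} λ m 1≤m _ _ m<i _ v<v₂ → <-asym v<v₂ (before o m 1≤m m<i))
      (T-∧⁺ (box⁺ {i} {j} {0} {v₁} λ m _ _ i<m m<j _ v<v₁ → <-asym v<v₁ (proj₁ (between o m i<m m<j)))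
      (T-∧⁺ (box⁺ {i} {j} {v₂} {suc n} λ m _ _ i<m m<j v₂<v _ → <-asym v₂<v (proj₂ (between o m i<m m<j)))
      (T-∧⁺ (box⁺ {j} {suc n} {v₁} {v₂} λ m _ m≤n j<m _ v₁<v _ → <-asym v₁<v (after o m j<m m≤n))
      (T-∧⁺ (box⁺ {j} {suc n} {v₂} {suc n} λ m _ m≤n j<m _ v₂<v _ → <-asym v₂<v (<-trans (after o m j<m m≤n) (increasing o))) _)))))))
    where
    v₁ = at σ i
    v₂ = at σ j

countTrue : List Bool → ℕ
countTrue bs = length (filterᵇ (λ b → b) bs)

countTrue-++ : ∀ bs cs → countTrue (bs ++ cs) ≡ countTrue bs + countTrue cs
countTrue-++ []           cs = refl
countTrue-++ (true ∷ bs)  cs = cong suc (countTrue-++ bs cs)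
countTrue-++ (false ∷ bs) cs = countTrue-++ bs cs

countTrue-none : ∀ bs → All (_≡ false) bs → countTrue bs ≡ 0
countTrue-none []           []            = refl
countTrue-none (false ∷ bs) (_ ∷ bs≡false) = countTrue-none bs bs≡false

countTrue≡0⇒none : ∀ bs → countTrue bs ≡ 0 → All (_≡ false) bs
countTrue≡0⇒none []           _  = []
countTrue≡0⇒none (false ∷ bs) eq = refl ∷ countTrue≡0⇒none bs eq

countTrue≢0⇒some : ∀ bs → countTrue bs ≢ 0 → true ∈ bs
countTrue≢0⇒some []           ≢0 = ⊥-elim (≢0 refl)
countTrue≢0⇒some (true ∷ bs)  ≢0 = here refl
countTrue≢0⇒some (false ∷ bs) ≢0 = there (countTrue≢0⇒some bs ≢0)

countPairs : List ℕ → List ℕ → (ℕ → ℕ → Bool) → ℕ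
countPairs is js F = countTrue (concatMap (λ i → map (F i) js) is)

countPairs-∷ : ∀ i is js F → countPairs (i ∷ is) js F ≡ countTrue (map (F i) js) + countPairs is js F
countPairs-∷ i is js F = countTrue-++ (map (F i) js) (concatMap (λ i → map (F i) js) is)

countPairs-++ˡ : ∀ is is′ js F → countPairs (is ++ is′) js F ≡ countPairs is js F + countPairs is′ js F
countPairs-++ˡ []       is′ js F = refl
countPairs-++ˡ (i ∷ is) is′ js F = begin
  countPairs (i ∷ is ++ is′) js F                                   ≡⟨ countPairs-∷ i (is ++ is′) js F ⟩
  countTrue (map (F i) js) + countPairs (is ++ is′) js F            ≡⟨ cong (countTrue (map (F i) js) +_) (countPairs-++ˡ is is′ js F) ⟩
  countTrue (map (F i) js) + (countPairs is js F + countPairs is′ js F) ≡⟨ sym (+-assoc (countTrue (map (F i) js)) _ _) ⟩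
  countTrue (map (F i) js) + countPairs is js F + countPairs is′ js F ≡⟨ cong (_+ countPairs is′ js F) (sym (countPairs-∷ i is js F)) ⟩
  countPairs (i ∷ is) js F + countPairs is′ js F                    ∎
  where open ≡-Reasoning

countPairs-++ʳ : ∀ is js js′ F → countPairs is (js ++ js′) F ≡ countPairs is js F + countPairs is js′ F
countPairs-++ʳ []       js js′ F = refl
countPairs-++ʳ (i ∷ is) js js′ F = begin
  countPairs (i ∷ is) (js ++ js′) F
    ≡⟨ countPairs-∷ i is (js ++ js′) F ⟩
  countTrue (map (F i) (js ++ js′)) + countPairs is (js ++ js′) F
    ≡⟨ cong₂ _+_ (trans (cong countTrue (map-++ (F i) js js′)) (countTrue-++ (map (F i) js) _)) (countPairs-++ʳ is js js′ F) ⟩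
  (countTrue (map (F i) js) + countTrue (map (F i) js′)) + (countPairs is js F + countPairs is js′ F)
    ≡⟨ +-interchange (countTrue (map (F i) js)) _ _ _ ⟩
  (countTrue (map (F i) js) + countPairs is js F) + (countTrue (map (F i) js′) + countPairs is js′ F)
    ≡⟨ sym (cong₂ _+_ (countPairs-∷ i is js F) (countPairs-∷ i is js′ F)) ⟩
  countPairs (i ∷ is) js F + countPairs (i ∷ is) js′ F
    ∎
  where open ≡-Reasoning

countPairs-cong : ∀ is js {F G} → (∀ {i j} → i ∈ is → j ∈ js → F i j ≡ G i j) → countPairs is js F ≡ countPairs is js G
countPairs-cong []       js F≡G = refl
countPairs-cong (i ∷ is) js {F} {G} F≡G = begin
  countPairs (i ∷ is) js F                               ≡⟨ countPairs-∷ i is js F ⟩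
  countTrue (map (F i) js) + countPairs is js F          ≡⟨ cong₂ _+_ (cong countTrue (map-cong-local (All.tabulate (F≡G (here refl)))))
                                                                      (countPairs-cong is js (F≡G ∘ there)) ⟩
  countTrue (map (G i) js) + countPairs is js G          ≡⟨ sym (countPairs-∷ i is js G) ⟩
  countPairs (i ∷ is) js G                               ∎
  where open ≡-Reasoning

countPairs-none : ∀ is js F → (∀ {i j} → i ∈ is → j ∈ js → F i j ≡ false) → countPairs is js F ≡ 0
countPairs-none is js F F≡false = countTrue-none _ (All.tabulate λ b∈ →
  let (i , i∈ , b∈′) = find (∈-concatMap⁻ (λ i → map (F i) js) {xs = is} b∈)
      (j , j∈ , b≡) = ∈-map⁻ (F i) b∈′
  in trans b≡ (F≡false i∈ j∈))

countPairs≡0⇒none : ∀ is js F → countPairs is js F ≡ 0 → ∀ {i j} → i ∈ is → j ∈ js → F i j ≡ false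
countPairs≡0⇒none is js F ≡0 i∈ j∈ =
  All.lookup (countTrue≡0⇒none _ ≡0) (∈-concatMap⁺ (λ i → map (F i) js) (lose i∈ (∈-map⁺ (F _) j∈)))

countPairs≢0⇒some : ∀ is js F → countPairs is js F ≢ 0 → ∃ λ i → ∃ λ j → i ∈ is × j ∈ js × F i j ≡ true
countPairs≢0⇒some is js F ≢0 =
  let (i , i∈ , true∈) = find (∈-concatMap⁻ (λ i → map (F i) js) {xs = is} (countTrue≢0⇒some _ ≢0))
      (j , j∈ , true≡) = ∈-map⁻ (F i) true∈
  in i , j , i∈ , j∈ , sym true≡

countPairs-map : ∀ (g h : ℕ → ℕ) is js F → countPairs (map g is) (map h js) F ≡ countPairs is js (λ i j → F (g i) (h j))
countPairs-map g h []       js F = refl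
countPairs-map g h (i ∷ is) js F = begin
  countPairs (map g (i ∷ is)) (map h js) F                               ≡⟨ countPairs-∷ (g i) (map g is) (map h js) F ⟩
  countTrue (map (F (g i)) (map h js)) + countPairs (map g is) (map h js) F ≡⟨ cong₂ _+_ (cong countTrue (sym (map-∘ js))) (countPairs-map g h is js F) ⟩
  countTrue (map (F (g i) ∘ h) js) + countPairs is js (λ i j → F (g i) (h j)) ≡⟨ sym (countPairs-∷ i is js (λ i j → F (g i) (h j))) ⟩
  countPairs (i ∷ is) js (λ i j → F (g i) (h j))                          ∎
  where open ≡-Reasoning

countTrue-≡ᵇ : ∀ {c xs} → Unique xs → c ∈ xs → countTrue (map (_≡ᵇ c) xs) ≡ 1
countTrue-≡ᵇ {c} {x ∷ xs} (x∉ ∷ uxs) (here refl) with x ≡ᵇ x in eq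
... | false = ⊥-elim (subst T eq (≡⇒≡ᵇ x x refl))
... | true  = cong suc (countTrue-none _ (All.tabulate λ b∈ →
  let (y , y∈ , b≡) = ∈-map⁻ (_≡ᵇ x) b∈ in trans b≡ (¬T⇒≡false (All.lookup x∉ y∈ ∘ sym ∘ ≡ᵇ⇒≡ y x))))
countTrue-≡ᵇ {c} {x ∷ xs} (x∉ ∷ uxs) (there c∈) with x ≡ᵇ c in eq
... | true  = ⊥-elim (All.lookup x∉ c∈ (≡ᵇ⇒≡ x c (subst T (sym eq) _)))
... | false = countTrue-≡ᵇ uxs c∈

occ≡0⇒noOccurrence : ∀ {σ} → IsPerm σ → occ Rp σ ≡ 0 → ∀ {i j} → 1 ≤ i → i < j → j ≤ length σ → ¬ Occurrence σ i j
occ≡0⇒noOccurrence {σ} pσ occ≡0 1≤i i<j j≤n o =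
  subst T (countPairs≡0⇒none (range (length σ)) (range (length σ)) (isOcc Rp σ) occ≡0
            (∈-range⁺ (1≤i , ≤-trans (<⇒≤ i<j) j≤n)) (∈-range⁺ (≤-trans 1≤i (<⇒≤ i<j) , j≤n)))
    (OccurrenceCharacterisation.Occurrence⇒isOcc pσ i<j o)

occ≢0⇒Occurrence : ∀ {σ} → IsPerm σ → occ Rp σ ≢ 0 → ∃ λ i → ∃ λ j → 1 ≤ i × i < j × j ≤ length σ × Occurrence σ i j
occ≢0⇒Occurrence {σ} pσ occ≢0 with countPairs≢0⇒some (range (length σ)) (range (length σ)) (isOcc Rp σ) occ≢0
... | i , j , i∈ , j∈ , isOcc≡true =
  let (1≤i , _) = ∈-range⁻ i∈
      (_ , j≤n) = ∈-range⁻ j∈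
      (i<j , o) = OccurrenceCharacterisation.isOcc⇒Occurrence pσ 1≤i j≤n (subst T (sym isOcc≡true) _)
  in i , j , 1≤i , i<j , j≤n , o

-- Skew sums

infixr 5 _⊟_
_⊟_ : List ℕ → List ℕ → List ℕ
x ⊟ y = map (length y +_) x ++ y

length-⊟ : ∀ x y → length (x ⊟ y) ≡ length x + length y
length-⊟ x y = trans (length-++ (map (length y +_) x)) (cong (_+ length y) (length-map (length y +_) x))

⊟-assoc : ∀ x y z → x ⊟ (y ⊟ z) ≡ (x ⊟ y) ⊟ z
⊟-assoc x y z = begin
  map (length (y ⊟ z) +_) x ++ (map (length z +_) y ++ z)
    ≡⟨ cong (λ k → map (k +_) x ++ (map (length z +_) y ++ z)) (trans (length-⊟ y z) (+-comm (length y) (length z))) ⟩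
  map ((length z + length y) +_) x ++ (map (length z +_) y ++ z)
    ≡⟨ cong (_++ (map (length z +_) y ++ z)) (trans (map-cong (+-assoc (length z) (length y)) x) (map-∘ x)) ⟩
  map (length z +_) (map (length y +_) x) ++ (map (length z +_) y ++ z)
    ≡⟨ sym (++-assoc (map (length z +_) (map (length y +_) x)) _ z) ⟩
  (map (length z +_) (map (length y +_) x) ++ map (length z +_) y) ++ z
    ≡⟨ cong (_++ z) (sym (map-++ (length z +_) (map (length y +_) x) y)) ⟩
  (x ⊟ y) ⊟ z ∎
  where open ≡-Reasoning

++-injective : ∀ {A : Set} (xs xs′ : List A) {ys ys′} → length xs ≡ length xs′ → xs ++ ys ≡ xs′ ++ ys′ → xs ≡ xs′ × ys ≡ ys′
++-injective []       []         _  eq = refl , eq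
++-injective (x ∷ xs) (x′ ∷ xs′) l≡ eq with ∷-injective eq
... | refl , eq′ = let (xs≡ , ys≡) = ++-injective xs xs′ (suc-injective l≡) eq′ in cong (x ∷_) xs≡ , ys≡

⊟-injective : ∀ x y x′ y′ → length x ≡ length x′ → length y ≡ length y′ → x ⊟ y ≡ x′ ⊟ y′ → x ≡ x′ × y ≡ y′
⊟-injective x y x′ y′ lx≡ ly≡ eq
  with ++-injective (map (length y +_) x) (map (length y′ +_) x′) (trans (length-map _ x) (trans lx≡ (sym (length-map _ x′)))) eq
... | shifted≡ , y≡ = map-injective (+-cancelˡ-≡ (length y) _ _) (trans shifted≡ (cong (λ k → map (k +_) x′) (sym ly≡))) , y≡

IsPerm-⊟ : ∀ {x y} → IsPerm x → IsPerm y → IsPerm (x ⊟ y)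
IsPerm-⊟ {x} {y} (ux , rx) (uy , ry) rewrite length-⊟ x y =
  Unique.++⁺ (Unique.map⁺ (+-cancelˡ-≡ (length y) _ _) ux) uy
    (λ (v∈ , v∈y) → let (u , u∈ , v≡) = ∈-map⁻ (length y +_) v∈ in
                    <⇒≱ (subst (length y <_) (sym v≡) (n<n+1≤m (length y) (proj₁ (All.lookup rx u∈)))) (proj₂ (All.lookup ry v∈y))) ,
  All.++⁺ (All.map⁺ (All.map (λ {u} (1≤u , u≤) → ≤-trans 1≤u (m≤n+m u (length y)) , subst (length y + u ≤_) (+-comm (length y) (length x)) (+-monoʳ-≤ (length y) u≤)) rx))
          (All.map (λ {v} (1≤v , v≤) → 1≤v , ≤-trans v≤ (m≤n+m (length y) (length x))) ry)
  where
  n<n+1≤m : ∀ n {m} → 1 ≤ m → n < n + m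
  n<n+1≤m n {m} 1≤m = subst (_≤ n + m) (+-comm n 1) (+-monoʳ-≤ n 1≤m)

<⇒∃≡+suc : ∀ {a m} → a < m → ∃ λ m′ → m ≡ a + suc m′
<⇒∃≡+suc {zero}  {suc m} _         = m , refl
<⇒∃≡+suc {suc a} {suc m} (s≤s a<m) = let (m′ , m≡) = <⇒∃≡+suc a<m in m′ , cong suc m≡

module SkewSum {x y : List ℕ} (px : IsPerm x) (py : IsPerm y) where

  private
    a b : ℕ
    a = length x
    b = length y
    σ : List ℕ
    σ = x ⊟ y

  length-σ : length σ ≡ a + b
  length-σ = length-⊟ x y

  at-⊟ˡ : ∀ m → 1 ≤ m → m ≤ a → at σ m ≡ b + at x m
  at-⊟ˡ m 1≤m m≤a = trans (at-++ˡ (map (b +_) x) y m 1≤m (subst (m ≤_) (sym (length-map (b +_) x)) m≤a)) (at-map (b +_) x m 1≤m m≤a)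

  at-⊟ʳ : ∀ m → at σ (a + suc m) ≡ at y (suc m)
  at-⊟ʳ m = trans (cong (λ k → at σ (k + suc m)) (sym (length-map (b +_) x))) (at-++ʳ (map (b +_) x) y m)

  private
    right<left : ∀ m k → 1 ≤ m → m ≤ a → 1 ≤ k → k ≤ b → at y k < at σ m
    right<left m k 1≤m m≤a 1≤k k≤b = subst (at y k <_) (sym (at-⊟ˡ m 1≤m m≤a))
      (≤-<-trans (proj₂ (at-in-range py k 1≤k k≤b))
                 (subst (_≤ b + at x m) (+-comm b 1) (+-monoʳ-≤ b (proj₁ (at-in-range px m 1≤m m≤a)))))

    left-< : ∀ {m k} → 1 ≤ m → m ≤ a → 1 ≤ k → k ≤ a → at σ m < at σ k → at x m < at x k
    left-< 1≤m m≤a 1≤k k≤a lt = +-cancelˡ-< b _ _ (subst₂ _<_ (at-⊟ˡ _ 1≤m m≤a) (at-⊟ˡ _ 1≤k k≤a) lt)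

    left-<⁻ : ∀ {m k} → 1 ≤ m → m ≤ a → 1 ≤ k → k ≤ a → at x m < at x k → at σ m < at σ k
    left-<⁻ 1≤m m≤a 1≤k k≤a lt = subst₂ _<_ (sym (at-⊟ˡ _ 1≤m m≤a)) (sym (at-⊟ˡ _ 1≤k k≤a)) (+-monoʳ-< b lt)

    ≤σ : ∀ {m} → m ≤ a + b → m ≤ length σ
    ≤σ {m} = subst (m ≤_) (sym length-σ)

  Occurrence-left⁻ : ∀ {i j} → 1 ≤ i → i < j → j ≤ a → Occurrence σ i j → Occurrence x i j
  Occurrence-left⁻ {i} {j} 1≤i i<j j≤a o = occurrence
    (left-< 1≤i i≤a 1≤j j≤a (increasing o))
    (λ m 1≤m m<i → left-< 1≤j j≤a 1≤m (≤-trans (<⇒≤ m<i) i≤a) (before o m 1≤m m<i))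
    (λ m i<m m<j → let 1≤m = ≤-trans 1≤i (<⇒≤ i<m) ; m≤a = ≤-trans (<⇒≤ m<j) j≤a ; (v₁<v , v<v₂) = between o m i<m m<j in
                   left-< 1≤i i≤a 1≤m m≤a v₁<v , left-< 1≤m m≤a 1≤j j≤a v<v₂)
    (λ m j<m m≤a → left-< (≤-trans 1≤j (<⇒≤ j<m)) m≤a 1≤i i≤a (after o m j<m (≤σ (≤-trans m≤a (m≤m+n a b)))))
    where
    i≤a : i ≤ a
    i≤a = ≤-trans (<⇒≤ i<j) j≤a
    1≤j : 1 ≤ j
    1≤j = ≤-trans 1≤i (<⇒≤ i<j)

  Occurrence-left⁺ : ∀ {i j} → 1 ≤ i → i < j → j ≤ a → Occurrence x i j → Occurrence σ i j
  Occurrence-left⁺ {i} {j} 1≤i i<j j≤a o = occurrence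
    (left-<⁻ 1≤i i≤a 1≤j j≤a (increasing o))
    (λ m 1≤m m<i → left-<⁻ 1≤j j≤a 1≤m (≤-trans (<⇒≤ m<i) i≤a) (before o m 1≤m m<i))
    (λ m i<m m<j → let 1≤m = ≤-trans 1≤i (<⇒≤ i<m) ; m≤a = ≤-trans (<⇒≤ m<j) j≤a ; (v₁<v , v<v₂) = between o m i<m m<j in
                   left-<⁻ 1≤i i≤a 1≤m m≤a v₁<v , left-<⁻ 1≤m m≤a 1≤j j≤a v<v₂)
    after′
    where
    i≤a : i ≤ a
    i≤a = ≤-trans (<⇒≤ i<j) j≤a
    1≤j : 1 ≤ j
    1≤j = ≤-trans 1≤i (<⇒≤ i<j)
    after′ : ∀ m → j < m → m ≤ length σ → at σ m < at σ i
    after′ m j<m m≤ with m ≤? a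
    ... | yes m≤a = left-<⁻ (≤-trans 1≤j (<⇒≤ j<m)) m≤a 1≤i i≤a (after o m j<m m≤a)
    ... | no  m≰a with <⇒∃≡+suc (≰⇒> m≰a)
    ... | m′ , refl = subst (_< at σ i) (sym (at-⊟ʳ m′))
                        (right<left i (suc m′) 1≤i i≤a (s≤s z≤n) (+-cancelˡ-≤ a _ _ (subst (a + suc m′ ≤_) length-σ m≤)))

  Occurrence-right⁻ : ∀ {i j} → i < j → suc j ≤ b → Occurrence σ (a + suc i) (a + suc j) → Occurrence y (suc i) (suc j)
  Occurrence-right⁻ {i} {j} i<j j<b o = occurrence
    (subst₂ _<_ (at-⊟ʳ i) (at-⊟ʳ j) (increasing o))
    (λ { (suc m) _ m<i → subst₂ _<_ (at-⊟ʳ j) (at-⊟ʳ m) (before o (a + suc m) (≤-trans (s≤s z≤n) (m≤n+m (suc m) a)) (+-monoʳ-< a m<i)) })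
    (λ { (suc m) i<m m<j → let (v₁<v , v<v₂) = between o (a + suc m) (+-monoʳ-< a i<m) (+-monoʳ-< a m<j) in
                             subst₂ _<_ (at-⊟ʳ i) (at-⊟ʳ m) v₁<v , subst₂ _<_ (at-⊟ʳ m) (at-⊟ʳ j) v<v₂ })
    (λ { (suc m) j<m m≤b → subst₂ _<_ (at-⊟ʳ m) (at-⊟ʳ i) (after o (a + suc m) (+-monoʳ-< a j<m) (≤σ (+-monoʳ-≤ a m≤b))) })

  Occurrence-right⁺ : ∀ {i j} → i < j → suc j ≤ b → Occurrence y (suc i) (suc j) → Occurrence σ (a + suc i) (a + suc j)
  Occurrence-right⁺ {i} {j} i<j j<b o = occurrence
    (subst₂ _<_ (sym (at-⊟ʳ i)) (sym (at-⊟ʳ j)) (increasing o))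
    before′ between′ after′
    where
    before′ : ∀ m → 1 ≤ m → m < a + suc i → at σ (a + suc j) < at σ m
    before′ m 1≤m m< with m ≤? a
    ... | yes m≤a = subst (_< at σ m) (sym (at-⊟ʳ j)) (right<left m (suc j) 1≤m m≤a (s≤s z≤n) j<b)
    ... | no  m≰a with <⇒∃≡+suc (≰⇒> m≰a)
    ... | m′ , refl = subst₂ _<_ (sym (at-⊟ʳ j)) (sym (at-⊟ʳ m′)) (before o (suc m′) (s≤s z≤n) (+-cancelˡ-< a _ _ m<))
    between′ : ∀ m → a + suc i < m → m < a + suc j → at σ (a + suc i) < at σ m × at σ m < at σ (a + suc j)
    between′ m i< m< with <⇒∃≡+suc (<-≤-trans (m<m+n a (s≤s z≤n)) (<⇒≤ i<))
    ... | m′ , refl = let (v₁<v , v<v₂) = between o (suc m′) (+-cancelˡ-< a _ _ i<) (+-cancelˡ-< a _ _ m<) in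
      subst₂ _<_ (sym (at-⊟ʳ i)) (sym (at-⊟ʳ m′)) v₁<v , subst₂ _<_ (sym (at-⊟ʳ m′)) (sym (at-⊟ʳ j)) v<v₂
    after′ : ∀ m → a + suc j < m → m ≤ length σ → at σ m < at σ (a + suc i)
    after′ m j< m≤ with <⇒∃≡+suc (<-≤-trans (m<m+n a (s≤s z≤n)) (<⇒≤ j<))
    ... | m′ , refl = subst₂ _<_ (sym (at-⊟ʳ m′)) (sym (at-⊟ʳ i))
                        (after o (suc m′) (+-cancelˡ-< a _ _ j<) (+-cancelˡ-≤ a _ _ (subst (a + suc m′ ≤_) length-σ m≤)))

  no-crossing-Occurrence : ∀ {i j} → 1 ≤ i → i ≤ a → a < j → j ≤ length σ → ¬ Occurrence σ i j
  no-crossing-Occurrence {i} {j} 1≤i i≤a a<j j≤ o with <⇒∃≡+suc a<j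
  ... | j′ , refl = <-asym (increasing o) (subst (_< at σ i) (sym (at-⊟ʳ j′))
                      (right<left i (suc j′) 1≤i i≤a (s≤s z≤n) (+-cancelˡ-≤ a _ _ (subst (a + suc j′ ≤_) length-σ j≤))))

  private
    module Σσ = OccurrenceCharacterisation (IsPerm-⊟ px py)
    module Σx = OccurrenceCharacterisation px
    module Σy = OccurrenceCharacterisation py

    isOcc-left : ∀ {i j} → InRange a i → InRange a j → isOcc Rp σ i j ≡ isOcc Rp x i j
    isOcc-left (1≤i , i≤a) (1≤j , j≤a) = T-extensional
      (λ t → let (i<j , o) = Σσ.isOcc⇒Occurrence 1≤i (≤σ (≤-trans j≤a (m≤m+n a b))) t in
             Σx.Occurrence⇒isOcc i<j (Occurrence-left⁻ 1≤i i<j j≤a o))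
      (λ t → let (i<j , o) = Σx.isOcc⇒Occurrence 1≤i j≤a t in
             Σσ.Occurrence⇒isOcc i<j (Occurrence-left⁺ 1≤i i<j j≤a o))

    isOcc-right : ∀ {i j} → InRange b i → InRange b j → isOcc Rp σ (a + i) (a + j) ≡ isOcc Rp y i j
    isOcc-right {suc i} {suc j} (_ , i≤b) (_ , j≤b) = T-extensional
      (λ t → let (a+i<a+j , o) = Σσ.isOcc⇒Occurrence (≤-trans (s≤s z≤n) (m≤n+m (suc i) a)) (≤σ (+-monoʳ-≤ a j≤b)) t
                 i<j = ≤-pred (+-cancelˡ-< a _ _ a+i<a+j) in
             Σy.Occurrence⇒isOcc (s≤s i<j) (Occurrence-right⁻ i<j j≤b o))
      (λ t → let (1+i<1+j , o) = Σy.isOcc⇒Occurrence (s≤s z≤n) j≤b t in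
             Σσ.Occurrence⇒isOcc (+-monoʳ-< a 1+i<1+j) (Occurrence-right⁺ (≤-pred 1+i<1+j) j≤b o))

    isOcc-crossing : ∀ {i j} → InRange a i → a < j → j ≤ a + b → isOcc Rp σ i j ≡ false
    isOcc-crossing (1≤i , i≤a) a<j j≤ = ¬T⇒≡false λ t →
      let (_ , o) = Σσ.isOcc⇒Occurrence 1≤i (≤σ j≤) t in no-crossing-Occurrence 1≤i i≤a a<j (≤σ j≤) o

    isOcc-backwards : ∀ {i j} → a < i → j ≤ a → isOcc Rp σ i j ≡ false
    isOcc-backwards a<i j≤a = ¬T⇒≡false λ t → <-asym (<ᵇ⇒< _ _ (proj₁ (T-∧⁻ t))) (≤-<-trans j≤a a<i)

  occ-⊟ : occ Rp σ ≡ occ Rp x + occ Rp y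
  occ-⊟ = begin
    occ Rp σ                                       ≡⟨ cong (λ n → countPairs (range n) (range n) F) length-σ ⟩
    countPairs (range (a + b)) (range (a + b)) F   ≡⟨ cong (λ r → countPairs r r F) (range-+ a b) ⟩
    countPairs (ra ++ rb) (ra ++ rb) F             ≡⟨ countPairs-++ˡ ra rb (ra ++ rb) F ⟩
    countPairs ra (ra ++ rb) F + countPairs rb (ra ++ rb) F
      ≡⟨ cong₂ _+_ (countPairs-++ʳ ra ra rb F) (countPairs-++ʳ rb ra rb F) ⟩
    (countPairs ra ra F + countPairs ra rb F) + (countPairs rb ra F + countPairs rb rb F)
      ≡⟨ cong₂ _+_ (cong₂ _+_ left-block crossing-block) (cong₂ _+_ backwards-block right-block) ⟩
    (occ Rp x + 0) + (0 + occ Rp y)                ≡⟨ cong (_+ occ Rp y) (+-identityʳ (occ Rp x)) ⟩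
    occ Rp x + occ Rp y                            ∎
    where
    open ≡-Reasoning
    F : ℕ → ℕ → Bool
    F = isOcc Rp σ
    ra rb : List ℕ
    ra = range a
    rb = map (a +_) (range b)
    ∈rb : ∀ {j} → j ∈ rb → a < j × j ≤ a + b
    ∈rb j∈ = let (j′ , j′∈ , j≡) = ∈-map⁻ (a +_) j∈ ; (1≤j′ , j′≤b) = ∈-range⁻ j′∈ in
      subst (λ j → a < j × j ≤ a + b) (sym j≡) (subst (_≤ a + j′) (+-comm a 1) (+-monoʳ-≤ a 1≤j′) , +-monoʳ-≤ a j′≤b)
    left-block : countPairs ra ra F ≡ occ Rp x
    left-block = countPairs-cong ra ra (λ i∈ j∈ → isOcc-left (∈-range⁻ i∈) (∈-range⁻ j∈))
    crossing-block : countPairs ra rb F ≡ 0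
    crossing-block = countPairs-none ra rb F λ i∈ j∈ → let (a<j , j≤) = ∈rb j∈ in isOcc-crossing (∈-range⁻ i∈) a<j j≤
    backwards-block : countPairs rb ra F ≡ 0
    backwards-block = countPairs-none rb ra F λ i∈ j∈ → isOcc-backwards (proj₁ (∈rb i∈)) (proj₂ (∈-range⁻ j∈))
    right-block : countPairs rb rb F ≡ occ Rp y
    right-block = trans (countPairs-map (a +_) (a +_) (range b) (range b) F)
      (countPairs-cong (range b) (range b) (λ i∈ j∈ → isOcc-right (∈-range⁻ i∈) (∈-range⁻ j∈)))

-- Framed permutations

-- Both are 0 on the empty list.
head₀ last₀ : List ℕ → ℕ
head₀ []      = 0
head₀ (x ∷ _) = x
last₀ []           = 0
last₀ (x ∷ [])     = x
last₀ (_ ∷ y ∷ xs) = last₀ (y ∷ xs)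

at-1 : ∀ xs → at xs 1 ≡ head₀ xs
at-1 []       = refl
at-1 (x ∷ xs) = refl

at-length : ∀ xs → at xs (length xs) ≡ last₀ xs
at-length []           = refl
at-length (x ∷ [])     = refl
at-length (x ∷ y ∷ xs) = at-length (y ∷ xs)

last₀-map : ∀ f x xs → last₀ (map f (x ∷ xs)) ≡ f (last₀ (x ∷ xs))
last₀-map f x []       = refl
last₀-map f x (y ∷ xs) = last₀-map f y xs

last₀-++ : ∀ xs y ys → last₀ (xs ++ y ∷ ys) ≡ last₀ (y ∷ ys)
last₀-++ []           y ys = refl
last₀-++ (x ∷ [])     y ys = refl
last₀-++ (x ∷ x′ ∷ xs) y ys = last₀-++ (x′ ∷ xs) y ys

last₀-∈ : ∀ x xs → last₀ (x ∷ xs) ∈ x ∷ xs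
last₀-∈ x []       = here refl
last₀-∈ x (y ∷ xs) = there (last₀-∈ y xs)

record IsFramed (μ : List ℕ) : Set where
  constructor framed
  field
    2≤length  : 2 ≤ length μ
    head₀≡1   : head₀ μ ≡ 1
    last₀≡max : last₀ μ ≡ length μ
open IsFramed public

isFramedᵇ : List ℕ → Bool
isFramedᵇ μ = (1 <ᵇ length μ) ∧ (head₀ μ ≡ᵇ 1) ∧ (last₀ μ ≡ᵇ length μ)

T-isFramedᵇ⁻ : ∀ {μ} → T (isFramedᵇ μ) → IsFramed μ
T-isFramedᵇ⁻ {μ} t = let (p , t′) = T-∧⁻ {1 <ᵇ length μ} t ; (q , r) = T-∧⁻ {head₀ μ ≡ᵇ 1} t′ in
  framed (<ᵇ⇒< 1 _ p) (≡ᵇ⇒≡ _ 1 q) (≡ᵇ⇒≡ _ _ r)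

T-isFramedᵇ⁺ : ∀ {μ} → IsFramed μ → T (isFramedᵇ μ)
T-isFramedᵇ⁺ {μ} (framed p q r) = T-∧⁺ {1 <ᵇ length μ} (<⇒<ᵇ p) (T-∧⁺ {head₀ μ ≡ᵇ 1} (≡⇒≡ᵇ _ 1 q) (≡⇒≡ᵇ _ _ r))

module FramedOccurrences {μ : List ℕ} (pμ : IsPerm μ) (fμ : IsFramed μ) where

  private
    b : ℕ
    b = length μ
    1≤b : 1 ≤ b
    1≤b = ≤-trans (s≤s z≤n) (2≤length fμ)
    first≡1 : at μ 1 ≡ 1
    first≡1 = trans (at-1 μ) (head₀≡1 fμ)
    last≡b : at μ b ≡ b
    last≡b = trans (at-length μ) (last₀≡max fμ)
    value-in-range : ∀ m → 1 ≤ m → m ≤ b → InRange b (at μ m)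
    value-in-range = at-in-range pμ
    values-distinct : ∀ {m k} → 1 ≤ m → m ≤ b → 1 ≤ k → k ≤ b → m ≢ k → at μ m ≢ at μ k
    values-distinct = at-distinct pμ

  -- An entry 1 left of i, or an entry b right of j, would violate the occurrence conditions.
  Occurrence⇒extremal : ∀ {i j} → 1 ≤ i → i < j → j ≤ b → Occurrence μ i j → i ≡ 1 × j ≡ b
  Occurrence⇒extremal {i} {j} 1≤i i<j j≤b o = i≡1 , j≡b
    where
    i≡1 : i ≡ 1
    i≡1 with m≤n⇒m<n∨m≡n 1≤i
    ... | inj₂ 1≡i = sym 1≡i
    ... | inj₁ 1<i = ⊥-elim (<⇒≱ (subst (at μ j <_) first≡1 (before o 1 (s≤s z≤n) 1<i))
                                  (proj₁ (value-in-range j (≤-trans 1≤i (<⇒≤ i<j)) j≤b)))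
    j≡b : j ≡ b
    j≡b with m≤n⇒m<n∨m≡n j≤b
    ... | inj₂ j≡b′ = j≡b′
    ... | inj₁ j<b  = ⊥-elim (<⇒≱ (subst (_< at μ i) last≡b (after o b j<b ≤-refl))
                                  (proj₂ (value-in-range i 1≤i (≤-trans (<⇒≤ i<j) j≤b))))

  extremal-Occurrence : Occurrence μ 1 b
  extremal-Occurrence = occurrence
    (subst₂ _<_ (sym first≡1) (sym last≡b) (2≤length fμ))
    (λ m 1≤m m<1 → ⊥-elim (<⇒≱ m<1 1≤m))
    (λ m 1<m m<b → let (1≤v , v≤b) = value-in-range m (<⇒≤ 1<m) (<⇒≤ m<b) in
      subst (_< at μ m) (sym first≡1) (≤∧≢⇒< 1≤v (values-distinct (s≤s z≤n) 1≤b (<⇒≤ 1<m) (<⇒≤ m<b) (<⇒≢ 1<m) ∘ trans first≡1)) ,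
      subst (at μ m <_) (sym last≡b) (≤∧≢⇒< v≤b (values-distinct (<⇒≤ 1<m) (<⇒≤ m<b) 1≤b ≤-refl (<⇒≢ m<b) ∘ (λ v≡b → trans v≡b (sym last≡b)))))
    (λ m b<m m≤b → ⊥-elim (<⇒≱ b<m m≤b))

  occ-framed : occ Rp μ ≡ 1
  occ-framed = begin
    occ Rp μ                                          ≡⟨ countPairs-cong (range b) (range b) isOcc≡ ⟩
    countPairs (range b) (range b) G                  ≡⟨ cong (λ r → countPairs r (range b) G) (trans (cong range (+-∸-assoc 1 1≤b)) (range-suc b′)) ⟩
    countPairs (1 ∷ map suc (range b′)) (range b) G   ≡⟨ countPairs-∷ 1 (map suc (range b′)) (range b) G ⟩
    countTrue (map (_≡ᵇ b) (range b)) + countPairs (map suc (range b′)) (range b) G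
      ≡⟨ cong₂ _+_ (countTrue-≡ᵇ (range-unique b) (∈-range⁺ (1≤b , ≤-refl)))
                   (countPairs-none (map suc (range b′)) (range b) G λ {i} {j} i∈ _ → i≢1 i∈ j) ⟩
    1                                                 ∎
    where
    open ≡-Reasoning
    b′ : ℕ
    b′ = b ∸ 1
    G : ℕ → ℕ → Bool
    G i j = (i ≡ᵇ 1) ∧ (j ≡ᵇ b)
    isOcc≡ : ∀ {i j} → i ∈ range b → j ∈ range b → isOcc Rp μ i j ≡ G i j
    isOcc≡ {i} {j} i∈ j∈ = let (1≤i , _) = ∈-range⁻ i∈ ; (_ , j≤b) = ∈-range⁻ j∈ in T-extensional
      (λ t → let (i<j , o) = OccurrenceCharacterisation.isOcc⇒Occurrence pμ 1≤i j≤b t ; (i≡1 , j≡b) = Occurrence⇒extremal 1≤i i<j j≤b o in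
             T-∧⁺ {i ≡ᵇ 1} (≡⇒≡ᵇ i 1 i≡1) (≡⇒≡ᵇ j b j≡b))
      (λ t → let (p , q) = T-∧⁻ {i ≡ᵇ 1} t in
             subst₂ (λ i j → T (isOcc Rp μ i j)) (sym (≡ᵇ⇒≡ i 1 p)) (sym (≡ᵇ⇒≡ j b q))
               (OccurrenceCharacterisation.Occurrence⇒isOcc pμ (2≤length fμ) extremal-Occurrence))
    i≢1 : ∀ {i} → i ∈ map suc (range b′) → ∀ j → G i j ≡ false
    i≢1 i∈ j with ∈-map⁻ suc i∈
    ... | x , x∈ , refl with ∈-range⁻ {b′} x∈
    ... | s≤s _ , _ = refl

farᵇ : ℕ → ℕ → Bool
farᵇ u v = 1 <ᵇ ∣ u - v ∣

far-by-2 : ∀ {u v} → v + 2 ≤ u → 1 < ∣ u - v ∣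
far-by-2 {u} {v} v+2≤u = subst (1 <_) (sym (m≤n⇒∣n-m∣≡n∸m v≤u))
  (+-cancelˡ-≤ v 2 (u ∸ v) (subst (v + 2 ≤_) (sym (m+[n∸m]≡n v≤u)) v+2≤u))
  where
  v≤u : v ≤ u
  v≤u = ≤-trans (m≤m+n v 2) v+2≤u

isKing-++ : ∀ x xs y ys → isKing ((x ∷ xs) ++ (y ∷ ys)) ≡ isKing (x ∷ xs) ∧ (farᵇ (last₀ (x ∷ xs)) y ∧ isKing (y ∷ ys))
isKing-++ x []        y ys = refl
isKing-++ x (x′ ∷ xs) y ys = trans (cong (farᵇ x x′ ∧_) (isKing-++ x′ xs y ys)) (sym (∧-assoc (farᵇ x x′) (isKing (x′ ∷ xs)) _))

isKing-shift : ∀ c σ → isKing (map (c +_) σ) ≡ isKing σ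
isKing-shift c []          = refl
isKing-shift c (u ∷ [])     = refl
isKing-shift c (u ∷ v ∷ σ) = cong₂ _∧_ (cong (1 <ᵇ_) (∣m+n-m+o∣≡∣n-o∣ c u v)) (isKing-shift c (v ∷ σ))

private
  isKing-⊟ : ∀ x xs y ys → isKing ((x ∷ xs) ⊟ (y ∷ ys)) ≡
    isKing (x ∷ xs) ∧ (farᵇ (length (y ∷ ys) + last₀ (x ∷ xs)) y ∧ isKing (y ∷ ys))
  isKing-⊟ x xs y ys = trans (isKing-++ (length (y ∷ ys) + x) (map (length (y ∷ ys) +_) xs) y ys)
    (cong₂ _∧_ (isKing-shift (length (y ∷ ys)) (x ∷ xs)) (cong (λ u → farᵇ u y ∧ isKing (y ∷ ys)) (last₀-map (length (y ∷ ys) +_) x xs)))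

  isKing-⊟[] : ∀ x → isKing (x ⊟ []) ≡ isKing x
  isKing-⊟[] x = trans (cong isKing (++-identityʳ (map (0 +_) x))) (isKing-shift 0 x)

isKing-⊟⁻ : ∀ x y → T (isKing (x ⊟ y)) → T (isKing x) × T (isKing y)
isKing-⊟⁻ []       y        k = _ , k
isKing-⊟⁻ (x ∷ xs) []       k = subst T (isKing-⊟[] (x ∷ xs)) k , _
isKing-⊟⁻ (x ∷ xs) (y ∷ ys) k =
  let (kx , k′) = T-∧⁻ {isKing (x ∷ xs)} (subst T (isKing-⊟ x xs y ys) k) in kx , proj₂ (T-∧⁻ {farᵇ (length (y ∷ ys) + last₀ (x ∷ xs)) y} k′)

isKing-⊟⁺ : ∀ x y → T (isKing x) → T (isKing y) →
  (x ≢ [] → y ≢ [] → 1 < ∣ length y + last₀ x - head₀ y ∣) → T (isKing (x ⊟ y))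
isKing-⊟⁺ []       y        kx ky far = ky
isKing-⊟⁺ (x ∷ xs) []       kx ky far = subst T (sym (isKing-⊟[] (x ∷ xs))) kx
isKing-⊟⁺ (x ∷ xs) (y ∷ ys) kx ky far = subst T (sym (isKing-⊟ x xs y ys))
  (T-∧⁺ {isKing (x ∷ xs)} kx (T-∧⁺ {farᵇ (length (y ∷ ys) + last₀ (x ∷ xs)) y} (<⇒<ᵇ (far (λ ()) (λ ()))) ky))

-- Splitting a permutation at an occurrence

∈-++-∷⁻ : ∀ {A : Set} {z x : A} ys {zs} → z ∈ ys ++ x ∷ zs → z ≢ x → z ∈ ys ++ zs
∈-++-∷⁻ ys z∈ z≢x with ∈-++⁻ ys z∈
... | inj₁ z∈ys          = ∈-++⁺ˡ z∈ys
... | inj₂ (here z≡x)    = ⊥-elim (z≢x z≡x)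
... | inj₂ (there z∈zs)  = ∈-++⁺ʳ ys z∈zs

length-⊆ : ∀ {A : Set} {xs ys : List A} → Unique xs → (∀ {z} → z ∈ xs → z ∈ ys) → length xs ≤ length ys
length-⊆ {xs = []}     _          _  = z≤n
length-⊆ {xs = x ∷ xs} (x∉ ∷ uxs) xs⊆ys with ∈-∃++ (xs⊆ys (here refl))
... | ys₁ , ys₂ , refl = subst (suc (length xs) ≤_) (sym (length-++-sucʳ ys₁ x ys₂))
  (s≤s (length-⊆ uxs λ z∈ → ∈-++-∷⁻ ys₁ (xs⊆ys (there z∈)) (All.lookup x∉ z∈ ∘ sym)))

IsPerm⇒covers : ∀ {σ} → IsPerm σ → ∀ {w} → InRange (length σ) w → w ∈ σ
IsPerm⇒covers {σ} (uσ , rσ) {w} w∈[1,n] with w ∈? σ | ∈-∃++ (∈-range⁺ w∈[1,n])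
... | yes w∈σ | _ = w∈σ
... | no  w∉σ | r₁ , r₂ , range≡ = ⊥-elim (<-irrefl refl (begin-strict
  length σ                  ≤⟨ length-⊆ uσ (λ z∈ → ∈-++-∷⁻ r₁ (subst (_ ∈_) range≡ (∈-range⁺ (All.lookup rσ z∈))) λ { refl → w∉σ z∈ }) ⟩
  length (r₁ ++ r₂)         <⟨ ≤-reflexive (sym (length-++-sucʳ r₁ w r₂)) ⟩
  length (r₁ ++ w ∷ r₂)     ≡⟨ cong length (sym range≡) ⟩
  length (range (length σ)) ≡⟨ length-range (length σ) ⟩
  length σ                  ∎))
  where open ≤-Reasoning

Unique-++⁻ˡ : ∀ {A : Set} {xs ys : List A} → Unique (xs ++ ys) → Unique xs
Unique-++⁻ˡ {xs = []}     _          = []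
Unique-++⁻ˡ {xs = x ∷ xs} (x∉ ∷ uxs) = All.++⁻ˡ xs x∉ ∷ Unique-++⁻ˡ uxs

Unique-++⁻ʳ : ∀ {A : Set} (xs : List A) {ys} → Unique (xs ++ ys) → Unique ys
Unique-++⁻ʳ []       uys        = uys
Unique-++⁻ʳ (x ∷ xs) (_ ∷ uxs) = Unique-++⁻ʳ xs uxs

window⇒IsPerm : ∀ (L : List ℕ) {lo hi} → lo ≤ hi → Unique L → All (λ z → lo < z × z ≤ hi) L → (∀ {w} → lo < w → w ≤ hi → w ∈ L) →
  length L ≡ hi ∸ lo × IsPerm (map (_∸ lo) L)
window⇒IsPerm L {lo} {hi} lo≤hi uL L⊆ ⊆L = length≡ , uL′ , All.tabulate λ z∈ → subst (λ k → InRange k _) (sym length′≡) (∈-range⁻ (L′⊆range z∈))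
  where
  L′ : List ℕ
  L′ = map (_∸ lo) L
  uL′ : Unique L′
  uL′ = map-unique-local (_∸ lo) (λ z∈ z′∈ eq → trans (sym (m+[n∸m]≡n (<⇒≤ (proj₁ (All.lookup L⊆ z∈)))))
                                               (trans (cong (lo +_) eq) (m+[n∸m]≡n (<⇒≤ (proj₁ (All.lookup L⊆ z′∈)))))) uL
  L′⊆range : ∀ {z′} → z′ ∈ L′ → z′ ∈ range (hi ∸ lo)
  L′⊆range z′∈ with ∈-map⁻ (_∸ lo) z′∈
  ... | z , z∈ , refl = let (lo<z , z≤hi) = All.lookup L⊆ z∈ in ∈-range⁺ (m<n⇒0<n∸m lo<z , ∸-monoˡ-≤ lo z≤hi)
  range⊆L′ : ∀ {w} → w ∈ range (hi ∸ lo) → w ∈ L′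
  range⊆L′ {w} w∈ = let (1≤w , w≤) = ∈-range⁻ w∈ in subst (_∈ L′) (m+n∸m≡n lo w)
    (∈-map⁺ (_∸ lo) (⊆L (subst (_≤ lo + w) (+-comm lo 1) (+-monoʳ-≤ lo 1≤w)) (subst (_≤ hi) (+-comm w lo) (m≤o∸n⇒m+n≤o w lo≤hi w≤))))
  length′≡ : length L′ ≡ hi ∸ lo
  length′≡ = trans (length-unique-⇔ uL′ (range-unique (hi ∸ lo)) (mk⇔ L′⊆range range⊆L′)) (length-range (hi ∸ lo))
  length≡ : length L ≡ hi ∸ lo
  length≡ = trans (sym (length-map (_∸ lo) L)) length′≡

record OccurrenceSplit (σ : List ℕ) : Set where
  constructor occurrenceSplit
  field
    pre          : List ℕ
    v₁           : ℕ
    mid          : List ℕ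
    v₂           : ℕ
    post         : List ℕ
    σ≡           : σ ≡ pre ++ v₁ ∷ mid ++ v₂ ∷ post
    v₁<v₂        : v₁ < v₂
    pre-above    : All (v₂ <_) pre
    mid-between  : All (λ z → v₁ < z × z < v₂) mid
    post-below   : All (_< v₁) post

private
  split-at : ∀ σ k → suc k ≤ length σ → Σ (List ℕ) λ pre → Σ ℕ λ v → Σ (List ℕ) λ rest → σ ≡ pre ++ v ∷ rest × length pre ≡ k
  split-at (x ∷ σ) zero    _         = [] , x , σ , refl , refl
  split-at (x ∷ σ) (suc k) (s≤s k<n) with split-at σ k k<n
  ... | pre , v , rest , σ≡ , length≡ = x ∷ pre , v , rest , cong (x ∷_) σ≡ , cong suc length≡

  at-∷ : ∀ x xs k → 1 ≤ k → at (x ∷ xs) (suc k) ≡ at xs k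
  at-∷ x xs (suc k) _ = refl

  module SplitPositions (pre : List ℕ) (v₁ : ℕ) (mid : List ℕ) (v₂ : ℕ) (post : List ℕ) where
    σ : List ℕ
    σ = pre ++ v₁ ∷ mid ++ v₂ ∷ post
    p q : ℕ
    p = length pre
    q = length mid

    at-pre : ∀ m → 1 ≤ m → m ≤ p → at σ m ≡ at pre m
    at-pre m 1≤m m≤p = at-++ˡ pre (v₁ ∷ mid ++ v₂ ∷ post) m 1≤m m≤p

    at-v₁ : at σ (p + 1) ≡ v₁
    at-v₁ = at-++ʳ pre (v₁ ∷ mid ++ v₂ ∷ post) 0

    at-mid : ∀ m → 1 ≤ m → m ≤ q → at σ (p + suc m) ≡ at mid m
    at-mid m 1≤m m≤q = trans (at-++ʳ pre _ m) (trans (at-∷ v₁ _ m 1≤m) (at-++ˡ mid (v₂ ∷ post) m 1≤m m≤q))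

    at-v₂ : at σ (p + suc (suc q)) ≡ v₂
    at-v₂ = trans (at-++ʳ pre _ (suc q)) (trans (cong (at (mid ++ v₂ ∷ post)) (+-comm 1 q)) (at-++ʳ mid (v₂ ∷ post) 0))

    at-post : ∀ m → at σ (p + suc (q + suc (suc m))) ≡ at post (suc m)
    at-post m = trans (at-++ʳ pre _ (q + suc (suc m)))
      (trans (at-∷ v₁ _ (q + suc (suc m)) (≤-trans (s≤s z≤n) (m≤n+m _ q))) (at-++ʳ mid (v₂ ∷ post) (suc m)))

    length-σ : length σ ≡ p + suc (q + suc (length post))
    length-σ = trans (length-++ pre) (cong (λ k → p + suc k) (length-++ mid))

  Occurrence⇒conditions : ∀ pre v₁ mid v₂ post → let open SplitPositions pre v₁ mid v₂ post in
    Occurrence σ (p + 1) (p + suc (suc q)) →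
    v₁ < v₂ × All (v₂ <_) pre × All (λ z → v₁ < z × z < v₂) mid × All (_< v₁) post
  Occurrence⇒conditions pre v₁ mid v₂ post o =
    subst₂ _<_ at-v₁ at-v₂ (increasing o) ,
    All.tabulate (λ z∈ → let (m , (1≤m , m≤p) , at≡z) = ∈⇒at z∈ in
      subst₂ _<_ at-v₂ (trans (at-pre m 1≤m m≤p) at≡z) (before o m 1≤m (≤-<-trans m≤p (m<m+n p (s≤s z≤n))))) ,
    All.tabulate (λ z∈ → let (m , (1≤m , m≤q) , at≡z) = ∈⇒at z∈
                             (v₁<z , z<v₂) = between o (p + suc m) (+-monoʳ-< p (s≤s 1≤m)) (+-monoʳ-< p (s≤s (s≤s m≤q))) in
      subst₂ _<_ at-v₁ (trans (at-mid m 1≤m m≤q) at≡z) v₁<z , subst₂ _<_ (trans (at-mid m 1≤m m≤q) at≡z) at-v₂ z<v₂) ,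
    All.tabulate (λ z∈ → let (m , (1≤m , m≤r) , at≡z) = ∈⇒at z∈ in post-below′ m 1≤m m≤r at≡z)
    where
    open SplitPositions pre v₁ mid v₂ post
    post-below′ : ∀ {z} m → 1 ≤ m → m ≤ length post → at post m ≡ z → z < v₁
    post-below′ (suc m) _ m≤r at≡z = subst₂ _<_ (trans (at-post m) at≡z) at-v₁
      (after o (p + suc (q + suc (suc m)))
        (+-monoʳ-< p (s≤s (subst (_< q + suc (suc m)) (+-comm q 1) (+-monoʳ-< q (s≤s (s≤s z≤n))))))
        (subst (p + suc (q + suc (suc m)) ≤_) (sym length-σ) (+-monoʳ-≤ p (s≤s (+-monoʳ-≤ q (s≤s m≤r))))))

Occurrence⇒split : ∀ {σ i j} → 1 ≤ i → i < j → j ≤ length σ → Occurrence σ i j → OccurrenceSplit σ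
Occurrence⇒split {σ} {suc k} {j} _ i<j j≤n o with <⇒∃≡+suc i<j
... | m , refl with split-at σ k (≤-trans (s≤s (m≤m+n k (suc m))) j≤n)
... | pre , v₁ , rest , σ≡₁ , refl with split-at rest m (m<rest σ≡₁)
  where
  m<rest : σ ≡ pre ++ v₁ ∷ rest → suc m ≤ length rest
  m<rest σ≡₁ = ≤-pred (+-cancelˡ-≤ (length pre) _ _ (subst (length pre + suc (suc m) ≤_) (trans (cong length σ≡₁) (length-++ pre))
                 (subst (_≤ length σ) (sym (+-suc (length pre) (suc m))) j≤n)))
... | mid , v₂ , post , σ≡₂ , refl =
  let (v₁<v₂ , above , between′ , below) = Occurrence⇒conditions pre v₁ mid v₂ post
        (subst (λ s → Occurrence s (length pre + 1) (length pre + suc (suc (length mid)))) σ≡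
          (subst₂ (Occurrence σ) (+-comm 1 (length pre)) (sym (+-suc (length pre) (suc (length mid)))) o))
  in occurrenceSplit pre v₁ mid v₂ post σ≡ v₁<v₂ above between′ below
  where
  σ≡ : σ ≡ pre ++ v₁ ∷ mid ++ v₂ ∷ post
  σ≡ = trans σ≡₁ (cong (λ l → pre ++ v₁ ∷ l) σ≡₂)

record FramedSplitting (σ : List ℕ) : Set where
  constructor framedSplitting
  field
    α μ γ    : List ℕ
    α-perm   : IsPerm α
    μ-perm   : IsPerm μ
    γ-perm   : IsPerm γ
    μ-framed : IsFramed μ
    σ≡       : σ ≡ α ⊟ (μ ⊟ γ)

private
  data Segment (pre : List ℕ) (v₁ : ℕ) (mid : List ℕ) (v₂ : ℕ) (post : List ℕ) (z : ℕ) : Set where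
    in-pre  : z ∈ pre  → Segment pre v₁ mid v₂ post z
    at-v₁   : z ≡ v₁   → Segment pre v₁ mid v₂ post z
    in-mid  : z ∈ mid  → Segment pre v₁ mid v₂ post z
    at-v₂   : z ≡ v₂   → Segment pre v₁ mid v₂ post z
    in-post : z ∈ post → Segment pre v₁ mid v₂ post z

  segment : ∀ pre v₁ mid v₂ post {z} → z ∈ pre ++ v₁ ∷ mid ++ v₂ ∷ post → Segment pre v₁ mid v₂ post z
  segment pre v₁ mid v₂ post z∈ with ∈-++⁻ pre z∈
  ... | inj₁ z∈pre         = in-pre z∈pre
  ... | inj₂ (here z≡v₁)   = at-v₁ z≡v₁
  ... | inj₂ (there z∈)    with ∈-++⁻ mid z∈
  ... | inj₁ z∈mid         = in-mid z∈mid
  ... | inj₂ (here z≡v₂)   = at-v₂ z≡v₂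
  ... | inj₂ (there z∈post) = in-post z∈post

  map-+∸ : ∀ c (l : List ℕ) → All (c ≤_) l → map (c +_) (map (_∸ c) l) ≡ l
  map-+∸ c l c≤l = trans (sym (map-∘ l)) (map-id-local (All.map m+[n∸m]≡n c≤l))

-- With v₁ = a + 1, the three segments hold exactly the values in (v₂, n], [v₁, v₂] and [1, a].
module SplitSegments {pre : List ℕ} {a : ℕ} {mid : List ℕ} {v₂ : ℕ} {post : List ℕ}
  (pσ : IsPerm (pre ++ suc a ∷ mid ++ v₂ ∷ post)) (v₁<v₂ : suc a < v₂) (above : All (v₂ <_) pre)
  (between′ : All (λ z → suc a < z × z < v₂) mid) (below : All (_< suc a) post) where

  private
    v₁ n : ℕ
    v₁ = suc a
    n = length (pre ++ v₁ ∷ mid ++ v₂ ∷ post)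
    μ₀ : List ℕ
    μ₀ = v₁ ∷ mid ++ [ v₂ ]
    a≤v₂ : a ≤ v₂
    a≤v₂ = ≤-trans (n≤1+n a) (<⇒≤ v₁<v₂)
    v₂≤n : v₂ ≤ n
    v₂≤n = proj₂ (All.lookup (proj₂ pσ) (∈-++⁺ʳ pre (there (∈-++⁺ʳ mid (here refl)))))
    covers : ∀ {w} → 1 ≤ w → w ≤ n → Segment pre v₁ mid v₂ post w
    covers 1≤w w≤n = segment pre v₁ mid v₂ post (IsPerm⇒covers pσ (1≤w , w≤n))
    uniq-μ₀++post : Unique (μ₀ ++ post)
    uniq-μ₀++post = subst Unique (cong (v₁ ∷_) (sym (++-assoc mid [ v₂ ] post))) (Unique-++⁻ʳ pre (proj₁ pσ))
    μ₀-bounds : All (λ z → a < z × z ≤ v₂) μ₀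
    μ₀-bounds = (≤-refl , <⇒≤ v₁<v₂) ∷ All.++⁺ (All.map (λ (v₁<z , z<v₂) → <-trans ≤-refl v₁<z , <⇒≤ z<v₂) between′) ((<-trans ≤-refl v₁<v₂ , ≤-refl) ∷ [])

  x μ : List ℕ
  x = map (_∸ v₂) pre
  μ = map (_∸ a) μ₀

  post-window : length post ≡ a ∸ 0 × IsPerm (map (_∸ 0) post)
  post-window = window⇒IsPerm post z≤n (Unique-++⁻ʳ μ₀ uniq-μ₀++post)
    (All.tabulate λ z∈ → proj₁ (All.lookup (proj₂ pσ) (∈-++⁺ʳ pre (there (∈-++⁺ʳ mid (there z∈))))) , ≤-pred (All.lookup below z∈))
    λ {w} 0<w w≤a → fills-post (covers 0<w (≤-trans w≤a (≤-trans a≤v₂ v₂≤n))) w≤a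
    where
    fills-post : ∀ {w} → Segment pre v₁ mid v₂ post w → w ≤ a → w ∈ post
    fills-post (in-pre z∈)   w≤a = ⊥-elim (<-asym (All.lookup above z∈) (<-trans (s≤s w≤a) v₁<v₂))
    fills-post (at-v₁ refl)  w≤a = ⊥-elim (<-irrefl refl (s≤s w≤a))
    fills-post (in-mid z∈)   w≤a = ⊥-elim (<-asym (proj₁ (All.lookup between′ z∈)) (s≤s w≤a))
    fills-post (at-v₂ refl)  w≤a = ⊥-elim (<-asym v₁<v₂ (s≤s w≤a))
    fills-post (in-post z∈)  w≤a = z∈

  μ₀-window : length μ₀ ≡ v₂ ∸ a × IsPerm μ
  μ₀-window = window⇒IsPerm μ₀ a≤v₂ (Unique-++⁻ˡ uniq-μ₀++post) μ₀-bounds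
    λ {w} a<w w≤v₂ → fills-μ₀ (covers (≤-trans (s≤s z≤n) a<w) (≤-trans w≤v₂ v₂≤n)) a<w w≤v₂
    where
    fills-μ₀ : ∀ {w} → Segment pre v₁ mid v₂ post w → a < w → w ≤ v₂ → w ∈ μ₀
    fills-μ₀ (in-pre z∈)  _   w≤v₂ = ⊥-elim (<⇒≱ (All.lookup above z∈) w≤v₂)
    fills-μ₀ (at-v₁ refl) _   _    = here refl
    fills-μ₀ (in-mid z∈)  _   _    = there (∈-++⁺ˡ z∈)
    fills-μ₀ (at-v₂ refl) _   _    = there (∈-++⁺ʳ mid (here refl))
    fills-μ₀ (in-post z∈) a<w _    = ⊥-elim (<⇒≱ (All.lookup below z∈) a<w)

  pre-window : length pre ≡ n ∸ v₂ × IsPerm x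
  pre-window = window⇒IsPerm pre v₂≤n (Unique-++⁻ˡ (proj₁ pσ)) (All.tabulate λ z∈ → All.lookup above z∈ , proj₂ (All.lookup (proj₂ pσ) (∈-++⁺ˡ z∈)))
    λ {w} v₂<w w≤n → fills-pre (covers (≤-trans (s≤s z≤n) v₂<w) w≤n) v₂<w
    where
    fills-pre : ∀ {w} → Segment pre v₁ mid v₂ post w → v₂ < w → w ∈ pre
    fills-pre (in-pre z∈)  _    = z∈
    fills-pre (at-v₁ refl) v₂<w = ⊥-elim (<-asym v₂<w v₁<v₂)
    fills-pre (in-mid z∈)  v₂<w = ⊥-elim (<-asym v₂<w (proj₂ (All.lookup between′ z∈)))
    fills-pre (at-v₂ refl) v₂<w = ⊥-elim (<-irrefl refl v₂<w)
    fills-pre (in-post z∈) v₂<w = ⊥-elim (<-asym v₂<w (<-trans (All.lookup below z∈) v₁<v₂))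

  post-perm : IsPerm post
  post-perm = subst IsPerm (map-id-local (All.tabulate λ _ → refl)) (proj₂ post-window)

  private
    length-μ : length μ ≡ v₂ ∸ a
    length-μ = trans (length-map (_∸ a) μ₀) (proj₁ μ₀-window)

  μ-framed : IsFramed μ
  μ-framed = framed (subst (2 ≤_) (sym length-μ) (m+n≤o⇒m≤o∸n 2 v₁<v₂))
    (trans (cong (_∸ a) (+-comm 1 a)) (m+n∸m≡n a 1))
    (trans (last₀-map (_∸ a) v₁ (mid ++ [ v₂ ])) (trans (cong (_∸ a) (last₀-++ (v₁ ∷ mid) v₂ [])) (sym length-μ)))

  σ≡ : pre ++ v₁ ∷ mid ++ v₂ ∷ post ≡ x ⊟ (μ ⊟ post)
  σ≡ = sym (begin
    map (length (μ ⊟ post) +_) x ++ (map (length post +_) μ ++ post)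
      ≡⟨ cong₂ (λ k l → map (k +_) x ++ (map (l +_) μ ++ post)) length-μ⊟post (proj₁ post-window) ⟩
    map (v₂ +_) x ++ (map (a +_) μ ++ post)
      ≡⟨ cong₂ (λ l l′ → l ++ (l′ ++ post)) (map-+∸ v₂ pre (All.map <⇒≤ above)) (map-+∸ a μ₀ (All.map (<⇒≤ ∘ proj₁) μ₀-bounds)) ⟩
    pre ++ (μ₀ ++ post)
      ≡⟨ cong (λ l → pre ++ v₁ ∷ l) (++-assoc mid [ v₂ ] post) ⟩
    pre ++ v₁ ∷ mid ++ v₂ ∷ post ∎)
    where
    open ≡-Reasoning
    length-μ⊟post : length (μ ⊟ post) ≡ v₂
    length-μ⊟post = trans (length-⊟ μ post) (trans (cong₂ _+_ length-μ (proj₁ post-window)) (m∸n+n≡m a≤v₂))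

split⇒FramedSplitting : ∀ {σ} → IsPerm σ → OccurrenceSplit σ → FramedSplitting σ
split⇒FramedSplitting pσ (occurrenceSplit pre zero mid v₂ post refl v₁<v₂ above between′ below) =
  ⊥-elim (<-irrefl refl (proj₁ (All.lookup (proj₂ pσ) (∈-++⁺ʳ pre (here refl)))))
split⇒FramedSplitting pσ (occurrenceSplit pre (suc a) mid v₂ post refl v₁<v₂ above between′ below) =
  framedSplitting x μ post (proj₂ pre-window) (proj₂ μ₀-window) post-perm μ-framed σ≡
  where open SplitSegments pσ v₁<v₂ above between′ below

occurrence⇒FramedSplitting : ∀ {σ} → IsPerm σ → occ Rp σ ≢ 0 → FramedSplitting σ
occurrence⇒FramedSplitting pσ occ≢0 =
  let (i , j , 1≤i , i<j , j≤n , o) = occ≢0⇒Occurrence pσ occ≢0 in split⇒FramedSplitting pσ (Occurrence⇒split 1≤i i<j j≤n o)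

module SplittingOccurrences {α μ γ : List ℕ} (pα : IsPerm α) (pμ : IsPerm μ) (pγ : IsPerm γ) (fμ : IsFramed μ) where

  private
    a b : ℕ
    a = length α
    b = length μ
    τ σ : List ℕ
    τ = μ ⊟ γ
    σ = α ⊟ τ
    pτ : IsPerm τ
    pτ = IsPerm-⊟ pμ pγ
    module Sτ = SkewSum pμ pγ
    module Sσ = SkewSum pα pτ
    length-τ : length τ ≡ b + length γ
    length-τ = length-⊟ μ γ

  occ-splitting : occ Rp γ ≡ 0 → occ Rp σ ≡ suc (occ Rp α)
  occ-splitting occ≡0 = begin
    occ Rp σ                        ≡⟨ Sσ.occ-⊟ ⟩
    occ Rp α + occ Rp τ             ≡⟨ cong (occ Rp α +_) Sτ.occ-⊟ ⟩
    occ Rp α + (occ Rp μ + occ Rp γ) ≡⟨ cong (λ k → occ Rp α + (k + occ Rp γ)) (FramedOccurrences.occ-framed pμ fμ) ⟩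
    occ Rp α + suc (occ Rp γ)       ≡⟨ cong (λ k → occ Rp α + suc k) occ≡0 ⟩
    occ Rp α + 1                    ≡⟨ +-comm (occ Rp α) 1 ⟩
    suc (occ Rp α)                  ∎
    where open ≡-Reasoning

  framed-Occurrence : Occurrence σ (a + 1) (a + b)
  framed-Occurrence = subst (Occurrence σ (a + 1)) (cong (a +_) (sym b≡1+b′))
    (Sσ.Occurrence-right⁺ (m+n≤o⇒m≤o∸n 1 (2≤length fμ)) (subst (_≤ length τ) b≡1+b′ (subst (b ≤_) (sym length-τ) (m≤m+n b _)))
      (subst (Occurrence τ 1) b≡1+b′ (Sτ.Occurrence-left⁺ ≤-refl (2≤length fμ) ≤-refl (FramedOccurrences.extremal-Occurrence pμ fμ))))
    where
    b≡1+b′ : b ≡ suc (b ∸ 1)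
    b≡1+b′ = +-∸-assoc 1 (≤-trans (s≤s z≤n) (2≤length fμ))

  Occurrence⇒inside-α-or-framed : occ Rp γ ≡ 0 → ∀ {i j} → 1 ≤ i → i < j → j ≤ length σ → Occurrence σ i j →
    j ≤ a ⊎ (i ≡ a + 1 × j ≡ a + b)
  Occurrence⇒inside-α-or-framed occ≡0 {i} {j} 1≤i i<j j≤n o with j ≤? a
  ... | yes j≤a = inj₁ j≤a
  ... | no  j≰a with i ≤? a
  ... | yes i≤a = ⊥-elim (Sσ.no-crossing-Occurrence 1≤i i≤a (≰⇒> j≰a) j≤n o)
  ... | no  i≰a with <⇒∃≡+suc (≰⇒> i≰a) | <⇒∃≡+suc (≰⇒> j≰a)
  ... | i′ , refl | j′ , refl = inj₂ (inside-τ (Sσ.Occurrence-right⁻ i′<j′ j′<τ o))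
    where
    i′<j′ : i′ < j′
    i′<j′ = ≤-pred (+-cancelˡ-< a _ _ i<j)
    j′<τ : suc j′ ≤ length τ
    j′<τ = +-cancelˡ-≤ a _ _ (subst (a + suc j′ ≤_) Sσ.length-σ j≤n)
    inside-τ : Occurrence τ (suc i′) (suc j′) → a + suc i′ ≡ a + 1 × a + suc j′ ≡ a + b
    inside-τ o′ with suc j′ ≤? b
    ... | yes j′≤b = let (i′≡ , j′≡) = FramedOccurrences.Occurrence⇒extremal pμ fμ (s≤s z≤n) (s≤s i′<j′) j′≤b
                                         (Sτ.Occurrence-left⁻ (s≤s z≤n) (s≤s i′<j′) j′≤b o′) in
                     cong (a +_) i′≡ , cong (a +_) j′≡
    ... | no  j′≰b with suc i′ ≤? b
    ... | yes i′≤b = ⊥-elim (Sτ.no-crossing-Occurrence (s≤s z≤n) i′≤b (≰⇒> j′≰b) j′<τ o′)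
    ... | no  i′≰b with <⇒∃≡+suc (≰⇒> i′≰b) | <⇒∃≡+suc (≰⇒> j′≰b)
    ... | i″ , i′≡ | j″ , j′≡ = ⊥-elim (occ≡0⇒noOccurrence pγ occ≡0 (s≤s z≤n) (s≤s i″<j″) j″<γ
                                  (Sτ.Occurrence-right⁻ i″<j″ j″<γ (subst₂ (Occurrence τ) i′≡ j′≡ o′)))
      where
      i″<j″ : i″ < j″
      i″<j″ = ≤-pred (+-cancelˡ-< b _ _ (subst₂ _<_ i′≡ j′≡ (s≤s i′<j′)))
      j″<γ : suc j″ ≤ length γ
      j″<γ = +-cancelˡ-≤ b _ _ (subst₂ _≤_ j′≡ length-τ j′<τ)

record AvoidingSplitting (σ : List ℕ) : Set where
  constructor avoidingSplitting
  field
    splitting : FramedSplitting σ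
  open FramedSplitting splitting public
  field
    γ-avoids : occ Rp γ ≡ 0

AvoidingSplitting-unique : ∀ {σ σ′} (s : AvoidingSplitting σ) (s′ : AvoidingSplitting σ′) → σ ≡ σ′ →
  AvoidingSplitting.α s ≡ AvoidingSplitting.α s′ × AvoidingSplitting.μ s ≡ AvoidingSplitting.μ s′ × AvoidingSplitting.γ s ≡ AvoidingSplitting.γ s′
AvoidingSplitting-unique s s′ σ≡σ′ = components (same-lengths (framed-position s s′ same) (framed-position s′ s (sym same)))
  where
  open AvoidingSplitting
  same : α s ⊟ (μ s ⊟ γ s) ≡ α s′ ⊟ (μ s′ ⊟ γ s′)
  same = trans (sym (σ≡ s)) (trans σ≡σ′ (σ≡ s′))
  -- Each splitting's framed occurrence lies inside the other's α or is the other's framed occurrence,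
  -- and the first option cannot hold both ways round.
  FramedPosition : ∀ {σ σ′} → AvoidingSplitting σ → AvoidingSplitting σ′ → Set
  FramedPosition s s′ = length (α s) + length (μ s) ≤ length (α s′) ⊎
    (length (α s) + 1 ≡ length (α s′) + 1 × length (α s) + length (μ s) ≡ length (α s′) + length (μ s′))
  framed-position : ∀ {σ σ′} (s : AvoidingSplitting σ) (s′ : AvoidingSplitting σ′) → α s ⊟ (μ s ⊟ γ s) ≡ α s′ ⊟ (μ s′ ⊟ γ s′) →
    FramedPosition s s′
  framed-position s s′ eq = SplittingOccurrences.Occurrence⇒inside-α-or-framed (α-perm s′) (μ-perm s′) (γ-perm s′) (μ-framed s′) (γ-avoids s′)
    (≤-trans (s≤s z≤n) (m≤n+m 1 (length (α s))))
    (+-monoʳ-< (length (α s)) (2≤length (μ-framed s)))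
    (subst (length (α s) + length (μ s) ≤_) (cong length eq) (subst (length (α s) + length (μ s) ≤_) (sym (length-⊟ (α s) _))
      (+-monoʳ-≤ (length (α s)) (subst (length (μ s) ≤_) (sym (length-⊟ (μ s) (γ s))) (m≤m+n _ _)))))
    (subst (λ τ → Occurrence τ _ _) eq (SplittingOccurrences.framed-Occurrence (α-perm s) (μ-perm s) (γ-perm s) (μ-framed s)))
  same-lengths : FramedPosition s s′ → FramedPosition s′ s → length (α s) ≡ length (α s′) × length (μ s) ≡ length (μ s′)
  same-lengths (inj₂ (a+1≡ , a+b≡)) _ = let a≡ = +-cancelʳ-≡ _ _ _ a+1≡ in a≡ , +-cancelˡ-≡ (length (α s′)) _ _ (trans (cong (_+ length (μ s)) (sym a≡)) a+b≡)
  same-lengths (inj₁ _) (inj₂ (a′+1≡ , a′+b′≡)) = let a≡ = +-cancelʳ-≡ _ _ _ a′+1≡ in sym a≡ , sym (+-cancelˡ-≡ (length (α s)) _ _ (trans (cong (_+ length (μ s′)) (sym a≡)) a′+b′≡))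
  same-lengths (inj₁ a+b≤a′) (inj₁ a′+b′≤a) = ⊥-elim (<-irrefl refl (≤-<-trans (≤-trans (m≤m+n _ (length (μ s′))) a′+b′≤a)
                                                 (<-≤-trans (m<m+n (length (α s)) (≤-trans (s≤s z≤n) (2≤length (μ-framed s)))) a+b≤a′)))
  components : length (α s) ≡ length (α s′) × length (μ s) ≡ length (μ s′) → α s ≡ α s′ × μ s ≡ μ s′ × γ s ≡ γ s′
  components (a≡ , b≡) =
    let τ-length≡ = +-cancelˡ-≡ (length (α s)) _ _ (trans (sym (length-⊟ (α s) _)) (trans (cong length same)
                      (trans (length-⊟ (α s′) _) (cong (_+ length (μ s′ ⊟ γ s′)) (sym a≡)))))
        (α≡ , τ≡) = ⊟-injective (α s) _ (α s′) _ a≡ τ-length≡ same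
        γ-length≡ = +-cancelˡ-≡ (length (μ s)) _ _ (trans (sym (length-⊟ (μ s) (γ s))) (trans τ-length≡ (trans (length-⊟ (μ s′) (γ s′)) (cong (_+ length (γ s′)) (sym b≡)))))
        (μ≡ , γ≡) = ⊟-injective (μ s) (γ s) (μ s′) (γ s′) b≡ γ-length≡ τ≡
    in α≡ , μ≡ , γ≡

private
  extend-splitting : ∀ {σ x μ y} → IsPerm x → IsPerm μ → σ ≡ x ⊟ (μ ⊟ y) → AvoidingSplitting y → AvoidingSplitting σ
  extend-splitting {σ} {x} {μ} {y} px pμ σ≡ (avoidingSplitting (framedSplitting α′ μ′ γ′ pα′ pμ′ pγ′ fμ′ y≡) γ′-avoids) =
    avoidingSplitting (framedSplitting (x ⊟ (μ ⊟ α′)) μ′ γ′ (IsPerm-⊟ px (IsPerm-⊟ pμ pα′)) pμ′ pγ′ fμ′ σ≡′) γ′-avoids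
    where
    σ≡′ : σ ≡ (x ⊟ (μ ⊟ α′)) ⊟ (μ′ ⊟ γ′)
    σ≡′ = begin
      σ                              ≡⟨ σ≡ ⟩
      x ⊟ (μ ⊟ y)                    ≡⟨ cong (λ w → x ⊟ (μ ⊟ w)) y≡ ⟩
      x ⊟ (μ ⊟ (α′ ⊟ (μ′ ⊟ γ′)))     ≡⟨ cong (x ⊟_) (⊟-assoc μ α′ (μ′ ⊟ γ′)) ⟩
      x ⊟ ((μ ⊟ α′) ⊟ (μ′ ⊟ γ′))     ≡⟨ ⊟-assoc x (μ ⊟ α′) (μ′ ⊟ γ′) ⟩
      (x ⊟ (μ ⊟ α′)) ⊟ (μ′ ⊟ γ′)     ∎
      where open ≡-Reasoning

  right-part-shorter : ∀ {σ} (s : FramedSplitting σ) → length (FramedSplitting.γ s) < length σ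
  right-part-shorter {σ} (framedSplitting x μ y _ _ _ fμ σ≡) = begin-strict
    length y                         <⟨ m<n+m (length y) (≤-trans (s≤s z≤n) (2≤length fμ)) ⟩
    length μ + length y              ≤⟨ m≤n+m _ (length x) ⟩
    length x + (length μ + length y) ≡⟨ sym (trans (length-⊟ x _) (cong (length x +_) (length-⊟ μ y))) ⟩
    length (x ⊟ (μ ⊟ y))             ≡⟨ cong length (sym σ≡) ⟩
    length σ                         ∎
    where open ≤-Reasoning

-- Split at any occurrence, then recurse into the right part.
AvoidingSplitting-exists : ∀ {σ} → IsPerm σ → occ Rp σ ≢ 0 → AvoidingSplitting σ
AvoidingSplitting-exists {σ} = go (length σ) ≤-refl
  where
  go : ∀ N {σ} → length σ ≤ N → IsPerm σ → occ Rp σ ≢ 0 → AvoidingSplitting σ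
  go zero    {[]}    _   _  occ≢0 = ⊥-elim (occ≢0 refl)
  go zero    {_ ∷ _} ()
  go (suc N) {σ}     σ≤N pσ occ≢0 = continue (occurrence⇒FramedSplitting pσ occ≢0)
    where
    continue : FramedSplitting σ → AvoidingSplitting σ
    continue s with occ Rp (FramedSplitting.γ s) ≟ 0
    ... | yes γ-avoids = avoidingSplitting s γ-avoids
    ... | no  occ-γ≢0  = extend-splitting (FramedSplitting.α-perm s) (FramedSplitting.μ-perm s) (FramedSplitting.σ≡ s)
                           (go N (≤-pred (≤-trans (right-part-shorter s) σ≤N)) (FramedSplitting.γ-perm s) occ-γ≢0)

-- Counting king permutations by their number of occurrences

length-cartesianProduct : ∀ {A B : Set} (as : List A) (bs : List B) → length (cartesianProduct as bs) ≡ length as * length bs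
length-cartesianProduct []       bs = refl
length-cartesianProduct (a ∷ as) bs = trans (length-++ (map (a ,_) bs)) (cong₂ _+_ (length-map (a ,_) bs) (length-cartesianProduct as bs))

filterᵇ-cong : ∀ {A : Set} {p q : A → Bool} → (∀ x → p x ≡ q x) → ∀ xs → filterᵇ p xs ≡ filterᵇ q xs
filterᵇ-cong {p = p} {q} p≗q = filter-≐ (T? ∘ p) (T? ∘ q) ((λ {x} → subst T (p≗q x)) , (λ {x} → subst T (sym (p≗q x))))

Graded : {X : Set} → (X → ℕ) → (ℕ → List X) → Set
Graded size xs = ∀ {k x} → x ∈ xs k → size x ≡ k

_⋆_ : {X Y : Set} → (ℕ → List X) → (ℕ → List Y) → ℕ → List (X × Y)
(xs ⋆ ys) n = concatMap (λ k → cartesianProduct (xs k) (ys (n ∸ k))) (upTo (suc n))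

module _ {X Y : Set} {xs : ℕ → List X} {ys : ℕ → List Y} where

  ∈-⋆⁻ : ∀ n {x y} → (x , y) ∈ (xs ⋆ ys) n → ∃ λ k → k ≤ n × x ∈ xs k × y ∈ ys (n ∸ k)
  ∈-⋆⁻ n xy∈ with find (∈-concatMap⁻ (λ k → cartesianProduct (xs k) (ys (n ∸ k))) {xs = upTo (suc n)} xy∈)
  ... | k , k∈ , xy∈′ = let (x∈ , y∈) = ∈-cartesianProduct⁻ (xs k) (ys (n ∸ k)) xy∈′ in k , ≤-pred (∈-upTo⁻ k∈) , x∈ , y∈

  ∈-⋆⁺ : ∀ k l {x y} → x ∈ xs k → y ∈ ys l → (x , y) ∈ (xs ⋆ ys) (k + l)
  ∈-⋆⁺ k l x∈ y∈ = ∈-concatMap⁺ (λ i → cartesianProduct (xs i) (ys (k + l ∸ i)))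
    (lose (∈-upTo⁺ (s≤s (m≤m+n k l))) (∈-cartesianProduct⁺ x∈ (subst (λ i → _ ∈ ys i) (sym (m+n∸m≡n k l)) y∈)))

  ⋆-graded : ∀ {s : X → ℕ} {t : Y → ℕ} → Graded s xs → Graded t ys → Graded (λ (x , y) → s x + t y) (xs ⋆ ys)
  ⋆-graded xs-graded ys-graded {n} xy∈ = let (k , k≤n , x∈ , y∈) = ∈-⋆⁻ n xy∈ in
    trans (cong₂ _+_ (xs-graded x∈) (ys-graded y∈)) (m+[n∸m]≡n k≤n)

  ⋆-unique : ∀ {s : X → ℕ} → Graded s xs → (∀ k → Unique (xs k)) → (∀ k → Unique (ys k)) → ∀ n → Unique ((xs ⋆ ys) n)
  ⋆-unique {s} xs-graded uxs uys n = blocks (upTo (suc n)) (Unique.upTo⁺ (suc n))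
    where
    block : ℕ → List (X × Y)
    block k = cartesianProduct (xs k) (ys (n ∸ k))
    in-block : ∀ {k xy} → xy ∈ block k → s (proj₁ xy) ≡ k
    in-block {k} {x , y} xy∈ = xs-graded (proj₁ (∈-cartesianProduct⁻ (xs k) (ys (n ∸ k)) xy∈))
    blocks : ∀ ks → Unique ks → Unique (concatMap block ks)
    blocks []       _          = []
    blocks (k ∷ ks) (k∉ ∷ uks) = Unique.++⁺ (Unique.cartesianProduct⁺ (uxs k) (uys (n ∸ k))) (blocks ks uks)
      λ (xy∈ , xy∈′) → let (k′ , k′∈ , xy∈″) = find (∈-concatMap⁻ block {xs = ks} xy∈′) in
                       All.lookup k∉ k′∈ (trans (sym (in-block xy∈)) (in-block xy∈″))

kingsWith : (ℕ → Bool) → ℕ → List (List ℕ)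
kingsWith S n = filterᵇ (S ∘ occ Rp) (K n)

framedKings : ℕ → List (List ℕ)
framedKings b = filterᵇ isFramedᵇ (K b)

avoidingKings : ℕ → List (List ℕ)
avoidingKings = kingsWith (_≡ᵇ 0)

predecessorIn : (ℕ → Bool) → ℕ → Bool
predecessorIn S zero    = false
predecessorIn S (suc k) = S k

triples : (ℕ → Bool) → ℕ → List ((List ℕ × List ℕ) × List ℕ)
triples S = (kingsWith S ⋆ framedKings) ⋆ avoidingKings

assemble : (List ℕ × List ℕ) × List ℕ → List ℕ
assemble ((α , μ) , γ) = α ⊟ (μ ⊟ γ)

length-graded : ∀ p → Graded length (λ n → filterᵇ p (K n))
length-graded p {k} σ∈ = KingPerm.length≡ (∈K⁻ k (proj₁ (∈-filterᵇ⁻ {p = p} {K k} σ∈)))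

filtered-kings-unique : ∀ p n → Unique (filterᵇ p (K n))
filtered-kings-unique p n = filterᵇ-unique p (K-unique n)

record Admissible (S : ℕ → Bool) (α μ γ : List ℕ) : Set where
  field
    α-king   : KingPerm (length α) α
    μ-king   : KingPerm (length μ) μ
    γ-king   : KingPerm (length γ) γ
    α-in-S   : T (S (occ Rp α))
    μ-framed : IsFramed μ
    γ-avoids : occ Rp γ ≡ 0

∈-triples⁻ : ∀ {S n α μ γ} → ((α , μ) , γ) ∈ triples S n → Admissible S α μ γ × length α + length μ + length γ ≡ n
∈-triples⁻ {S} {n} t∈ with ∈-⋆⁻ {xs = kingsWith S ⋆ framedKings} {ys = avoidingKings} n t∈
... | i , i≤n , αμ∈ , γ∈ with ∈-⋆⁻ {xs = kingsWith S} {ys = framedKings} i αμ∈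
... | a , a≤i , α∈ , μ∈ =
  let (α∈K , α-in-S)   = ∈-filterᵇ⁻ {p = S ∘ occ Rp} {K a} α∈
      (μ∈K , μ-framed) = ∈-filterᵇ⁻ {p = isFramedᵇ} {K (i ∸ a)} μ∈
      (γ∈K , γ-avoids) = ∈-filterᵇ⁻ {p = (_≡ᵇ 0) ∘ occ Rp} {K (n ∸ i)} γ∈
      kα = ∈K⁻ a α∈K ; kμ = ∈K⁻ (i ∸ a) μ∈K ; kγ = ∈K⁻ (n ∸ i) γ∈K
  in record { α-king = kingPerm refl (KingPerm.perm kα) (KingPerm.king kα)
            ; μ-king = kingPerm refl (KingPerm.perm kμ) (KingPerm.king kμ)
            ; γ-king = kingPerm refl (KingPerm.perm kγ) (KingPerm.king kγ)
            ; α-in-S = α-in-S ; μ-framed = T-isFramedᵇ⁻ μ-framed ; γ-avoids = ≡ᵇ⇒≡ _ 0 γ-avoids } ,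
     trans (cong₂ _+_ (trans (cong₂ _+_ (KingPerm.length≡ kα) (KingPerm.length≡ kμ)) (m+[n∸m]≡n a≤i)) (KingPerm.length≡ kγ)) (m+[n∸m]≡n i≤n)

∈-triples⁺ : ∀ {S α μ γ} → Admissible S α μ γ → ((α , μ) , γ) ∈ triples S (length α + length μ + length γ)
∈-triples⁺ {S} {α} {μ} {γ} adm = ∈-⋆⁺ {xs = kingsWith S ⋆ framedKings} {ys = avoidingKings} (length α + length μ) (length γ)
  (∈-⋆⁺ {xs = kingsWith S} {ys = framedKings} (length α) (length μ) (∈-filterᵇ⁺ {p = S ∘ occ Rp} (∈K⁺ (α-king adm)) (α-in-S adm))
                                              (∈-filterᵇ⁺ {p = isFramedᵇ} (∈K⁺ (μ-king adm)) (T-isFramedᵇ⁺ (μ-framed adm))))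
  (∈-filterᵇ⁺ {p = (_≡ᵇ 0) ∘ occ Rp} (∈K⁺ (γ-king adm)) (≡⇒≡ᵇ _ 0 (γ-avoids adm)))
  where open Admissible

triples-unique : ∀ S n → Unique (triples S n)
triples-unique S = ⋆-unique (⋆-graded (length-graded (S ∘ occ Rp)) (length-graded isFramedᵇ))
  (⋆-unique (length-graded (S ∘ occ Rp)) (filtered-kings-unique (S ∘ occ Rp)) (filtered-kings-unique isFramedᵇ))
  (filtered-kings-unique ((_≡ᵇ 0) ∘ occ Rp))

private
  in-range : ∀ {σ z} → IsPerm σ → z ∈ σ → InRange (length σ) z
  in-range pσ = All.lookup (proj₂ pσ)

isKing-splitting : ∀ {α μ γ} → IsPerm α → IsPerm γ → IsFramed μ → T (isKing α) → T (isKing μ) → T (isKing γ) → T (isKing (α ⊟ (μ ⊟ γ)))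
isKing-splitting {α} {[]}    {γ} pα pγ fμ kα kμ kγ = ⊥-elim (<⇒≱ (2≤length fμ) z≤n)
isKing-splitting {α} {m ∷ μ} {γ} pα pγ fμ kα kμ kγ =
  isKing-⊟⁺ α ((m ∷ μ) ⊟ γ) kα (isKing-⊟⁺ (m ∷ μ) γ kμ kγ (λ _ → μ-to-γ pγ)) (λ α≢[] _ → α-to-μ pα α≢[])
  where
  μ-to-γ : ∀ {γ} → IsPerm γ → γ ≢ [] → 1 < ∣ length γ + last₀ (m ∷ μ) - head₀ γ ∣
  μ-to-γ {[]}     _  γ≢[] = ⊥-elim (γ≢[] refl)
  μ-to-γ {w ∷ ws} pγ _    = far-by-2 (subst (λ l → w + 2 ≤ length (w ∷ ws) + l) (sym (last₀≡max fμ))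
                              (+-mono-≤ (proj₂ (in-range pγ (here refl))) (2≤length fμ)))
  α-to-μ : ∀ {α} → IsPerm α → α ≢ [] → 1 < ∣ length ((m ∷ μ) ⊟ γ) + last₀ α - head₀ ((m ∷ μ) ⊟ γ) ∣
  α-to-μ {[]}     _  α≢[] = ⊥-elim (α≢[] refl)
  α-to-μ {z ∷ zs} pα _    = far-by-2 (begin
    length γ + m + 2                           ≡⟨ cong (λ h → length γ + h + 2) (head₀≡1 fμ) ⟩
    length γ + 1 + 2                           ≡⟨ +-comm (length γ + 1) 2 ⟩
    2 + (length γ + 1)                         ≡⟨ sym (+-assoc 2 (length γ) 1) ⟩
    2 + length γ + 1                           ≤⟨ +-mono-≤ (+-monoˡ-≤ (length γ) (2≤length fμ)) (proj₁ (in-range pα (last₀-∈ z zs))) ⟩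
    length (m ∷ μ) + length γ + last₀ (z ∷ zs) ≡⟨ cong (_+ last₀ (z ∷ zs)) (sym (length-⊟ (m ∷ μ) γ)) ⟩
    length ((m ∷ μ) ⊟ γ) + last₀ (z ∷ zs)        ∎)
    where open ≤-Reasoning

module _ {S : ℕ → Bool} {α μ γ : List ℕ} (adm : Admissible S α μ γ) where
  open Admissible adm

  Admissible⇒AvoidingSplitting : AvoidingSplitting (α ⊟ (μ ⊟ γ))
  Admissible⇒AvoidingSplitting = avoidingSplitting
    (framedSplitting α μ γ (KingPerm.perm α-king) (KingPerm.perm μ-king) (KingPerm.perm γ-king) μ-framed refl) γ-avoids

  Admissible⇒KingPerm : KingPerm (length α + length μ + length γ) (α ⊟ (μ ⊟ γ))
  Admissible⇒KingPerm = kingPerm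
    (trans (length-⊟ α _) (trans (cong (length α +_) (length-⊟ μ γ)) (sym (+-assoc (length α) _ _))))
    (IsPerm-⊟ (KingPerm.perm α-king) (IsPerm-⊟ (KingPerm.perm μ-king) (KingPerm.perm γ-king)))
    (isKing-splitting (KingPerm.perm α-king) (KingPerm.perm γ-king) μ-framed (KingPerm.king α-king) (KingPerm.king μ-king) (KingPerm.king γ-king))

  occ-assembled : occ Rp (α ⊟ (μ ⊟ γ)) ≡ suc (occ Rp α)
  occ-assembled = SplittingOccurrences.occ-splitting (KingPerm.perm α-king) (KingPerm.perm μ-king) (KingPerm.perm γ-king) μ-framed γ-avoids

length-kingsWith-predecessorIn : ∀ S n → length (triples S n) ≡ length (kingsWith (predecessorIn S) n)
length-kingsWith-predecessorIn S n =
  length-bijection assemble (triples-unique S n) (filtered-kings-unique (predecessorIn S ∘ occ Rp) n) into injective onto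
  where
  into : ∀ {t} → t ∈ triples S n → assemble t ∈ kingsWith (predecessorIn S) n
  into {(α , μ) , γ} t∈ = let (adm , length≡) = ∈-triples⁻ {S} {n} t∈ in
    ∈-filterᵇ⁺ {p = predecessorIn S ∘ occ Rp} {K n} (∈K⁺ (subst (λ k → KingPerm k (α ⊟ (μ ⊟ γ))) length≡ (Admissible⇒KingPerm adm)))
      (subst (T ∘ predecessorIn S) (sym (occ-assembled adm)) (Admissible.α-in-S adm))
  injective : ∀ {t t′} → t ∈ triples S n → t′ ∈ triples S n → assemble t ≡ assemble t′ → t ≡ t′
  injective {(α , μ) , γ} {(α′ , μ′) , γ′} t∈ t′∈ eq =
    let (α≡ , μ≡ , γ≡) = AvoidingSplitting-unique (Admissible⇒AvoidingSplitting (proj₁ (∈-triples⁻ {S} {n} t∈)))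
                           (Admissible⇒AvoidingSplitting (proj₁ (∈-triples⁻ {S} {n} t′∈))) eq
    in cong₂ _,_ (cong₂ _,_ α≡ μ≡) γ≡
  onto : ∀ {σ} → σ ∈ kingsWith (predecessorIn S) n → ∃ λ t → t ∈ triples S n × assemble t ≡ σ
  onto {σ} σ∈ with ∈-filterᵇ⁻ {p = predecessorIn S ∘ occ Rp} {K n} σ∈
  ... | σ∈K , σ-in-S⁺ with occ Rp σ in occ≡ | σ-in-S⁺
  ... | suc k | k-in-S = ((α , μ) , γ) , subst (λ m → ((α , μ) , γ) ∈ triples S m) length≡ (∈-triples⁺ adm) , sym σ≡
    where
    kσ : KingPerm n σ
    kσ = ∈K⁻ n σ∈K
    s : AvoidingSplitting σ
    s = AvoidingSplitting-exists (KingPerm.perm kσ) (λ occ≡0 → case (trans (sym occ≡) occ≡0))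
      where
      case : suc k ≢ 0
      case ()
    open AvoidingSplitting s
    kings : T (isKing α) × T (isKing (μ ⊟ γ))
    kings = isKing-⊟⁻ α (μ ⊟ γ) (subst (T ∘ isKing) σ≡ (KingPerm.king kσ))
    kings′ : T (isKing μ) × T (isKing γ)
    kings′ = isKing-⊟⁻ μ γ (proj₂ kings)
    occ-α : occ Rp α ≡ k
    occ-α = suc-injective (trans (sym (SplittingOccurrences.occ-splitting α-perm μ-perm γ-perm μ-framed γ-avoids))
                                 (trans (cong (occ Rp) (sym σ≡)) occ≡))
    adm : Admissible S α μ γ
    adm = record { α-king = kingPerm refl α-perm (proj₁ kings) ; μ-king = kingPerm refl μ-perm (proj₁ kings′)
                 ; γ-king = kingPerm refl γ-perm (proj₂ kings′) ; α-in-S = subst (T ∘ S) (sym occ-α) k-in-S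
                 ; μ-framed = μ-framed ; γ-avoids = γ-avoids }
    length≡ : length α + length μ + length γ ≡ n
    length≡ = trans (sym (KingPerm.length≡ (Admissible⇒KingPerm adm))) (trans (cong length (sym σ≡)) (KingPerm.length≡ kσ))

-- Framed king permutations

1⊕_ : List ℕ → List ℕ
1⊕ τ = 1 ∷ map suc τ

length-∷ʳ : ∀ (τ : List ℕ) v → length (τ ∷ʳ v) ≡ suc (length τ)
length-∷ʳ τ v = trans (length-++ τ) (+-comm (length τ) 1)

IsPerm-1⊕ : ∀ {τ} → IsPerm τ → IsPerm (1⊕ τ)
IsPerm-1⊕ {τ} (uτ , rτ) =
  (All.tabulate (λ z∈ 1≡z → let (y , y∈ , z≡) = ∈-map⁻ suc z∈ in <⇒≢ (proj₁ (All.lookup rτ y∈)) (suc-injective (trans 1≡z z≡))) ∷ Unique.map⁺ suc-injective uτ) ,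
  (s≤s z≤n , s≤s z≤n) ∷ subst (λ k → All (InRange (suc k)) (map suc τ)) (sym (length-map suc τ)) (All.map⁺ (All.map (λ (_ , y≤) → s≤s z≤n , s≤s y≤) rτ))

IsPerm-1⊕⁻ : ∀ {τ′} → IsPerm (1 ∷ τ′) → Σ (List ℕ) λ τ → τ′ ≡ map suc τ × IsPerm τ
IsPerm-1⊕⁻ {τ′} (1∉ ∷ uτ′ , _ ∷ rτ′) = map pred τ′ , sym map-suc∘pred ,
  map-unique-local pred (λ z∈ z′∈ eq → trans (sym (suc∘pred z∈)) (trans (cong suc eq) (suc∘pred z′∈))) uτ′ ,
  subst (λ k → All (InRange k) (map pred τ′)) (sym (length-map pred τ′)) (All.map⁺ (All.tabulate pred-in-range))
  where
  2≤ : ∀ {z} → z ∈ τ′ → 2 ≤ z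
  2≤ z∈ = ≤∧≢⇒< (proj₁ (All.lookup rτ′ z∈)) (All.lookup 1∉ z∈)
  suc∘pred : ∀ {z} → z ∈ τ′ → suc (pred z) ≡ z
  suc∘pred {suc z} _ = refl
  suc∘pred {zero} z∈ = ⊥-elim (<⇒≱ (2≤ z∈) z≤n)
  map-suc∘pred : map suc (map pred τ′) ≡ τ′
  map-suc∘pred = trans (sym (map-∘ τ′)) (map-id-local (All.tabulate suc∘pred))
  pred-in-range : ∀ {z} → z ∈ τ′ → InRange (length τ′) (pred z)
  pred-in-range {suc (suc z)} z∈ = s≤s z≤n , ≤-pred (proj₂ (All.lookup rτ′ z∈))
  pred-in-range {suc zero}    z∈ = ⊥-elim (<-irrefl refl (2≤ z∈))
  pred-in-range {zero}        z∈ = ⊥-elim (<⇒≱ (2≤ z∈) z≤n)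

IsPerm-∷ʳ : ∀ {τ} → IsPerm τ → IsPerm (τ ∷ʳ suc (length τ))
IsPerm-∷ʳ {τ} (uτ , rτ) =
  Unique.++⁺ uτ ([] ∷ []) (λ { (z∈ , here z≡) → <-irrefl refl (subst (_≤ length τ) z≡ (proj₂ (All.lookup rτ z∈))) }) ,
  subst (λ k → All (InRange k) (τ ∷ʳ suc (length τ))) (sym (length-∷ʳ τ _))
    (All.++⁺ (All.map (λ (1≤z , z≤) → 1≤z , ≤-trans z≤ (n≤1+n _)) rτ) ((s≤s z≤n , ≤-refl) ∷ []))

IsPerm-∷ʳ⁻ : ∀ {τ v} → IsPerm (τ ∷ʳ v) → v ≡ suc (length τ) → IsPerm τ
IsPerm-∷ʳ⁻ {τ} {v} (uτv , rτv) refl = Unique-++⁻ˡ uτv , All.tabulate λ {z} z∈ →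
  let (1≤z , z≤) = All.lookup rτv (∈-++⁺ˡ z∈) in
  1≤z , ≤-pred (≤∧≢⇒< (subst (z ≤_) (length-∷ʳ τ v) z≤) (not-last uτv z∈))
  where
  not-last : ∀ {xs : List ℕ} {v z} → Unique (xs ∷ʳ v) → z ∈ xs → z ≢ v
  not-last {x ∷ xs} (x∉ ∷ _)    (here refl) = All.lookup x∉ (∈-++⁺ʳ xs (here refl))
  not-last {x ∷ xs} (_ ∷ uxsv) (there z∈)  = not-last uxsv z∈

isKing-1⊕ : ∀ x xs → isKing (1⊕ (x ∷ xs)) ≡ (1 <ᵇ x) ∧ isKing (x ∷ xs)
isKing-1⊕ x xs = cong ((1 <ᵇ x) ∧_) (isKing-shift 1 (x ∷ xs))

isKing-∷ʳ : ∀ x xs v → isKing ((x ∷ xs) ∷ʳ v) ≡ isKing (x ∷ xs) ∧ (farᵇ (last₀ (x ∷ xs)) v ∧ true)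
isKing-∷ʳ x xs v = isKing-++ x xs v []

farᵇ-suc⁻ : ∀ u m → T (farᵇ u (suc m)) → u ≢ m
farᵇ-suc⁻ u m t refl = <-irrefl (sym (∣n-1+n∣ u)) (<ᵇ⇒< 1 _ t)
  where
  ∣n-1+n∣ : ∀ n → ∣ n - suc n ∣ ≡ 1
  ∣n-1+n∣ zero    = refl
  ∣n-1+n∣ (suc n) = ∣n-1+n∣ n

farᵇ-suc⁺ : ∀ u m → u ≤ m → u ≢ m → T (farᵇ u (suc m))
farᵇ-suc⁺ u m u≤m u≢m = <⇒<ᵇ (subst (1 <_) (∣-∣-comm (suc m) u) (far-by-2 (subst (_≤ suc m) (+-comm 2 u) (s≤s (≤∧≢⇒< u≤m u≢m)))))

last₀-∷ʳ : ∀ (τ : List ℕ) v → last₀ (τ ∷ʳ v) ≡ v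
last₀-∷ʳ τ v = last₀-++ τ v []

KingPerm⇒nonempty : ∀ {m τ} → KingPerm m τ → 1 ≤ m → τ ≢ []
KingPerm⇒nonempty (kingPerm refl _ _) () refl

prepend-1 : ∀ {m τ} → KingPerm m τ → head₀ τ ≢ 1 → 1 ≤ m → KingPerm (suc m) (1⊕ τ)
prepend-1 {m} {[]}     kτ                    _     1≤m = ⊥-elim (KingPerm⇒nonempty kτ 1≤m refl)
prepend-1 {m} {x ∷ xs} (kingPerm refl pτ kτ) x≢1   _   = kingPerm (cong suc (length-map suc (x ∷ xs))) (IsPerm-1⊕ pτ)
  (subst T (sym (isKing-1⊕ x xs)) (T-∧⁺ {1 <ᵇ x} (<⇒<ᵇ (≤∧≢⇒< (proj₁ (All.lookup (proj₂ pτ) (here refl))) (x≢1 ∘ sym))) kτ))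

prepend-1⁻ : ∀ {m μ} → KingPerm (suc m) μ → head₀ μ ≡ 1 → 1 ≤ m → Σ (List ℕ) λ τ → μ ≡ 1⊕ τ × KingPerm m τ × head₀ τ ≢ 1
prepend-1⁻ {m} {.1 ∷ τ′} (kingPerm length≡ pμ kμ) refl 1≤m with IsPerm-1⊕⁻ pμ
... | τ , refl , pτ = τ , refl , kingPerm length-τ pτ (proj₂ kτ) , (λ x≡1 → <-irrefl (sym x≡1) (<ᵇ⇒< 1 _ (proj₁ kτ)))
  where
  length-τ : length τ ≡ m
  length-τ = trans (sym (length-map suc τ)) (suc-injective length≡)
  split-king : ∀ τ → τ ≢ [] → T (isKing (1⊕ τ)) → T (1 <ᵇ head₀ τ) × T (isKing τ)
  split-king []       τ≢[] _ = ⊥-elim (τ≢[] refl)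
  split-king (x ∷ xs) _    k = T-∧⁻ {1 <ᵇ x} (subst T (isKing-1⊕ x xs) k)
  kτ : T (1 <ᵇ head₀ τ) × T (isKing τ)
  kτ = split-king τ (λ { refl → <⇒≱ 1≤m (≤-reflexive (sym length-τ)) }) kμ

append-max : ∀ {m τ} → KingPerm m τ → last₀ τ ≢ m → 1 ≤ m → KingPerm (suc m) (τ ∷ʳ suc m)
append-max {m} {[]}     kτ                    _    1≤m = ⊥-elim (KingPerm⇒nonempty kτ 1≤m refl)
append-max {m} {x ∷ xs} (kingPerm refl pτ kτ) l≢m  _   = kingPerm (length-∷ʳ (x ∷ xs) _) (IsPerm-∷ʳ pτ)
  (subst T (sym (isKing-∷ʳ x xs (suc m))) (T-∧⁺ {isKing (x ∷ xs)} kτ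
    (T-∧⁺ {farᵇ (last₀ (x ∷ xs)) (suc m)} (farᵇ-suc⁺ _ m (proj₂ (All.lookup (proj₂ pτ) (last₀-∈ x xs))) l≢m) _)))

append-max⁻ : ∀ {m μ} → KingPerm (suc m) μ → last₀ μ ≡ suc m → 1 ≤ m → Σ (List ℕ) λ τ → μ ≡ τ ∷ʳ suc m × KingPerm m τ × last₀ τ ≢ m
append-max⁻ {m} {μ} (kingPerm length≡ pμ kμ) last≡ 1≤m with initLast μ
... | []       = ⊥-elim (0≢1+n length≡)
... | τ ∷ʳ′ v  with trans (sym (last₀-∷ʳ τ v)) last≡
... | refl = τ , refl , kingPerm length-τ (IsPerm-∷ʳ⁻ pμ (cong suc (sym length-τ))) (proj₁ kτ) , proj₂ kτ
  where
  length-τ : length τ ≡ m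
  length-τ = suc-injective (trans (sym (length-∷ʳ τ (suc m))) length≡)
  split-king : ∀ τ → length τ ≡ m → T (isKing (τ ∷ʳ suc m)) → T (isKing τ) × last₀ τ ≢ m
  split-king []       length≡′ _ = ⊥-elim (<⇒≱ 1≤m (≤-reflexive (sym length≡′)))
  split-king (y ∷ ys) _        k = let (ky , far) = T-∧⁻ {isKing (y ∷ ys)} (subst T (isKing-∷ʳ y ys (suc m)) k) in
    ky , farᵇ-suc⁻ _ m (proj₁ (T-∧⁻ {farᵇ (last₀ (y ∷ ys)) (suc m)} far))
  kτ : T (isKing τ) × last₀ τ ≢ m
  kτ = split-king τ length-τ kμ

head₀-∷ʳ : ∀ {τ} v → τ ≢ [] → head₀ (τ ∷ʳ v) ≡ head₀ τ
head₀-∷ʳ {[]}    v τ≢[] = ⊥-elim (τ≢[] refl)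
head₀-∷ʳ {x ∷ τ} v _    = refl

last₀-1⊕ : ∀ {τ} → τ ≢ [] → last₀ (1⊕ τ) ≡ suc (last₀ τ)
last₀-1⊕ {[]}    τ≢[] = ⊥-elim (τ≢[] refl)
last₀-1⊕ {x ∷ τ} _    = last₀-map suc x τ

∈framedKings⁻ : ∀ b {μ} → μ ∈ framedKings b → KingPerm b μ × IsFramed μ
∈framedKings⁻ b μ∈ = let (μ∈K , fμ) = ∈-filterᵇ⁻ {p = isFramedᵇ} {K b} μ∈ in ∈K⁻ b μ∈K , T-isFramedᵇ⁻ fμ

∈framedKings⁺ : ∀ {b μ} → KingPerm b μ → IsFramed μ → μ ∈ framedKings b
∈framedKings⁺ kμ fμ = ∈-filterᵇ⁺ {p = isFramedᵇ} (∈K⁺ kμ) (T-isFramedᵇ⁺ fμ)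

length-filterᵇ-split : ∀ {A : Set} (p : A → Bool) xs → length (filterᵇ p xs) + length (filterᵇ (not ∘ p) xs) ≡ length xs
length-filterᵇ-split p []       = refl
length-filterᵇ-split p (x ∷ xs) with p x
... | true  = cong suc (length-filterᵇ-split p xs)
... | false = trans (+-suc _ _) (cong suc (length-filterᵇ-split p xs))

-- Classifying king permutations of length b ≥ 2 by whether they start with 1 and end with b:
-- removing a leading 1 and/or a trailing b identifies the four classes with framed king permutations.
module FirstLastClasses (b : ℕ) (2≤b : 2 ≤ b) where

  private
    1≤b : 1 ≤ b
    1≤b = ≤-trans (s≤s z≤n) 2≤b

  startsWith1 endsWithMax : List ℕ → Bool
  startsWith1 τ = head₀ τ ≡ᵇ 1
  endsWithMax τ = last₀ τ ≡ᵇ b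

  class : (List ℕ → Bool) → (List ℕ → Bool) → List (List ℕ)
  class p q = filterᵇ q (filterᵇ p (K b))

  private
    ∈-class⁻ : ∀ {p q τ} → τ ∈ class p q → KingPerm b τ × T (p τ) × T (q τ)
    ∈-class⁻ {p} {q} τ∈ = let (τ∈′ , qτ) = ∈-filterᵇ⁻ {p = q} τ∈ ; (τ∈K , pτ) = ∈-filterᵇ⁻ {p = p} {K b} τ∈′ in ∈K⁻ b τ∈K , pτ , qτ

    ∈-class⁺ : ∀ {p q τ} → KingPerm b τ → T (p τ) → T (q τ) → τ ∈ class p q
    ∈-class⁺ {p} {q} kτ pτ qτ = ∈-filterᵇ⁺ {p = q} (∈-filterᵇ⁺ {p = p} (∈K⁺ kτ) pτ) qτ

    class-unique : ∀ p q → Unique (class p q)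
    class-unique p q = filterᵇ-unique q (filterᵇ-unique p (K-unique b))

    T-≡ᵇ⁻ : ∀ {x c} → T (x ≡ᵇ c) → x ≡ c
    T-≡ᵇ⁻ = ≡ᵇ⇒≡ _ _
    T-≢ᵇ⁻ : ∀ {x c} → T (not (x ≡ᵇ c)) → x ≢ c
    T-≢ᵇ⁻ t x≡c = T-not⁻ t (≡⇒≡ᵇ _ _ x≡c)
    T-≢ᵇ⁺ : ∀ {x c} → x ≢ c → T (not (x ≡ᵇ c))
    T-≢ᵇ⁺ x≢c = T-not⁺ (x≢c ∘ ≡ᵇ⇒≡ _ _)

  both : length (class startsWith1 endsWithMax) ≡ length (framedKings b)
  both = length-bijection (λ τ → τ) (class-unique _ _) (filtered-kings-unique isFramedᵇ b)
    (λ τ∈ → let (kτ , s , e) = ∈-class⁻ τ∈ in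
            ∈framedKings⁺ kτ (framed (subst (2 ≤_) (sym (KingPerm.length≡ kτ)) 2≤b) (T-≡ᵇ⁻ s) (trans (T-≡ᵇ⁻ e) (sym (KingPerm.length≡ kτ)))))
    (λ _ _ eq → eq)
    (λ μ∈ → let (kμ , fμ) = ∈framedKings⁻ b μ∈ in
            _ , ∈-class⁺ kμ (≡⇒≡ᵇ _ _ (head₀≡1 fμ)) (≡⇒≡ᵇ _ _ (trans (last₀≡max fμ) (KingPerm.length≡ kμ))) , refl)

  only-first : length (class startsWith1 (not ∘ endsWithMax)) ≡ length (framedKings (suc b))
  only-first = length-bijection (_∷ʳ suc b) (class-unique _ _) (filtered-kings-unique isFramedᵇ (suc b))
    (λ {τ} τ∈ → let (kτ , s , ¬e) = ∈-class⁻ τ∈ ; kτ′ = append-max kτ (T-≢ᵇ⁻ ¬e) 1≤b in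
            ∈framedKings⁺ kτ′ (framed (subst (2 ≤_) (sym (KingPerm.length≡ kτ′)) (s≤s 1≤b))
                                      (trans (head₀-∷ʳ (suc b) (KingPerm⇒nonempty kτ 1≤b)) (T-≡ᵇ⁻ s))
                                      (trans (last₀-∷ʳ τ (suc b)) (sym (KingPerm.length≡ kτ′)))))
    (λ _ _ → ∷ʳ-injectiveˡ _ _)
    (λ μ∈ → let (kμ , fμ) = ∈framedKings⁻ (suc b) μ∈
                (τ , μ≡ , kτ , l≢b) = append-max⁻ kμ (trans (last₀≡max fμ) (KingPerm.length≡ kμ)) 1≤b in
            τ , ∈-class⁺ kτ (≡⇒≡ᵇ _ _ (trans (sym (head₀-∷ʳ (suc b) (KingPerm⇒nonempty kτ 1≤b))) (trans (cong head₀ (sym μ≡)) (head₀≡1 fμ)))) (T-≢ᵇ⁺ l≢b) , sym μ≡)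

  only-last : length (class (not ∘ startsWith1) endsWithMax) ≡ length (framedKings (suc b))
  only-last = length-bijection 1⊕_ (class-unique _ _) (filtered-kings-unique isFramedᵇ (suc b))
    (λ τ∈ → let (kτ , ¬s , e) = ∈-class⁻ τ∈ ; kτ′ = prepend-1 kτ (T-≢ᵇ⁻ ¬s) 1≤b in
            ∈framedKings⁺ kτ′ (framed (subst (2 ≤_) (sym (KingPerm.length≡ kτ′)) (s≤s 1≤b)) refl
                                      (trans (last₀-1⊕ (KingPerm⇒nonempty kτ 1≤b)) (trans (cong suc (T-≡ᵇ⁻ e)) (sym (KingPerm.length≡ kτ′))))))
    (λ _ _ eq → map-injective suc-injective (∷-injectiveʳ eq))
    (λ μ∈ → let (kμ , fμ) = ∈framedKings⁻ (suc b) μ∈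
                (τ , μ≡ , kτ , h≢1) = prepend-1⁻ kμ (head₀≡1 fμ) 1≤b in
            τ , ∈-class⁺ kτ (T-≢ᵇ⁺ h≢1)
                  (≡⇒≡ᵇ _ _ (suc-injective (trans (sym (last₀-1⊕ (KingPerm⇒nonempty kτ 1≤b))) (trans (cong last₀ (sym μ≡)) (trans (last₀≡max fμ) (KingPerm.length≡ kμ)))))) ,
            sym μ≡)

  neither : length (class (not ∘ startsWith1) (not ∘ endsWithMax)) ≡ length (framedKings (suc (suc b)))
  neither = length-bijection wrap (class-unique _ _) (filtered-kings-unique isFramedᵇ (suc (suc b)))
    (λ {τ} τ∈ → let (kτ , ¬s , ¬e) = ∈-class⁻ τ∈ ; kτ′ = prepend-1 kτ (T-≢ᵇ⁻ ¬s) 1≤b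
                    kτ″ = append-max kτ′ (T-≢ᵇ⁻ ¬e ∘ suc-injective ∘ trans (sym (last₀-1⊕ (KingPerm⇒nonempty kτ 1≤b)))) (s≤s z≤n) in
            ∈framedKings⁺ kτ″ (framed (subst (2 ≤_) (sym (KingPerm.length≡ kτ″)) (s≤s (s≤s z≤n))) refl
                                      (trans (last₀-∷ʳ (1⊕ τ) (suc (suc b))) (sym (KingPerm.length≡ kτ″)))))
    (λ _ _ eq → map-injective suc-injective (∷-injectiveʳ (∷ʳ-injectiveˡ _ _ eq)))
    (λ μ∈ → let (kμ , fμ) = ∈framedKings⁻ (suc (suc b)) μ∈
                (τ′ , μ≡ , kτ′ , l≢) = append-max⁻ kμ (trans (last₀≡max fμ) (KingPerm.length≡ kμ)) (s≤s z≤n)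
                (τ , τ′≡ , kτ , h≢1) = prepend-1⁻ kτ′ (trans (sym (head₀-∷ʳ (suc (suc b)) (KingPerm⇒nonempty kτ′ (s≤s z≤n)))) (trans (cong head₀ (sym μ≡)) (head₀≡1 fμ))) 1≤b in
            τ , ∈-class⁺ kτ (T-≢ᵇ⁺ h≢1) (T-≢ᵇ⁺ (λ l≡b → l≢ (trans (cong last₀ τ′≡) (trans (last₀-1⊕ (KingPerm⇒nonempty kτ 1≤b)) (cong suc l≡b))))) ,
            sym (trans μ≡ (cong (_∷ʳ suc (suc b)) τ′≡)))
    where
    wrap : List ℕ → List ℕ
    wrap τ = (1⊕ τ) ∷ʳ suc (suc b)

  length-K : length (K b) ≡ (length (framedKings b) + length (framedKings (suc b))) + (length (framedKings (suc b)) + length (framedKings (suc (suc b))))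
  length-K = begin
    length (K b)
      ≡⟨ sym (length-filterᵇ-split startsWith1 (K b)) ⟩
    length (filterᵇ startsWith1 (K b)) + length (filterᵇ (not ∘ startsWith1) (K b))
      ≡⟨ sym (cong₂ _+_ (length-filterᵇ-split endsWithMax (filterᵇ startsWith1 (K b))) (length-filterᵇ-split endsWithMax (filterᵇ (not ∘ startsWith1) (K b)))) ⟩
    (length (class startsWith1 endsWithMax) + length (class startsWith1 (not ∘ endsWithMax))) +
    (length (class (not ∘ startsWith1) endsWithMax) + length (class (not ∘ startsWith1) (not ∘ endsWithMax)))
      ≡⟨ cong₂ _+_ (cong₂ _+_ both only-first) (cong₂ _+_ only-last neither) ⟩
    (length (framedKings b) + length (framedKings (suc b))) + (length (framedKings (suc b)) + length (framedKings (suc (suc b)))) ∎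
    where open ≡-Reasoning

module GeneratingFunctions where

  open import Data.Integer using (ℤ; +_; -_; _-_) renaming (_+_ to _+ᶻ_; _*_ to _*ᶻ_)

  gf : {X : Set} → (ℕ → List X) → Series
  gf xs n = + length (xs n)

  gf-⋆ : ∀ {X Y : Set} (xs : ℕ → List X) (ys : ℕ → List Y) → gf (xs ⋆ ys) ≋ gf xs ⊛ gf ys
  gf-⋆ {X} {Y} xs ys = coeffwise λ n → +length-concatMap n (upTo (suc n))
    where
    +length-concatMap : ∀ n ks → + length (concatMap (λ k → cartesianProduct (xs k) (ys (n ∸ k))) ks)
                                ≡ sumℤ (map (λ k → gf xs k *ᶻ gf ys (n ∸ k)) ks)
    +length-concatMap n []       = refl
    +length-concatMap n (k ∷ ks) = begin
      + length (block ++ rest)                       ≡⟨ cong +_ (length-++ block) ⟩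
      + (length block ℕ.+ length rest)               ≡⟨ ℤ.pos-+ (length block) (length rest) ⟩
      + length block +ᶻ + length rest                ≡⟨ cong₂ _+ᶻ_ (trans (cong +_ (length-cartesianProduct (xs k) (ys (n ∸ k)))) (ℤ.pos-* (length (xs k)) _))
                                                                   (+length-concatMap n ks) ⟩
      gf xs k *ᶻ gf ys (n ∸ k) +ᶻ _                  ∎
      where
      open ≡-Reasoning
      block rest : List (X × Y)
      block = cartesianProduct (xs k) (ys (n ∸ k))
      rest = concatMap (λ k → cartesianProduct (xs k) (ys (n ∸ k))) ks

  M : Series
  M = gf framedKings

  gf-triples : ∀ S → gf (triples S) ≋ (gf (kingsWith S) ⊛ M) ⊛ P
  gf-triples S = ≋-trans (gf-⋆ (kingsWith S ⋆ framedKings) avoidingKings) (⊛-cong (gf-⋆ (kingsWith S) framedKings) (≋-refl {P}))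

  A≋P+AMP : A ≋ P ⊕ ((A ⊛ M) ⊛ P)
  A≋P+AMP = coeffwise λ n → begin
    + length (K n)                                          ≡⟨ cong +_ (sym (length-filterᵇ-split ((_≡ᵇ 0) ∘ occ Rp) (K n))) ⟩
    + (length (avoidingKings n) ℕ.+ length (filterᵇ (not ∘ (_≡ᵇ 0) ∘ occ Rp) (K n)))
      ≡⟨ ℤ.pos-+ (length (avoidingKings n)) _ ⟩
    P n +ᶻ + length (filterᵇ (not ∘ (_≡ᵇ 0) ∘ occ Rp) (K n))  ≡⟨ cong (λ xs → P n +ᶻ + length xs) (filterᵇ-cong (λ σ → nonzero (occ Rp σ)) (K n)) ⟩
    P n +ᶻ + length (kingsWith (predecessorIn (λ _ → true)) n) ≡⟨ cong (λ k → P n +ᶻ + k) (sym (length-kingsWith-predecessorIn (λ _ → true) n)) ⟩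
    P n +ᶻ + length (triples (λ _ → true) n)                ≡⟨ cong (P n +ᶻ_) (coeff (gf-triples (λ _ → true)) n) ⟩
    P n +ᶻ ((gf (kingsWith (λ _ → true)) ⊛ M) ⊛ P) n        ≡⟨ cong (P n +ᶻ_) (coeff (⊛-cong (⊛-cong all-kings (≋-refl {M})) (≋-refl {P})) n) ⟩
    P n +ᶻ ((A ⊛ M) ⊛ P) n                                  ∎
    where
    open ≡-Reasoning
    nonzero : ∀ m → not (m ≡ᵇ 0) ≡ predecessorIn (λ _ → true) m
    nonzero zero    = refl
    nonzero (suc m) = refl
    all-kings : gf (kingsWith (λ _ → true)) ≋ A
    all-kings = coeffwise λ n → cong (+_ ∘ length) (filter-all (T? ∘ λ _ → true) {K n} (All.tabulate λ _ → _))

  E-column-suc : ∀ k → column (suc k) E ≋ (column k E ⊛ M) ⊛ P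
  E-column-suc k = coeffwise λ n → begin
    + length (filterᵇ (λ σ → occ Rp σ ≡ᵇ suc k) (K n))   ≡⟨ cong (+_ ∘ length) (filterᵇ-cong (λ σ → successor (occ Rp σ)) (K n)) ⟩
    + length (kingsWith (predecessorIn (_≡ᵇ k)) n)        ≡⟨ cong +_ (sym (length-kingsWith-predecessorIn (_≡ᵇ k) n)) ⟩
    + length (triples (_≡ᵇ k) n)                          ≡⟨ coeff (gf-triples (_≡ᵇ k)) n ⟩
    ((column k E ⊛ M) ⊛ P) n                              ∎
    where
    open ≡-Reasoning
    successor : ∀ m → (m ≡ᵇ suc k) ≡ predecessorIn (_≡ᵇ k) m
    successor zero    = refl
    successor (suc m) = refl

  M[1+t]²≋t²[A-t-1] : M ⊛ onePt² ≋ (tt ⊛ tt) ⊛ ((A ⊖ tt) ⊖ one)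
  M[1+t]²≋t²[A-t-1] = [1+t]²-recurrence M A refl refl recurrence
    where
    recurrence : ∀ b → A b ≡ (M b +ᶻ M (suc b)) +ᶻ (M (suc b) +ᶻ M (suc (suc b))) +ᶻ tt b +ᶻ one b
    recurrence 0 = refl
    recurrence 1 = refl
    recurrence (suc (suc b)) = begin
      + length (K (suc (suc b)))                 ≡⟨ cong +_ (FirstLastClasses.length-K (suc (suc b)) (s≤s (s≤s z≤n))) ⟩
      + ((m₀ ℕ.+ m₁) ℕ.+ (m₁ ℕ.+ m₂))            ≡⟨ trans (ℤ.pos-+ (m₀ ℕ.+ m₁) _) (cong₂ _+ᶻ_ (ℤ.pos-+ m₀ m₁) (ℤ.pos-+ m₁ m₂)) ⟩
      (+ m₀ +ᶻ + m₁) +ᶻ (+ m₁ +ᶻ + m₂)           ≡⟨ sym (trans (ℤ.+-identityʳ _) (ℤ.+-identityʳ _)) ⟩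
      (+ m₀ +ᶻ + m₁) +ᶻ (+ m₁ +ᶻ + m₂) +ᶻ + 0 +ᶻ + 0 ∎
      where
      open ≡-Reasoning
      m₀ m₁ m₂ : ℕ
      m₀ = length (framedKings (suc (suc b)))
      m₁ = length (framedKings (suc (suc (suc b))))
      m₂ = length (framedKings (suc (suc (suc (suc b)))))

  B : Series
  B = (A ⊖ tt) ⊖ one

  P⊛denP≋numP : P ⊛ denP ≋ numP
  P⊛denP≋numP = begin
    P ⊛ (onePt² ⊕ ((tt ⊛ tt) ⊛ (B ⊛ A)))        ≈⟨ expand P onePt² tt B A ⟩
    (P ⊛ onePt²) ⊕ (P ⊛ (((tt ⊛ tt) ⊛ B) ⊛ A))  ≈⟨ +-congˡ {P ⊛ onePt²} (*-congˡ {P} (*-congʳ {A} (≋-sym M[1+t]²≋t²[A-t-1]))) ⟩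
    (P ⊛ onePt²) ⊕ (P ⊛ ((M ⊛ onePt²) ⊛ A))     ≈⟨ factor P onePt² M A ⟩
    onePt² ⊛ (P ⊕ ((A ⊛ M) ⊛ P))                 ≈⟨ *-congˡ {onePt²} (≋-sym A≋P+AMP) ⟩
    onePt² ⊛ A                                   ∎
    where
    open ≋-Reasoning
    expand : ∀ p o t b a → p ⊛ (o ⊕ ((t ⊛ t) ⊛ (b ⊛ a))) ≋ (p ⊛ o) ⊕ (p ⊛ (((t ⊛ t) ⊛ b) ⊛ a))
    expand = solve 5 (λ p o t b a → p :* (o :+ t :* t :* (b :* a)) := p :* o :+ p :* (t :* t :* b :* a)) ≋-refl
    factor : ∀ p o m a → (p ⊛ o) ⊕ (p ⊛ ((m ⊛ o) ⊛ a)) ≋ o ⊛ (p ⊕ ((a ⊛ m) ⊛ p))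
    factor = solve 4 (λ p o m a → p :* o :+ p :* (m :* o :* a) := o :* (p :+ a :* m :* p)) ≋-refl

  D : ℕ → Series
  D k = column k denE

  column-denE : ∀ k → D k ≋ column k one₂ ⊕ (tt ⊛ (column k two₂ ⊕ (tt ⊛ (column k one₂ ⊕ (column k (one₂ ⊖₂ u₂) ⊛ (B ⊛ A))))))
  column-denE k =
    +-congˡ {column k one₂} (≋-trans (column-liftˡ tt X k) (*-congˡ {tt} (+-congˡ {column k two₂}
      (≋-trans (column-liftˡ tt Y k) (*-congˡ {tt} (+-congˡ {column k one₂} (column-liftʳ (one₂ ⊖₂ u₂) (B ⊛ A) k)))))))
    where
    Y X : Series₂
    Y = one₂ ⊕₂ ((one₂ ⊖₂ u₂) ⊛₂ lift (B ⊛ A))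
    X = two₂ ⊕₂ (t₂ ⊛₂ Y)

  D0≋denP : D 0 ≋ denP
  D0≋denP = begin
    D 0                                                                       ≈⟨ column-denE 0 ⟩
    one ⊕ (tt ⊛ ((one ⊕ one) ⊕ (tt ⊛ (one ⊕ (column 0 (one₂ ⊖₂ u₂) ⊛ (B ⊛ A)))))) ≈⟨ +-congˡ {one} (*-congˡ {tt} (+-congˡ {one ⊕ one} (*-congˡ {tt} (+-congˡ {one} (*-congʳ {B ⊛ A} c0))))) ⟩
    one ⊕ (tt ⊛ ((one ⊕ one) ⊕ (tt ⊛ (one ⊕ (one ⊛ (B ⊛ A))))))               ≈⟨ normalise tt (B ⊛ A) ⟩
    denP                                                                      ∎
    where
    open ≋-Reasoning
    c0 : column 0 (one₂ ⊖₂ u₂) ≋ one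
    c0 = coeffwise λ { zero → refl ; (suc _) → refl }
    normalise : ∀ t x → one ⊕ (t ⊛ ((one ⊕ one) ⊕ (t ⊛ (one ⊕ (one ⊛ x))))) ≋ ((one ⊕ t) ⊛ (one ⊕ t)) ⊕ ((t ⊛ t) ⊛ x)
    normalise = solve 2 (λ t x → con 1 :+ t :* (con 2 :+ t :* (con 1 :+ con 1 :* x)) := (con 1 :+ t) :* (con 1 :+ t) :+ t :* t :* x) ≋-refl

  D1≋-t²BA : D 1 ≋ -ˢ ((tt ⊛ tt) ⊛ (B ⊛ A))
  D1≋-t²BA = begin
    D 1                                                                              ≈⟨ column-denE 1 ⟩
    zeroˢ ⊕ (tt ⊛ (zeroˢ ⊕ (tt ⊛ (zeroˢ ⊕ (column 1 (one₂ ⊖₂ u₂) ⊛ (B ⊛ A))))))       ≈⟨ normalise tt (column 1 (one₂ ⊖₂ u₂) ⊛ (B ⊛ A)) ⟩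
    (tt ⊛ tt) ⊛ (column 1 (one₂ ⊖₂ u₂) ⊛ (B ⊛ A))                                    ≈⟨ *-congˡ {tt ⊛ tt} (≋-trans (*-congʳ {B ⊛ A} c1) (-1*x≈-x (B ⊛ A))) ⟩
    (tt ⊛ tt) ⊛ (-ˢ (B ⊛ A))                                                         ≈⟨ ≋-sym (-‿distribʳ-* (tt ⊛ tt) (B ⊛ A)) ⟩
    -ˢ ((tt ⊛ tt) ⊛ (B ⊛ A))                                                         ∎
    where
    open ≋-Reasoning
    c1 : column 1 (one₂ ⊖₂ u₂) ≋ -ˢ one
    c1 = coeffwise λ { zero → refl ; (suc _) → refl }
    normalise : ∀ t x → zeroˢ ⊕ (t ⊛ (zeroˢ ⊕ (t ⊛ (zeroˢ ⊕ x)))) ≋ (t ⊛ t) ⊛ x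
    normalise = solve 2 (λ t x → con 0 :+ t :* (con 0 :+ t :* (con 0 :+ x)) := t :* t :* x) ≋-refl

  D2+≋0 : ∀ k → D (suc (suc k)) ≋ zeroˢ
  D2+≋0 k = begin
    D (suc (suc k))                                                                  ≈⟨ column-denE (suc (suc k)) ⟩
    zeroˢ ⊕ (tt ⊛ (zeroˢ ⊕ (tt ⊛ (zeroˢ ⊕ (column (suc (suc k)) (one₂ ⊖₂ u₂) ⊛ (B ⊛ A)))))) ≈⟨ +-congˡ {zeroˢ} (*-congˡ {tt} (+-congˡ {zeroˢ} (*-congˡ {tt} (+-congˡ {zeroˢ} (*-congʳ {B ⊛ A} c2))))) ⟩
    zeroˢ ⊕ (tt ⊛ (zeroˢ ⊕ (tt ⊛ (zeroˢ ⊕ (zeroˢ ⊛ (B ⊛ A))))))                     ≈⟨ normalise tt (B ⊛ A) ⟩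
    zeroˢ                                                                            ∎
    where
    open ≋-Reasoning
    c2 : column (suc (suc k)) (one₂ ⊖₂ u₂) ≋ zeroˢ
    c2 = coeffwise λ { zero → refl ; (suc _) → refl }
    normalise : ∀ t x → zeroˢ ⊕ (t ⊛ (zeroˢ ⊕ (t ⊛ (zeroˢ ⊕ (zeroˢ ⊛ x))))) ≋ zeroˢ
    normalise = solve 2 (λ t x → con 0 :+ t :* (con 0 :+ t :* (con 0 :+ con 0 :* x)) := con 0) ≋-refl

  E-column-suc⊛denP : ∀ k → column (suc k) E ⊛ denP ≋ column k E ⊛ ((tt ⊛ tt) ⊛ (B ⊛ A))
  E-column-suc⊛denP k = begin
    column (suc k) E ⊛ denP               ≈⟨ *-congʳ {denP} (E-column-suc k) ⟩
    ((Eₖ ⊛ M) ⊛ P) ⊛ denP                 ≈⟨ ⊛-assoc (Eₖ ⊛ M) P denP ⟩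
    (Eₖ ⊛ M) ⊛ (P ⊛ denP)                 ≈⟨ *-congˡ {Eₖ ⊛ M} P⊛denP≋numP ⟩
    (Eₖ ⊛ M) ⊛ (onePt² ⊛ A)               ≈⟨ regroup Eₖ M onePt² A ⟩
    Eₖ ⊛ ((M ⊛ onePt²) ⊛ A)               ≈⟨ *-congˡ {Eₖ} (*-congʳ {A} M[1+t]²≋t²[A-t-1]) ⟩
    Eₖ ⊛ (((tt ⊛ tt) ⊛ B) ⊛ A)            ≈⟨ *-congˡ {Eₖ} (⊛-assoc (tt ⊛ tt) B A) ⟩
    Eₖ ⊛ ((tt ⊛ tt) ⊛ (B ⊛ A))            ∎
    where
    open ≋-Reasoning
    Eₖ : Series
    Eₖ = column k E
    regroup : ∀ e m o a → (e ⊛ m) ⊛ (o ⊛ a) ≋ e ⊛ ((m ⊛ o) ⊛ a)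
    regroup = solve 4 (λ e m o a → e :* m :* (o :* a) := e :* (m :* o :* a)) ≋-refl

  adjacent-columns-cancel : ∀ k → (column k E ⊛ D 1) ⊕ (column (suc k) E ⊛ D 0) ≋ zeroˢ
  adjacent-columns-cancel k = begin
    (Eₖ ⊛ D 1) ⊕ (column (suc k) E ⊛ D 0)          ≈⟨ +-cong (*-congˡ {Eₖ} D1≋-t²BA) (*-congˡ {column (suc k) E} D0≋denP) ⟩
    (Eₖ ⊛ (-ˢ X)) ⊕ (column (suc k) E ⊛ denP)      ≈⟨ +-cong (≋-sym (-‿distribʳ-* Eₖ X)) (E-column-suc⊛denP k) ⟩
    (-ˢ (Eₖ ⊛ X)) ⊕ (Eₖ ⊛ X)                        ≈⟨ -‿inverseˡ (Eₖ ⊛ X) ⟩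
    zeroˢ                                          ∎
    where
    open ≋-Reasoning
    Eₖ X : Series
    Eₖ = column k E
    X = (tt ⊛ tt) ⊛ (B ⊛ A)

  E⊛₂denE≡numE : ∀ n k → (E ⊛₂ denE) n k ≡ numE n k
  E⊛₂denE≡numE n zero = begin
    (E ⊛₂ denE) n 0            ≡⟨ ⊛₂-by-columns E denE n 0 ⟩
    (P ⊛ D 0) n +ᶻ + 0         ≡⟨ ℤ.+-identityʳ _ ⟩
    (P ⊛ D 0) n                ≡⟨ coeff (≋-trans (*-congˡ {P} D0≋denP) P⊛denP≋numP) n ⟩
    numP n                     ∎
    where open ≡-Reasoning
  E⊛₂denE≡numE n (suc k) = begin
    (E ⊛₂ denE) n (suc k)                 ≡⟨ ⊛₂-by-columns E denE n (suc k) ⟩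
    ∑< (suc (suc k)) h                    ≡⟨ trans (∑<-sucʳ (suc k) h) (cong (_+ᶻ h (suc k)) (∑<-sucʳ k h)) ⟩
    ∑< k h +ᶻ h k +ᶻ h (suc k)            ≡⟨ cong (λ x → x +ᶻ h k +ᶻ h (suc k)) (∑<-zero k vanishes) ⟩
    + 0 +ᶻ h k +ᶻ h (suc k)               ≡⟨ cong (_+ᶻ h (suc k)) (ℤ.+-identityˡ (h k)) ⟩
    h k +ᶻ h (suc k)                      ≡⟨ cong₂ (λ i j → (column k E ⊛ D i) n +ᶻ (column (suc k) E ⊛ D j) n) (m+n∸n≡m 1 k) (n∸n≡0 k) ⟩
    (column k E ⊛ D 1) n +ᶻ (column (suc k) E ⊛ D 0) n ≡⟨ coeff (adjacent-columns-cancel k) n ⟩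
    + 0                                   ∎
    where
    open ≡-Reasoning
    h : ℕ → ℤ
    h j = (column j E ⊛ D (suc k ∸ j)) n
    vanishes : ∀ j → j < k → h j ≡ + 0
    vanishes j j<k = trans (cong (λ i → (column j E ⊛ D i) n) (trans (∸-suc (m≤n⇒m≤1+n j<k)) (cong suc (∸-suc j<k))))
                           (coeff (≋-trans (*-congˡ {column j E} (D2+≋0 (k ∸ suc j))) (zeroʳ (column j E))) n)

  count : {X : Set} → (X → ℕ) → ℕ → List X → ℕ
  count f k xs = length (filterᵇ (λ x → f x ≡ᵇ k) xs)

  -- One pass over the list, so that K 8 is enumerated only once.
  countsAre : {X : Set} → (X → ℕ) → List X → ℕ → ℕ → Bool
  countsAre f []       a b = (a ≡ᵇ 0) ∧ (b ≡ᵇ 0)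
  countsAre f (x ∷ xs) a b with f x | a | b
  ... | 0 | suc a′ | b′     = countsAre f xs a′ b′
  ... | 1 | a′     | suc b′ = countsAre f xs a′ b′
  ... | _ | _      | _      = false

  countsAre-sound : ∀ {X : Set} (f : X → ℕ) xs a b → T (countsAre f xs a b) →
    count f 0 xs ≡ a × count f 1 xs ≡ b × (∀ k → count f (suc (suc k)) xs ≡ 0)
  countsAre-sound f []       a b t = let (a≡0 , b≡0) = T-∧⁻ {a ≡ᵇ 0} t in sym (≡ᵇ⇒≡ a 0 a≡0) , sym (≡ᵇ⇒≡ b 0 b≡0) , λ _ → refl
  countsAre-sound f (x ∷ xs) a b t with f x | a | b
  ... | 0 | suc a′ | b′     = let (p , q , r) = countsAre-sound f xs a′ b′ t in cong suc p , q , r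
  ... | 1 | a′     | suc b′ = let (p , q , r) = countsAre-sound f xs a′ b′ t in p , cong suc q , r

  E≡Einit-from-counts : ∀ n a b → T (countsAre (occ Rp) (K n) a b) → Einit n 0 ≡ + a → Einit n 1 ≡ + b → (∀ k → Einit n (suc (suc k)) ≡ + 0) →
    ∀ k → E n k ≡ Einit n k
  E≡Einit-from-counts n a b t e₀ e₁ e₂₊ k with countsAre-sound (occ Rp) (K n) a b t | k
  ... | c₀ , _  , _   | 0           = trans (cong +_ c₀) (sym e₀)
  ... | _  , c₁ , _   | 1           = trans (cong +_ c₁) (sym e₁)
  ... | _  , _  , c₂₊ | suc (suc k) = trans (cong +_ (c₂₊ k)) (sym (e₂₊ k))

  E≡Einit : ∀ n k → n ≤ 8 → E n k ≡ Einit n k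
  E≡Einit 0 k _ = E≡Einit-from-counts 0 1    0  _ refl refl (λ _ → refl) k
  E≡Einit 1 k _ = E≡Einit-from-counts 1 1    0  _ refl refl (λ _ → refl) k
  E≡Einit 2 k _ = E≡Einit-from-counts 2 0    0  _ refl refl (λ _ → refl) k
  E≡Einit 3 k _ = E≡Einit-from-counts 3 0    0  _ refl refl (λ _ → refl) k
  E≡Einit 4 k _ = E≡Einit-from-counts 4 2    0  _ refl refl (λ _ → refl) k
  E≡Einit 5 k _ = E≡Einit-from-counts 5 14   0  _ refl refl (λ _ → refl) k
  E≡Einit 6 k _ = E≡Einit-from-counts 6 88   2  _ refl refl (λ _ → refl) k
  E≡Einit 7 k _ = E≡Einit-from-counts 7 632  14 _ refl refl (λ _ → refl) k
  E≡Einit 8 k _ = E≡Einit-from-counts 8 5152 90 _ refl refl (λ _ → refl) k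
  E≡Einit (suc (suc (suc (suc (suc (suc (suc (suc (suc _))))))))) _ (s≤s (s≤s (s≤s (s≤s (s≤s (s≤s (s≤s (s≤s ()))))))))

open GeneratingFunctions

theorem4p4 : (∀ n → (P ⊛ denP) n ≡ numP n)
           × (∀ n k → (E ⊛₂ denE) n k ≡ numE n k)
           × (∀ n k → n ≤ 8 → E n k ≡ Einit n k)
theorem4p4 = coeff P⊛denP≋numP , E⊛₂denE≡numE , E≡Einit
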